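{- For every integer $n\geq 2$, $$a_n(3412,4321;213)=a_n(3412,4321;312)=P_{n-1},$$ where $P_m$ is the $m$-th Pell number.
   Context: A permutation $\pi$ of $[n]=\{1,\dots,n\}$ is cyclic if it consists of a single $n$-cycle. Its one-line notation is $\pi_1\pi_2\cdots\pi_n$ with $\pi_i=\pi(i)$. Its standard cycle form is $(c_1,c_2,\dots,c_n)$ with $c_1=1$ and $c_{i+1}=\pi(c_i)$ for $1\le i<n$. A sequence $w_1\cdots w_n$ of distinct integers contains a pattern $\sigma=\sigma_1\cdots\sigma_k\in S_k$ if there are indices $i_1<\dots<i_k$ with $w_{i_s}>w_{i_t}$ iff $\sigma_s>\sigma_t$ for all $s<t$; otherwise it avoids $\sigma$. $\mathcal{A}_n(\sigma_1,\dots,\sigma_l;\rho)$ is the set of cyclic permutations of $[n]$ whose one-line notation avoids each $\sigma_i$ and whose standard cycle form $c_1\cdots c_n$, read as a sequence, avoids $\rho$; $a_n(\sigma_1,\dots,\sigma_l;\rho)$ is its cardinality. Pell numbers: $P_0=0$, $P_1=1$, $P_m=2P_{m-1}+P_{m-2}$ for $m\ge 2$. -}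

module Defs where

open import Data.Nat using (ℕ; zero; suc; _∸_; _+_; _*_; _<ᵇ_)
open import Data.Bool using (Bool; true; false; _∧_; not; if_then_else_)
open import Data.List using (List; []; _∷_; map; length; filter; concatMap; upTo; zip; _++_)
open import Data.Bool.ListAction using (all; any)
open import Data.Product using (_×_; _,_)
open import Data.List.Relation.Unary.Unique.DecPropositional using (unique?)
open import Data.Nat.Properties using (_≟_)
open import Relation.Nullary using (does)

pell : ℕ → ℕ
pell zero = 0
pell (suc zero) = 1
pell (suc (suc m)) = 2 * pell (suc m) + pell m

range1 : ℕ → List ℕ
range1 n = map suc (upTo n)

words : List ℕ → ℕ → List (List ℕ)
words xs zero = [] ∷ []
words xs (suc k) = concatMap (λ x → map (x ∷_) (words xs k)) xs

distinctᵇ : List ℕ → Bool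
distinctᵇ w = does (unique? _≟_ w)

-- one-line notations of all permutations of [n]:
-- words of length n over [n] with pairwise distinct letters
perms : ℕ → List (List ℕ)
perms n = filter (λ w → unique? _≟_ w) (words (range1 n) n)

subseqs : {A : Set} → ℕ → List A → List (List A)
subseqs zero _ = [] ∷ []
subseqs (suc k) [] = []
subseqs (suc k) (x ∷ xs) = map (x ∷_) (subseqs k xs) ++ subseqs (suc k) xs

pairs : {A : Set} → List A → List (A × A)
pairs [] = []
pairs (x ∷ xs) = map (x ,_) xs ++ pairs xs

_==ᵇ_ : Bool → Bool → Bool
true ==ᵇ b = b
false ==ᵇ b = not b

orderIsoᵇ : List ℕ → List ℕ → Bool
orderIsoᵇ u σ =
  all (λ { ((us , σs) , (ut , σt)) → (ut <ᵇ us) ==ᵇ (σt <ᵇ σs) }) (pairs (zip u σ))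

containsᵇ : List ℕ → List ℕ → Bool
containsᵇ w σ = any (λ u → orderIsoᵇ u σ) (subseqs (length σ) w)

avoidsᵇ : List ℕ → List ℕ → Bool
avoidsᵇ w σ = not (containsᵇ w σ)

-- π(i) for one-line notation w = π(1) ... π(n)  (0 outside [n])
app : List ℕ → ℕ → ℕ
app [] _ = 0
app (x ∷ xs) zero = 0
app (x ∷ xs) (suc zero) = x
app (x ∷ xs) (suc (suc i)) = app xs (suc i)

orbitFrom : List ℕ → ℕ → ℕ → List ℕ
orbitFrom w zero c = []
orbitFrom w (suc k) c = c ∷ orbitFrom w k (app w c)

-- standard cycle form (c_1,...,c_n): c_1 = 1, c_{i+1} = π(c_i)
cycleForm : List ℕ → List ℕ
cycleForm w = orbitFrom w (length w) 1

-- a permutation of [n] is cyclic iff 1, π(1), ..., π^{n-1}(1) are distinct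
cyclicᵇ : List ℕ → Bool
cyclicᵇ w = distinctᵇ (cycleForm w)

boolFilter : {A : Set} → (A → Bool) → List A → List A
boolFilter p [] = []
boolFilter p (x ∷ xs) = if p x then x ∷ boolFilter p xs else boolFilter p xs

𝒜 : ℕ → List (List ℕ) → List ℕ → List (List ℕ)
𝒜 n σs ρ = boolFilter
  (λ w → cyclicᵇ w ∧ all (avoidsᵇ w) σs ∧ avoidsᵇ (cycleForm w) ρ) (perms n)

a : ℕ → List (List ℕ) → List ℕ → ℕ
a n σs ρ = length (𝒜 n σs ρ)

{-# OPTIONS --safe #-}
-- In cycle form, let n ≥ 4 be the largest value. In a cyclic permutation whose one-line notation
-- avoids 3412 and 4321 and whose cycle form avoids 213 (resp. 312), the three largest values sit in
-- one of three configurations: n - 1 immediately followed by n, n immediately followed by n - 1, or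
-- n, n - 2, n - 1 consecutively (resp. n - 1, n - 2, n); every other placement produces one of the
-- forbidden patterns. Deleting n in the first two cases, and n and n - 1 in the third, is a bijection
-- onto two copies of the permutations of size n - 1 and one copy of those of size n - 2. Hence
-- a_n = 2 a_(n-1) + a_(n-2), which with a_2 = 1 and a_3 = 2 is the Pell recurrence.

module Submission where

open import Defs
open import Data.Nat hiding (_!)
open import Data.Nat.Properties
open import Data.List hiding (any; all; find)
open import Data.List.Properties using (length-map; length-++; length-applyUpTo; length-upTo; map-∘; ∷-injective)
open import Data.Bool using (Bool; true; false; _∧_; not)
open import Data.Bool.Properties using (T-≡)
open import Data.Bool.ListAction using (any)
open import Data.Product using (∃; _×_; _,_; proj₁; proj₂)
import Data.Product as Product
open import Data.Sum using (_⊎_; inj₁; inj₂)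
open import Data.Empty
open import Function using (_∘_; id)
open import Function.Bundles using (Equivalence)
open import Relation.Nullary
open import Relation.Binary.PropositionalEquality
open import Relation.Binary.Definitions using (Tri; tri<; tri≈; tri>)
open import Data.List.Membership.Propositional
open import Data.List.Membership.Propositional.Properties
open import Data.List.Membership.DecPropositional _≟_ using (_∈?_)
open import Data.List.Relation.Binary.Subset.Propositional using (_⊆_)
open import Data.List.Relation.Unary.All using (All; []; _∷_)
import Data.List.Relation.Unary.All as All
import Data.List.Relation.Unary.All.Properties as Allₚ
open import Data.List.Relation.Unary.Any using (here; there)
import Data.List.Relation.Unary.Any as Any
open import Data.List.Relation.Unary.Any.Properties using (any⁺; any⁻)
open import Data.List.Relation.Unary.AllPairs using (AllPairs; []; _∷_)
import Data.List.Relation.Unary.AllPairs as AllPairs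
import Data.List.Relation.Unary.AllPairs.Properties as AllPairsₚ
open import Data.List.Relation.Unary.Unique.Propositional using (Unique)
import Data.List.Relation.Unary.Unique.Propositional.Properties as Uniqueₚ
open import Data.List.Relation.Unary.Unique.DecPropositional using (unique?)
open import Data.List.Relation.Binary.Disjoint.Propositional using (Disjoint)

_!_ : List ℕ → ℕ → ℕ
w ! i = app w (suc i)

app-map : ∀ (g : ℕ → ℕ) xs i → i < length xs → map g xs ! i ≡ g (xs ! i)
app-map g (x ∷ xs) zero _ = refl
app-map g (x ∷ xs) (suc i) (s≤s p) = app-map g xs i p

app-applyUpTo : ∀ (f : ℕ → ℕ) n i → i < n → applyUpTo f n ! i ≡ f i
app-applyUpTo f (suc n) zero _ = refl
app-applyUpTo f (suc n) (suc i) (s≤s p) = app-applyUpTo (f ∘ suc) n i p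

build : ℕ → (ℕ → ℕ) → List ℕ
build M f = applyUpTo (λ i → f (suc i)) M

app-build : ∀ M f i → i < M → build M f ! i ≡ f (suc i)
app-build M f i p = app-applyUpTo (λ i → f (suc i)) M i p

length-build : ∀ M f → length (build M f) ≡ M
length-build M f = length-applyUpTo (λ i → f (suc i)) M

list-ext : ∀ xs ys → length xs ≡ length ys → (∀ i → i < length xs → xs ! i ≡ ys ! i) → xs ≡ ys
list-ext [] [] _ _ = refl
list-ext (x ∷ xs) (y ∷ ys) e h =
  cong₂ _∷_ (h zero (s≤s z≤n)) (list-ext xs ys (suc-injective e) (λ i p → h (suc i) (s≤s p)))

All-app : ∀ {P : ℕ → Set} xs → All P xs → ∀ i → i < length xs → P (xs ! i)
All-app (x ∷ xs) (px ∷ _) zero _ = px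
All-app (x ∷ xs) (_ ∷ pxs) (suc i) (s≤s p) = All-app xs pxs i p

app-All : ∀ {P : ℕ → Set} xs → (∀ i → i < length xs → P (xs ! i)) → All P xs
app-All [] h = []
app-All (x ∷ xs) h = h zero (s≤s z≤n) ∷ app-All xs (λ i p → h (suc i) (s≤s p))

∈⇒index : ∀ {x} xs → x ∈ xs → ∃ λ i → i < length xs × xs ! i ≡ x
∈⇒index (y ∷ xs) (here refl) = zero , s≤s z≤n , refl
∈⇒index (y ∷ xs) (there p) with ∈⇒index xs p
... | i , q , e = suc i , s≤s q , e

index⇒∈ : ∀ xs i → i < length xs → xs ! i ∈ xs
index⇒∈ (x ∷ xs) zero _ = here refl
index⇒∈ (x ∷ xs) (suc i) (s≤s p) = there (index⇒∈ xs i p)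

Inj : List ℕ → Set
Inj xs = ∀ i j → i < length xs → j < length xs → xs ! i ≡ xs ! j → i ≡ j

unique⇒inj : ∀ xs → Unique xs → Inj xs
unique⇒inj (x ∷ xs) (px ∷ u) zero zero _ _ _ = refl
unique⇒inj (x ∷ xs) (px ∷ u) zero (suc j) _ (s≤s q) e = ⊥-elim (All-app xs px j q e)
unique⇒inj (x ∷ xs) (px ∷ u) (suc i) zero (s≤s p) _ e = ⊥-elim (All-app xs px i p (sym e))
unique⇒inj (x ∷ xs) (px ∷ u) (suc i) (suc j) (s≤s p) (s≤s q) e = cong suc (unique⇒inj xs u i j p q e)

inj⇒unique : ∀ xs → Inj xs → Unique xs
inj⇒unique [] h = []
inj⇒unique (x ∷ xs) h =
  app-All xs (λ j q e → 0≢1+n (h zero (suc j) (s≤s z≤n) (s≤s q) e))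
  ∷ inj⇒unique xs (λ i j p q e → suc-injective (h (suc i) (suc j) (s≤s p) (s≤s q) e))

remove-∈ : ∀ {A : Set} {x z : A} ys zs → z ∈ ys ++ x ∷ zs → z ≢ x → z ∈ ys ++ zs
remove-∈ [] zs (here refl) ne = ⊥-elim (ne refl)
remove-∈ [] zs (there p) ne = p
remove-∈ (y ∷ ys) zs (here refl) ne = here refl
remove-∈ (y ∷ ys) zs (there p) ne = there (remove-∈ ys zs p ne)

unique-length : ∀ {A : Set} (xs ys : List A) → Unique xs → xs ⊆ ys → length xs ≤ length ys
unique-length [] ys u h = z≤n
unique-length (x ∷ xs) ys (px ∷ u) h with ∈-∃++ (h (here refl))
... | ys₁ , ys₂ , refl = begin
  suc (length xs)               ≤⟨ s≤s (unique-length xs (ys₁ ++ ys₂) u xs⊆) ⟩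
  suc (length (ys₁ ++ ys₂))     ≡⟨ cong suc (length-++ ys₁) ⟩
  suc (length ys₁ + length ys₂) ≡⟨ +-suc (length ys₁) (length ys₂) ⟨
  length ys₁ + length (x ∷ ys₂) ≡⟨ length-++ ys₁ ⟨
  length (ys₁ ++ x ∷ ys₂)       ∎
  where
  open ≤-Reasoning
  xs⊆ : xs ⊆ ys₁ ++ ys₂
  xs⊆ z∈ = remove-∈ ys₁ ys₂ (h (there z∈)) (λ e → All.lookup px z∈ (sym e))

unique-⊆-⊇-length : ∀ {A : Set} (xs ys : List A) → Unique xs → Unique ys → xs ⊆ ys → ys ⊆ xs →
  length xs ≡ length ys
unique-⊆-⊇-length xs ys uxs uys xs⊆ys ys⊆xs =
  ≤-antisym (unique-length xs ys uxs xs⊆ys) (unique-length ys xs uys ys⊆xs)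

∈-subseqs⁻ : ∀ k (xs u : List ℕ) → u ∈ subseqs k xs →
  ∃ λ is → length is ≡ k × AllPairs _<_ is × All (_< length xs) is × u ≡ map (xs !_) is
∈-subseqs⁻ zero xs .[] (here refl) = [] , refl , [] , [] , refl
∈-subseqs⁻ (suc k) (x ∷ xs) u p with ∈-++⁻ (map (x ∷_) (subseqs k xs)) p
... | inj₁ q with ∈-map⁻ (x ∷_) q
...   | u' , u'∈ , refl with ∈-subseqs⁻ k xs u' u'∈
...     | is , l , ap , al , refl =
  zero ∷ map suc is , cong suc (trans (length-map suc is) l) ,
  Allₚ.map⁺ (All.universal (λ _ → s≤s z≤n) is) ∷ AllPairsₚ.map⁺ (AllPairs.map s≤s ap) ,
  s≤s z≤n ∷ Allₚ.map⁺ (All.map s≤s al) , cong (x ∷_) (map-∘ is)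
∈-subseqs⁻ (suc k) (x ∷ xs) u p | inj₂ q with ∈-subseqs⁻ (suc k) xs u q
... | is , l , ap , al , refl =
  map suc is , trans (length-map suc is) l ,
  AllPairsₚ.map⁺ (AllPairs.map s≤s ap) , Allₚ.map⁺ (All.map s≤s al) , map-∘ is

index-shift : ∀ x xs off js → All (off <_) js →
  map (λ i → (x ∷ xs) ! (i ∸ off)) js ≡ map (λ i → xs ! (i ∸ suc off)) js
index-shift x xs off [] [] = refl
index-shift x xs off (suc j ∷ js) (s≤s b ∷ bs) rewrite +-∸-assoc 1 b = cong (_ ∷_) (index-shift x xs off js bs)

index-bounds-shift : ∀ (xs : List ℕ) off js → All (off <_) js → All (λ i → off ≤ i × i < off + suc (length xs)) js →
  All (λ i → suc off ≤ i × i < suc off + length xs) js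
index-bounds-shift xs off js bs cs =
  All.zipWith (λ {i} (b , (_ , c)) → b , subst (i <_) (+-suc off (length xs)) c) (bs , cs)

-- Indices are offset by off so that the recursion can drop the head of xs without renumbering.
∈-subseqs⁺ : ∀ (xs : List ℕ) off is → AllPairs _<_ is → All (λ i → off ≤ i × i < off + length xs) is →
  map (λ i → xs ! (i ∸ off)) is ∈ subseqs (length is) xs
∈-subseqs⁺ xs off [] _ _ = here refl
∈-subseqs⁺ [] off (i ∷ is) _ ((p , q) ∷ _) =
  ⊥-elim (<-irrefl refl (≤-<-trans p (subst (i <_) (+-identityʳ off) q)))
∈-subseqs⁺ (x ∷ xs) off (i ∷ is) (a ∷ ap) ((p , q) ∷ al) with m≤n⇒m<n∨m≡n p
... | inj₂ refl rewrite n∸n≡0 off =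
  ∈-++⁺ˡ (subst (λ l → x ∷ l ∈ map (x ∷_) (subseqs (length is) xs)) (sym (index-shift x xs off is a))
           (∈-map⁺ (x ∷_) (∈-subseqs⁺ xs (suc off) is ap (index-bounds-shift xs off is a al))))
... | inj₁ off<i =
  ∈-++⁺ʳ (map (x ∷_) (subseqs (length is) xs))
    (subst (λ l → l ∈ subseqs (suc (length is)) xs) (sym (index-shift x xs off (i ∷ is) off<is))
      (∈-subseqs⁺ xs (suc off) (i ∷ is) (a ∷ ap) (index-bounds-shift xs off (i ∷ is) off<is ((p , q) ∷ al))))
  where
  off<is : All (off <_) (i ∷ is)
  off<is = off<i ∷ All.map (<-trans off<i) a

any≡true⁻ : ∀ {A : Set} (p : A → Bool) xs → any p xs ≡ true → ∃ λ x → x ∈ xs × p x ≡ true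
any≡true⁻ p xs e with find (any⁻ p xs (Equivalence.from T-≡ e))
... | x , x∈ , px = x , x∈ , Equivalence.to T-≡ px

any≡true⁺ : ∀ {A : Set} (p : A → Bool) xs x → x ∈ xs → p x ≡ true → any p xs ≡ true
any≡true⁺ p xs x x∈ px = Equivalence.to T-≡ (any⁺ p (lose x∈ (Equivalence.from T-≡ px)))

Occ4 : List ℕ → List ℕ → Set
Occ4 w σ = ∃ λ i → ∃ λ j → ∃ λ k → ∃ λ l → i < j × j < k × k < l × l < length w ×
  orderIsoᵇ (w ! i ∷ w ! j ∷ w ! k ∷ w ! l ∷ []) σ ≡ true

OccSeq : (ℕ → ℕ) → ℕ → List ℕ → Set
OccSeq o M ρ = ∃ λ i → ∃ λ j → ∃ λ k → i < j × j < k × k < M ×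
  orderIsoᵇ (o i ∷ o j ∷ o k ∷ []) ρ ≡ true

OccSeq-cong : ∀ {o o' M ρ} → (∀ t → t < M → o t ≡ o' t) → OccSeq o M ρ → OccSeq o' M ρ
OccSeq-cong {ρ = ρ} h (i , j , k , ij , jk , kM , iso) =
  i , j , k , ij , jk , kM ,
  subst (λ z → orderIsoᵇ z ρ ≡ true)
    (cong₂ _∷_ (h i (<-trans ij (<-trans jk kM))) (cong₂ _∷_ (h j (<-trans jk kM)) (cong (_∷ []) (h k kM)))) iso

contains⇒occ4 : ∀ w s1 s2 s3 s4 → containsᵇ w (s1 ∷ s2 ∷ s3 ∷ s4 ∷ []) ≡ true → Occ4 w (s1 ∷ s2 ∷ s3 ∷ s4 ∷ [])
contains⇒occ4 w s1 s2 s3 s4 e with any≡true⁻ _ (subseqs 4 w) e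
... | u , u∈ , iso with ∈-subseqs⁻ 4 w u u∈
... | i ∷ j ∷ k ∷ l ∷ [] , _ , (ij ∷ _ ∷ _ ∷ []) ∷ (jk ∷ _ ∷ []) ∷ (kl ∷ []) ∷ [] ∷ [] , _ ∷ _ ∷ _ ∷ lw ∷ [] , refl
  = i , j , k , l , ij , jk , kl , lw , iso

occ4⇒contains : ∀ w s1 s2 s3 s4 → Occ4 w (s1 ∷ s2 ∷ s3 ∷ s4 ∷ []) → containsᵇ w (s1 ∷ s2 ∷ s3 ∷ s4 ∷ []) ≡ true
occ4⇒contains w s1 s2 s3 s4 (i , j , k , l , ij , jk , kl , lw , iso) =
  any≡true⁺ _ (subseqs 4 w) _
    (∈-subseqs⁺ w 0 (i ∷ j ∷ k ∷ l ∷ [])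
       ((ij ∷ <-trans ij jk ∷ <-trans (<-trans ij jk) kl ∷ []) ∷ (jk ∷ <-trans jk kl ∷ []) ∷ (kl ∷ []) ∷ [] ∷ [])
       ((z≤n , il) ∷ (z≤n , jl) ∷ (z≤n , kl') ∷ (z≤n , lw) ∷ []))
    iso
  where
  kl' = <-trans kl lw
  jl = <-trans jk kl'
  il = <-trans ij jl

contains⇒occ3 : ∀ w s1 s2 s3 → containsᵇ w (s1 ∷ s2 ∷ s3 ∷ []) ≡ true → OccSeq (w !_) (length w) (s1 ∷ s2 ∷ s3 ∷ [])
contains⇒occ3 w s1 s2 s3 e with any≡true⁻ _ (subseqs 3 w) e
... | u , u∈ , iso with ∈-subseqs⁻ 3 w u u∈
... | i ∷ j ∷ k ∷ [] , _ , (ij ∷ _ ∷ []) ∷ (jk ∷ []) ∷ [] ∷ [] , _ ∷ _ ∷ kw ∷ [] , refl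
  = i , j , k , ij , jk , kw , iso

occ3⇒contains : ∀ w s1 s2 s3 → OccSeq (w !_) (length w) (s1 ∷ s2 ∷ s3 ∷ []) → containsᵇ w (s1 ∷ s2 ∷ s3 ∷ []) ≡ true
occ3⇒contains w s1 s2 s3 (i , j , k , ij , jk , kw , iso) =
  any≡true⁺ _ (subseqs 3 w) _
    (∈-subseqs⁺ w 0 (i ∷ j ∷ k ∷ [])
       ((ij ∷ <-trans ij jk ∷ []) ∷ (jk ∷ []) ∷ [] ∷ [])
       ((z≤n , <-trans ij jw) ∷ (z≤n , jw) ∷ (z≤n , kw) ∷ []))
    iso
  where
  jw = <-trans jk kw

∈-words⁻ : ∀ xs k w → w ∈ words xs k → length w ≡ k × All (_∈ xs) w
∈-words⁻ xs zero .[] (here refl) = refl , []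
∈-words⁻ xs (suc k) w p with find (∈-concatMap⁻ (λ x → map (x ∷_) (words xs k)) {xs = xs} p)
... | x , x∈ , q with ∈-map⁻ (x ∷_) q
... | w' , w'∈ , refl with ∈-words⁻ xs k w' w'∈
... | l , a = cong suc l , x∈ ∷ a

∈-words⁺ : ∀ xs k w → length w ≡ k → All (_∈ xs) w → w ∈ words xs k
∈-words⁺ xs zero [] _ _ = here refl
∈-words⁺ xs (suc k) (y ∷ w) l (y∈ ∷ a) =
  ∈-concatMap⁺ (λ x → map (x ∷_) (words xs k)) {xs = xs}
    (Any.map (λ { refl → ∈-map⁺ (y ∷_) (∈-words⁺ xs k w (suc-injective l) a) }) y∈)

unique-words : ∀ xs k → Unique xs → Unique (words xs k)
unique-words xs zero u = [] ∷ []
unique-words xs (suc k) u = go xs u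
  where
  W = words xs k
  go : ∀ ys → Unique ys → Unique (concatMap (λ x → map (x ∷_) W) ys)
  go [] _ = []
  go (y ∷ ys) (py ∷ uy) =
    Uniqueₚ.++⁺ (Uniqueₚ.map⁺ (λ e → proj₂ (∷-injective e)) (unique-words xs k u)) (go ys uy) disjoint
    where
    disjoint : Disjoint (map (y ∷_) W) (concatMap (λ x → map (x ∷_) W) ys)
    disjoint (p , q) with ∈-map⁻ (y ∷_) p
    ... | _ , _ , refl with find (∈-concatMap⁻ (λ x → map (x ∷_) W) {xs = ys} q)
    ... | x , x∈ , r with ∈-map⁻ (x ∷_) r
    ... | _ , _ , e = All.lookup py x∈ (proj₁ (∷-injective e))

app-range1 : ∀ n i → i < n → range1 n ! i ≡ suc i
app-range1 n i p = trans (app-map suc (upTo n) i (subst (i <_) (sym (length-upTo n)) p))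
                         (cong suc (app-applyUpTo id n i p))

length-range1 : ∀ n → length (range1 n) ≡ n
length-range1 n = trans (length-map suc (upTo n)) (length-upTo n)

∈-range1⁻ : ∀ n x → x ∈ range1 n → 1 ≤ x × x ≤ n
∈-range1⁻ n x p with ∈⇒index (range1 n) p
... | i , il , e rewrite length-range1 n | app-range1 n i il = subst (λ y → 1 ≤ y × y ≤ n) e (s≤s z≤n , il)

∈-range1⁺ : ∀ n x → 1 ≤ x → x ≤ n → x ∈ range1 n
∈-range1⁺ n (suc x) _ p =
  subst (_∈ range1 n) (app-range1 n x p) (index⇒∈ (range1 n) x (subst (x <_) (sym (length-range1 n)) p))

unique-range1 : ∀ n → Unique (range1 n)
unique-range1 n = inj⇒unique (range1 n) λ i j p q e →
  suc-injective (trans (sym (app-range1 n i (subst (i <_) (length-range1 n) p)))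
                (trans e (app-range1 n j (subst (j <_) (length-range1 n) q))))

does-unique⁻ : ∀ w → does (unique? _≟_ w) ≡ true → Unique w
does-unique⁻ w e with unique? _≟_ w
... | yes u = u

does-unique⁺ : ∀ w → Unique w → does (unique? _≟_ w) ≡ true
does-unique⁺ w u with unique? _≟_ w
... | yes _ = refl
... | no nu = ⊥-elim (nu u)

IsPerm : ℕ → List ℕ → Set
IsPerm M w = length w ≡ M × (∀ i → i < M → 1 ≤ w ! i × w ! i ≤ M) × Inj w

∈-perms⁻ : ∀ M w → w ∈ perms M → IsPerm M w
∈-perms⁻ M w p with ∈-filter⁻ (λ w → unique? _≟_ w) {xs = words (range1 M) M} p
... | w∈ , u with ∈-words⁻ (range1 M) M w w∈
... | l , a = l , (λ i il → ∈-range1⁻ M (w ! i) (All-app w a i (subst (i <_) (sym l) il))) , unique⇒inj w u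

∈-perms⁺ : ∀ M w → IsPerm M w → w ∈ perms M
∈-perms⁺ M w (l , r , inj) =
  ∈-filter⁺ (λ w → unique? _≟_ w) {xs = words (range1 M) M}
    (∈-words⁺ (range1 M) M w l (app-All w λ i il → let (a , b) = r i (subst (i <_) l il) in ∈-range1⁺ M (w ! i) a b))
    (inj⇒unique w inj)

unique-perms : ∀ M → Unique (perms M)
unique-perms M = Uniqueₚ.filter⁺ (λ w → unique? _≟_ w) (unique-words (range1 M) M (unique-range1 M))

∈-boolFilter⁻ : ∀ {A : Set} (p : A → Bool) xs x → x ∈ boolFilter p xs → x ∈ xs × p x ≡ true
∈-boolFilter⁻ p (y ∷ xs) x q with p y in eq
∈-boolFilter⁻ p (y ∷ xs) x (here refl) | true = here refl , eq
∈-boolFilter⁻ p (y ∷ xs) x (there q) | true = Product.map₁ there (∈-boolFilter⁻ p xs x q)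
∈-boolFilter⁻ p (y ∷ xs) x q | false = Product.map₁ there (∈-boolFilter⁻ p xs x q)

∈-boolFilter⁺ : ∀ {A : Set} (p : A → Bool) xs x → x ∈ xs → p x ≡ true → x ∈ boolFilter p xs
∈-boolFilter⁺ p (y ∷ xs) x (here refl) px rewrite px = here refl
∈-boolFilter⁺ p (y ∷ xs) x (there q) px with p y
... | true = there (∈-boolFilter⁺ p xs x q px)
... | false = ∈-boolFilter⁺ p xs x q px

unique-boolFilter : ∀ {A : Set} (p : A → Bool) xs → Unique xs → Unique (boolFilter p xs)
unique-boolFilter p [] u = []
unique-boolFilter p (y ∷ xs) (py ∷ u) with p y
... | true = all-boolFilter xs py ∷ unique-boolFilter p xs u
  where
  all-boolFilter : ∀ zs → All (y ≢_) zs → All (y ≢_) (boolFilter p zs)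
  all-boolFilter [] [] = []
  all-boolFilter (z ∷ zs) (q ∷ qs) with p z
  ... | true = q ∷ all-boolFilter zs qs
  ... | false = all-boolFilter zs qs
... | false = unique-boolFilter p xs u

iter : (ℕ → ℕ) → ℕ → ℕ → ℕ
iter f zero x = x
iter f (suc t) x = f (iter f t x)

iter-shift : ∀ f t x → iter f t (f x) ≡ f (iter f t x)
iter-shift f zero x = refl
iter-shift f (suc t) x = cong f (iter-shift f t x)

orbit : List ℕ → ℕ → ℕ
orbit w t = iter (app w) t 1

app-orbitFrom : ∀ w k c t → t < k → orbitFrom w k c ! t ≡ iter (app w) t c
app-orbitFrom w (suc k) c zero _ = refl
app-orbitFrom w (suc k) c (suc t) (s≤s p) = trans (app-orbitFrom w k (app w c) t p) (iter-shift (app w) t c)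

length-orbitFrom : ∀ w k c → length (orbitFrom w k c) ≡ k
length-orbitFrom w zero c = refl
length-orbitFrom w (suc k) c = cong suc (length-orbitFrom w k (app w c))

Cyc : ℕ → List ℕ → Set
Cyc n v = ∀ s t → s < n → t < n → orbit v s ≡ orbit v t → s ≡ t

-- Membership in 𝒜 M σs ρ, restated with indices instead of Boolean searches.
record Good (ρ : List ℕ) (M : ℕ) (w : List ℕ) : Set where
  field
    perm : IsPerm M w
    cyc : Cyc M w
    no4321 : ¬ Occ4 w (4 ∷ 3 ∷ 2 ∷ 1 ∷ [])
    no3412 : ¬ Occ4 w (3 ∷ 4 ∷ 1 ∷ 2 ∷ [])
    noρ : ¬ OccSeq (orbit w) M ρ

σs : List (List ℕ)
σs = (3 ∷ 4 ∷ 1 ∷ 2 ∷ []) ∷ (4 ∷ 3 ∷ 2 ∷ 1 ∷ []) ∷ []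

∧≡true⁻ : ∀ {a b} → a ∧ b ≡ true → a ≡ true × b ≡ true
∧≡true⁻ {true} {true} _ = refl , refl

∧≡true⁺ : ∀ {a b} → a ≡ true → b ≡ true → a ∧ b ≡ true
∧≡true⁺ refl refl = refl

not≡true⁻ : ∀ {b} → not b ≡ true → ¬ (b ≡ true)
not≡true⁻ {false} _ ()

not≡true⁺ : ∀ {b} → ¬ (b ≡ true) → not b ≡ true
not≡true⁺ {false} _ = refl
not≡true⁺ {true} h = ⊥-elim (h refl)

app-cycleForm : ∀ w t → t < length w → cycleForm w ! t ≡ orbit w t
app-cycleForm w t p = app-orbitFrom w (length w) 1 t p

length-cycleForm : ∀ w → length (cycleForm w) ≡ length w
length-cycleForm w = length-orbitFrom w (length w) 1

cycleForm-occ : ∀ {w ρ} → OccSeq (cycleForm w !_) (length (cycleForm w)) ρ → OccSeq (orbit w) (length w) ρ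
cycleForm-occ {w} {ρ} o =
  OccSeq-cong {ρ = ρ} (λ t p → app-cycleForm w t p) (subst (λ M → OccSeq (cycleForm w !_) M ρ) (length-cycleForm w) o)

occ-cycleForm : ∀ {w ρ} → OccSeq (orbit w) (length w) ρ → OccSeq (cycleForm w !_) (length (cycleForm w)) ρ
occ-cycleForm {w} {ρ} o =
  subst (λ M → OccSeq (cycleForm w !_) M ρ) (sym (length-cycleForm w)) (OccSeq-cong {ρ = ρ} (λ t p → sym (app-cycleForm w t p)) o)

𝒜⇒Good : ∀ M ρ1 ρ2 ρ3 w → w ∈ 𝒜 M σs (ρ1 ∷ ρ2 ∷ ρ3 ∷ []) → Good (ρ1 ∷ ρ2 ∷ ρ3 ∷ []) M w
𝒜⇒Good M ρ1 ρ2 ρ3 w p with ∈-boolFilter⁻ _ (perms M) w p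
... | w∈ , e with ∧≡true⁻ e
... | cyclic , e₂ with ∧≡true⁻ e₂
... | e₃ , avoidsρ with ∧≡true⁻ e₃
... | avoids3412 , e₄ with ∧≡true⁻ e₄
... | avoids4321 , _ = record
  { perm = P
  ; cyc = λ s t sp tp eq → unique⇒inj (cycleForm w) (does-unique⁻ _ cyclic) s t (lc sp) (lc tp)
            (trans (app-cycleForm w s (lw sp)) (trans eq (sym (app-cycleForm w t (lw tp)))))
  ; no4321 = λ o → not≡true⁻ avoids4321 (occ4⇒contains w 4 3 2 1 o)
  ; no3412 = λ o → not≡true⁻ avoids3412 (occ4⇒contains w 3 4 1 2 o)
  ; noρ = λ o → not≡true⁻ avoidsρ (occ3⇒contains (cycleForm w) ρ1 ρ2 ρ3
            (occ-cycleForm {w} {ρ1 ∷ ρ2 ∷ ρ3 ∷ []} (subst (λ M → OccSeq (orbit w) M (ρ1 ∷ ρ2 ∷ ρ3 ∷ [])) (sym (proj₁ P)) o)))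
  }
  where
  P = ∈-perms⁻ M w w∈
  lw : ∀ {s} → s < M → s < length w
  lw {s} = subst (s <_) (sym (proj₁ P))
  lc : ∀ {s} → s < M → s < length (cycleForm w)
  lc {s} sp = subst (s <_) (sym (length-cycleForm w)) (lw sp)

Good⇒𝒜 : ∀ M ρ1 ρ2 ρ3 w → Good (ρ1 ∷ ρ2 ∷ ρ3 ∷ []) M w → w ∈ 𝒜 M σs (ρ1 ∷ ρ2 ∷ ρ3 ∷ [])
Good⇒𝒜 M ρ1 ρ2 ρ3 w g = ∈-boolFilter⁺ _ (perms M) w (∈-perms⁺ M w perm)
   (∧≡true⁺ cyclic (∧≡true⁺ (∧≡true⁺ (not≡true⁺ (λ e → no3412 (contains⇒occ4 w 3 4 1 2 e)))
                              (∧≡true⁺ (not≡true⁺ (λ e → no4321 (contains⇒occ4 w 4 3 2 1 e))) refl))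
                  (not≡true⁺ (λ e → noρ (subst (λ M → OccSeq (orbit w) M (ρ1 ∷ ρ2 ∷ ρ3 ∷ [])) (proj₁ perm)
                                           (cycleForm-occ {w} {ρ1 ∷ ρ2 ∷ ρ3 ∷ []} (contains⇒occ3 (cycleForm w) ρ1 ρ2 ρ3 e)))))))
  where
  open Good g
  lM : ∀ {s} → s < length (cycleForm w) → s < M
  lM {s} sp = subst (s <_) (trans (length-cycleForm w) (proj₁ perm)) sp
  lw : ∀ {s} → s < length (cycleForm w) → s < length w
  lw {s} sp = subst (s <_) (length-cycleForm w) sp
  cyclic = does-unique⁺ (cycleForm w) (inj⇒unique (cycleForm w) λ s t sp tp eq →
    cyc s t (lM sp) (lM tp) (trans (sym (app-cycleForm w s (lw sp))) (trans eq (app-cycleForm w t (lw tp)))))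

<ᵇ≡true⇒< : ∀ {a b} → (a <ᵇ b) ≡ true → a < b
<ᵇ≡true⇒< {a} {b} e = <ᵇ⇒< a b (Equivalence.from T-≡ e)

<⇒<ᵇ≡true : ∀ {a b} → a < b → (a <ᵇ b) ≡ true
<⇒<ᵇ≡true p = Equivalence.to T-≡ (<⇒<ᵇ p)

<ᵇ≡false⇒≥ : ∀ {a b} → (a <ᵇ b) ≡ false → b ≤ a
<ᵇ≡false⇒≥ e = ≮⇒≥ (λ a<b → contradiction (trans (sym (<⇒<ᵇ≡true a<b)) e) λ ())

≥⇒<ᵇ≡false : ∀ {a b} → b ≤ a → (a <ᵇ b) ≡ false
≥⇒<ᵇ≡false {a} {b} p with a <ᵇ b in eq
... | false = refl
... | true = ⊥-elim (<⇒≱ (<ᵇ≡true⇒< eq) p)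

==ᵇ-true : ∀ b → (b ==ᵇ true) ≡ b
==ᵇ-true true = refl
==ᵇ-true false = refl

==ᵇ-false : ∀ b → (b ==ᵇ false) ≡ not b
==ᵇ-false true = refl
==ᵇ-false false = refl

not≡true⇒≡false : ∀ {b} → not b ≡ true → b ≡ false
not≡true⇒≡false {false} _ = refl

∧≡true⇒ˡ : ∀ a {b} → a ∧ b ≡ true → a ≡ true
∧≡true⇒ˡ true _ = refl

∧≡true⇒ʳ : ∀ a {b} → a ∧ b ≡ true → b ≡ true
∧≡true⇒ʳ true e = e

iso4321⁻ : ∀ {a b c d} → orderIsoᵇ (a ∷ b ∷ c ∷ d ∷ []) (4 ∷ 3 ∷ 2 ∷ 1 ∷ []) ≡ true → b < a × c < b × d < c
iso4321⁻ {a} {b} {c} {d} e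
  rewrite ==ᵇ-true (b <ᵇ a) | ==ᵇ-true (c <ᵇ a) | ==ᵇ-true (d <ᵇ a) | ==ᵇ-true (c <ᵇ b) | ==ᵇ-true (d <ᵇ b) | ==ᵇ-true (d <ᵇ c) =
  let r1 = ∧≡true⇒ʳ (b <ᵇ a) e ; r2 = ∧≡true⇒ʳ (c <ᵇ a) r1 ; r3 = ∧≡true⇒ʳ (d <ᵇ a) r2 ; r4 = ∧≡true⇒ʳ (c <ᵇ b) r3 ; r5 = ∧≡true⇒ʳ (d <ᵇ b) r4
  in <ᵇ≡true⇒< (∧≡true⇒ˡ (b <ᵇ a) e) , <ᵇ≡true⇒< (∧≡true⇒ˡ (c <ᵇ b) r3) , <ᵇ≡true⇒< (∧≡true⇒ˡ (d <ᵇ c) r5)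

iso4321⁺ : ∀ {a b c d} → b < a → c < b → d < c → orderIsoᵇ (a ∷ b ∷ c ∷ d ∷ []) (4 ∷ 3 ∷ 2 ∷ 1 ∷ []) ≡ true
iso4321⁺ {a} {b} {c} {d} p q r
  rewrite ==ᵇ-true (b <ᵇ a) | ==ᵇ-true (c <ᵇ a) | ==ᵇ-true (d <ᵇ a) | ==ᵇ-true (c <ᵇ b) | ==ᵇ-true (d <ᵇ b) | ==ᵇ-true (d <ᵇ c)
        | <⇒<ᵇ≡true p | <⇒<ᵇ≡true q | <⇒<ᵇ≡true r | <⇒<ᵇ≡true (<-trans q p) | <⇒<ᵇ≡true (<-trans r (<-trans q p)) | <⇒<ᵇ≡true (<-trans r q) = refl

iso3412⁻ : ∀ {a b c d} → orderIsoᵇ (a ∷ b ∷ c ∷ d ∷ []) (3 ∷ 4 ∷ 1 ∷ 2 ∷ []) ≡ true →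
  a ≤ b × c < a × d < a × c < b × d < b × c ≤ d
iso3412⁻ {a} {b} {c} {d} e
  rewrite ==ᵇ-false (b <ᵇ a) | ==ᵇ-true (c <ᵇ a) | ==ᵇ-true (d <ᵇ a) | ==ᵇ-true (c <ᵇ b) | ==ᵇ-true (d <ᵇ b) | ==ᵇ-false (d <ᵇ c) =
  let r1 = ∧≡true⇒ʳ (not (b <ᵇ a)) e ; r2 = ∧≡true⇒ʳ (c <ᵇ a) r1 ; r3 = ∧≡true⇒ʳ (d <ᵇ a) r2 ; r4 = ∧≡true⇒ʳ (c <ᵇ b) r3 ; r5 = ∧≡true⇒ʳ (d <ᵇ b) r4
  in <ᵇ≡false⇒≥ (not≡true⇒≡false (∧≡true⇒ˡ (not (b <ᵇ a)) e)) , <ᵇ≡true⇒< (∧≡true⇒ˡ (c <ᵇ a) r1) , <ᵇ≡true⇒< (∧≡true⇒ˡ (d <ᵇ a) r2) ,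
     <ᵇ≡true⇒< (∧≡true⇒ˡ (c <ᵇ b) r3) , <ᵇ≡true⇒< (∧≡true⇒ˡ (d <ᵇ b) r4) , <ᵇ≡false⇒≥ (not≡true⇒≡false (∧≡true⇒ˡ (not (d <ᵇ c)) r5))

iso3412⁺ : ∀ {a b c d} → c < d → d < a → a < b → orderIsoᵇ (a ∷ b ∷ c ∷ d ∷ []) (3 ∷ 4 ∷ 1 ∷ 2 ∷ []) ≡ true
iso3412⁺ {a} {b} {c} {d} p q r
  rewrite ==ᵇ-false (b <ᵇ a) | ==ᵇ-true (c <ᵇ a) | ==ᵇ-true (d <ᵇ a) | ==ᵇ-true (c <ᵇ b) | ==ᵇ-true (d <ᵇ b) | ==ᵇ-false (d <ᵇ c)
        | ≥⇒<ᵇ≡false (<⇒≤ r) | <⇒<ᵇ≡true (<-trans p q) | <⇒<ᵇ≡true q | <⇒<ᵇ≡true (<-trans (<-trans p q) r) | <⇒<ᵇ≡true (<-trans q r)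
        | ≥⇒<ᵇ≡false (<⇒≤ p) = refl

iso213⁻ : ∀ {a b c} → orderIsoᵇ (a ∷ b ∷ c ∷ []) (2 ∷ 1 ∷ 3 ∷ []) ≡ true → b < a × a ≤ c
iso213⁻ {a} {b} {c} e rewrite ==ᵇ-true (b <ᵇ a) | ==ᵇ-false (c <ᵇ a) | ==ᵇ-false (c <ᵇ b) =
  <ᵇ≡true⇒< (∧≡true⇒ˡ (b <ᵇ a) e) , <ᵇ≡false⇒≥ (not≡true⇒≡false (∧≡true⇒ˡ (not (c <ᵇ a)) (∧≡true⇒ʳ (b <ᵇ a) e)))

iso213⁺ : ∀ {a b c} → b < a → a < c → orderIsoᵇ (a ∷ b ∷ c ∷ []) (2 ∷ 1 ∷ 3 ∷ []) ≡ true
iso213⁺ {a} {b} {c} p q rewrite ==ᵇ-true (b <ᵇ a) | ==ᵇ-false (c <ᵇ a) | ==ᵇ-false (c <ᵇ b)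
  | <⇒<ᵇ≡true p | ≥⇒<ᵇ≡false (<⇒≤ q) | ≥⇒<ᵇ≡false (<⇒≤ (<-trans p q)) = refl

iso312⁻ : ∀ {a b c} → orderIsoᵇ (a ∷ b ∷ c ∷ []) (3 ∷ 1 ∷ 2 ∷ []) ≡ true → b < a × c < a × b ≤ c
iso312⁻ {a} {b} {c} e rewrite ==ᵇ-true (b <ᵇ a) | ==ᵇ-true (c <ᵇ a) | ==ᵇ-false (c <ᵇ b) =
  let r1 = ∧≡true⇒ʳ (b <ᵇ a) e ; r2 = ∧≡true⇒ʳ (c <ᵇ a) r1 in
  <ᵇ≡true⇒< (∧≡true⇒ˡ (b <ᵇ a) e) , <ᵇ≡true⇒< (∧≡true⇒ˡ (c <ᵇ a) r1) , <ᵇ≡false⇒≥ (not≡true⇒≡false (∧≡true⇒ˡ (not (c <ᵇ b)) r2))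

iso312⁺ : ∀ {a b c} → b < c → c < a → orderIsoᵇ (a ∷ b ∷ c ∷ []) (3 ∷ 1 ∷ 2 ∷ []) ≡ true
iso312⁺ {a} {b} {c} p q rewrite ==ᵇ-true (b <ᵇ a) | ==ᵇ-true (c <ᵇ a) | ==ᵇ-false (c <ᵇ b)
  | <⇒<ᵇ≡true (<-trans p q) | <⇒<ᵇ≡true q | ≥⇒<ᵇ≡false (<⇒≤ p) = refl

orderIso4-cong : ∀ a b c d a' b' c' d' s1 s2 s3 s4 →
  (b' <ᵇ a') ≡ (b <ᵇ a) → (c' <ᵇ a') ≡ (c <ᵇ a) → (d' <ᵇ a') ≡ (d <ᵇ a) →
  (c' <ᵇ b') ≡ (c <ᵇ b) → (d' <ᵇ b') ≡ (d <ᵇ b) → (d' <ᵇ c') ≡ (d <ᵇ c) →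
  orderIsoᵇ (a' ∷ b' ∷ c' ∷ d' ∷ []) (s1 ∷ s2 ∷ s3 ∷ s4 ∷ []) ≡ orderIsoᵇ (a ∷ b ∷ c ∷ d ∷ []) (s1 ∷ s2 ∷ s3 ∷ s4 ∷ [])
orderIso4-cong a b c d a' b' c' d' s1 s2 s3 s4 e1 e2 e3 e4 e5 e6 rewrite e1 | e2 | e3 | e4 | e5 | e6 = refl

monotone⇒<ᵇ-preserved : ∀ (h : ℕ → ℕ) (D : ℕ → Set) → (∀ y z → D y → D z → y < z → h y < h z) →
  ∀ a b → D a → D b → (h b <ᵇ h a) ≡ (b <ᵇ a)
monotone⇒<ᵇ-preserved h D m a b da db with <-cmp b a
... | tri< p _ _ = trans (<⇒<ᵇ≡true (m b a db da p)) (sym (<⇒<ᵇ≡true p))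
... | tri≈ _ refl _ = trans (≥⇒<ᵇ≡false {h a} {h a} ≤-refl) (sym (≥⇒<ᵇ≡false {a} {a} ≤-refl))
... | tri> _ _ p = trans (≥⇒<ᵇ≡false (<⇒≤ (m a b da db p))) (sym (≥⇒<ᵇ≡false (<⇒≤ p)))

Rng : ℕ → List ℕ → Set
Rng M w = ∀ p → 1 ≤ p → p ≤ M → 1 ≤ app w p × app w p ≤ M

Inj1 : ℕ → List ℕ → Set
Inj1 M w = ∀ p q → 1 ≤ p → p ≤ M → 1 ≤ q → q ≤ M → app w p ≡ app w q → p ≡ q

perm-rng : ∀ M w → IsPerm M w → Rng M w
perm-rng M w (_ , r , _) (suc i) _ p = r i p

perm-inj : ∀ M w → IsPerm M w → Inj1 M w
perm-inj M w (l , _ , inj) (suc i) (suc j) _ p _ q e =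
  cong suc (inj i j (subst (i <_) (sym l) p) (subst (j <_) (sym l) q) e)

mkPerm : ∀ M w → length w ≡ M → Rng M w → Inj1 M w → IsPerm M w
mkPerm M w l r inj = l , (λ i p → r (suc i) (s≤s z≤n) p) ,
  λ i j p q e → suc-injective (inj (suc i) (suc j) (s≤s z≤n) (subst (i <_) l p) (s≤s z≤n) (subst (j <_) l q) e)

app-build1 : ∀ M f p → 1 ≤ p → p ≤ M → app (build M f) p ≡ f p
app-build1 M f (suc i) _ p = app-build M f i p

opaque
  ifeq : ℕ → ℕ → ℕ → ℕ → ℕ
  ifeq a b t e with a ≟ b
  ... | yes _ = t
  ... | no _ = e

  ifeq-y : ∀ a b t e → a ≡ b → ifeq a b t e ≡ t
  ifeq-y a b t e p with a ≟ b
  ... | yes _ = refl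
  ... | no ne = ⊥-elim (ne p)

  ifeq-n : ∀ a b t e → a ≢ b → ifeq a b t e ≡ e
  ifeq-n a b t e p with a ≟ b
  ... | yes q = ⊥-elim (p q)
  ... | no ne = refl

-- For v of length n, insA x v and insB x v have length n + 1: in cycle notation the new point n + 1
-- is inserted right after x, resp. right before x.
fA : ℕ → List ℕ → ℕ → ℕ
fA x v p = ifeq p x (suc (length v)) (ifeq p (suc (length v)) (app v x) (app v p))

fB : ℕ → List ℕ → ℕ → ℕ
fB x v p = ifeq p (suc (length v)) x (ifeq (app v p) x (suc (length v)) (app v p))

opaque
  insA : ℕ → List ℕ → List ℕ
  insA x v = build (suc (length v)) (fA x v)

  insB : ℕ → List ℕ → List ℕ
  insB x v = build (suc (length v)) (fB x v)

  length-insA : ∀ x v → length (insA x v) ≡ suc (length v)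
  length-insA x v = length-build _ (fA x v)

  length-insB : ∀ x v → length (insB x v) ≡ suc (length v)
  length-insB x v = length-build _ (fB x v)

  insA-x : ∀ x v → 1 ≤ x → x ≤ length v → app (insA x v) x ≡ suc (length v)
  insA-x x v a b = trans (app-build1 (suc (length v)) (fA x v) x a (m≤n⇒m≤1+n b)) (ifeq-y x x _ _ refl)

  insA-N : ∀ x v → x ≤ length v → app (insA x v) (suc (length v)) ≡ app v x
  insA-N x v b = trans (app-build1 (suc (length v)) (fA x v) (suc (length v)) (s≤s z≤n) ≤-refl)
    (trans (ifeq-n (suc (length v)) x _ _ (λ e → <-irrefl (sym e) (s≤s b))) (ifeq-y (suc (length v)) (suc (length v)) _ _ refl))

  insA-o : ∀ x v p → 1 ≤ p → p ≤ length v → p ≢ x → app (insA x v) p ≡ app v p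
  insA-o x v p a b ne = trans (app-build1 (suc (length v)) (fA x v) p a (m≤n⇒m≤1+n b))
    (trans (ifeq-n p x _ _ ne) (ifeq-n p (suc (length v)) _ _ (λ e → <-irrefl e (s≤s b))))

  insB-N : ∀ x v → app (insB x v) (suc (length v)) ≡ x
  insB-N x v = trans (app-build1 (suc (length v)) (fB x v) (suc (length v)) (s≤s z≤n) ≤-refl) (ifeq-y (suc (length v)) (suc (length v)) _ _ refl)

  insB-hit : ∀ x v p → 1 ≤ p → p ≤ length v → app v p ≡ x → app (insB x v) p ≡ suc (length v)
  insB-hit x v p a b e = trans (app-build1 (suc (length v)) (fB x v) p a (m≤n⇒m≤1+n b))
    (trans (ifeq-n p (suc (length v)) _ _ (λ e → <-irrefl e (s≤s b))) (ifeq-y (app v p) x _ _ e))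

  insB-o : ∀ x v p → 1 ≤ p → p ≤ length v → app v p ≢ x → app (insB x v) p ≡ app v p
  insB-o x v p a b ne = trans (app-build1 (suc (length v)) (fB x v) p a (m≤n⇒m≤1+n b))
    (trans (ifeq-n p (suc (length v)) _ _ (λ e → <-irrefl e (s≤s b))) (ifeq-n (app v p) x _ _ ne))

pos-split : ∀ n p → p ≤ suc n → p ≡ suc n ⊎ p ≤ n
pos-split n p q with m≤n⇒m<n∨m≡n q
... | inj₁ (s≤s r) = inj₂ r
... | inj₂ e = inj₁ e

insA-perm : ∀ n x v → IsPerm n v → 1 ≤ x → x ≤ n → IsPerm (suc n) (insA x v)
insA-perm n x v P@(l , _ , _) a b = mkPerm (suc n) (insA x v) (trans (length-insA x v) (cong suc l)) rng inj
  where
  r = perm-rng n v P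
  i1 = perm-inj n v P
  b' : x ≤ length v
  b' = subst (x ≤_) (sym l) b
  val : ∀ p → 1 ≤ p → p ≤ suc n →
        (p ≡ x × app (insA x v) p ≡ suc n) ⊎ (p ≡ suc n × app (insA x v) p ≡ app v x) ⊎
        (p ≢ x × p ≤ n × app (insA x v) p ≡ app v p)
  val p c d with p ≟ x
  ... | yes refl = inj₁ (refl , trans (insA-x x v a b') (cong suc l))
  ... | no ne with pos-split n p d
  ...   | inj₁ refl = inj₂ (inj₁ (refl , subst (λ m → app (insA x v) (suc m) ≡ app v x) l (insA-N x v b')))
  ...   | inj₂ e = inj₂ (inj₂ (ne , e , insA-o x v p c (subst (p ≤_) (sym l) e) ne))
  rng : Rng (suc n) (insA x v)
  rng p c d with val p c d
  ... | inj₁ (_ , e) rewrite e = s≤s z≤n , ≤-refl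
  ... | inj₂ (inj₁ (_ , e)) rewrite e = proj₁ (r x a b) , m≤n⇒m≤1+n (proj₂ (r x a b))
  ... | inj₂ (inj₂ (_ , q , e)) rewrite e = proj₁ (r p c q) , m≤n⇒m≤1+n (proj₂ (r p c q))
  inj : Inj1 (suc n) (insA x v)
  inj p q c d c' d' e with val p c d | val q c' d'
  ... | inj₁ (refl , _) | inj₁ (refl , _) = refl
  ... | inj₁ (_ , e1) | inj₂ (inj₁ (_ , e2)) = ⊥-elim (<-irrefl (sym (trans (sym e1) (trans e e2))) (s≤s (proj₂ (r x a b))))
  ... | inj₁ (_ , e1) | inj₂ (inj₂ (_ , q' , e2)) = ⊥-elim (<-irrefl (sym (trans (sym e1) (trans e e2))) (s≤s (proj₂ (r q c' q'))))
  ... | inj₂ (inj₁ (_ , e1)) | inj₁ (_ , e2) = ⊥-elim (<-irrefl (sym (trans (sym e2) (trans (sym e) e1))) (s≤s (proj₂ (r x a b))))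
  ... | inj₂ (inj₁ (refl , _)) | inj₂ (inj₁ (refl , _)) = refl
  ... | inj₂ (inj₁ (_ , e1)) | inj₂ (inj₂ (ne , q' , e2)) = ⊥-elim (ne (sym (i1 x q a b c' q' (trans (sym e1) (trans e e2)))))
  ... | inj₂ (inj₂ (_ , p' , e1)) | inj₁ (_ , e2) = ⊥-elim (<-irrefl (sym (trans (sym e2) (trans (sym e) e1))) (s≤s (proj₂ (r p c p'))))
  ... | inj₂ (inj₂ (ne , p' , e1)) | inj₂ (inj₁ (_ , e2)) = ⊥-elim (ne (i1 p x c p' a b (trans (sym e1) (trans e e2))))
  ... | inj₂ (inj₂ (_ , p' , e1)) | inj₂ (inj₂ (_ , q' , e2)) = i1 p q c p' c' q' (trans (sym e1) (trans e e2))

insB-perm : ∀ n x v → IsPerm n v → 1 ≤ x → x ≤ n → IsPerm (suc n) (insB x v)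
insB-perm n x v P@(l , _ , _) a b = mkPerm (suc n) (insB x v) (trans (length-insB x v) (cong suc l)) rng inj
  where
  r = perm-rng n v P
  i1 = perm-inj n v P
  val : ∀ p → 1 ≤ p → p ≤ suc n →
        (p ≡ suc n × app (insB x v) p ≡ x) ⊎ (p ≤ n × app v p ≡ x × app (insB x v) p ≡ suc n) ⊎
        (p ≤ n × app v p ≢ x × app (insB x v) p ≡ app v p)
  val p c d with pos-split n p d
  ... | inj₁ refl = inj₁ (refl , subst (λ m → app (insB x v) (suc m) ≡ x) l (insB-N x v))
  ... | inj₂ q with app v p ≟ x
  ...   | yes e = inj₂ (inj₁ (q , e , trans (insB-hit x v p c (subst (p ≤_) (sym l) q) e) (cong suc l)))
  ...   | no ne = inj₂ (inj₂ (q , ne , insB-o x v p c (subst (p ≤_) (sym l) q) ne))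
  rng : Rng (suc n) (insB x v)
  rng p c d with val p c d
  ... | inj₁ (_ , e) rewrite e = a , m≤n⇒m≤1+n b
  ... | inj₂ (inj₁ (_ , _ , e)) rewrite e = s≤s z≤n , ≤-refl
  ... | inj₂ (inj₂ (q , _ , e)) rewrite e = proj₁ (r p c q) , m≤n⇒m≤1+n (proj₂ (r p c q))
  inj : Inj1 (suc n) (insB x v)
  inj p q c d c' d' e with val p c d | val q c' d'
  ... | inj₁ (refl , _) | inj₁ (refl , _) = refl
  ... | inj₁ (_ , e1) | inj₂ (inj₁ (_ , _ , e2)) = ⊥-elim (<-irrefl (trans (sym e1) (trans e e2)) (s≤s b))
  ... | inj₁ (_ , e1) | inj₂ (inj₂ (_ , ne , e2)) = ⊥-elim (ne (sym (trans (sym e1) (trans e e2))))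
  ... | inj₂ (inj₁ (_ , _ , e1)) | inj₁ (_ , e2) = ⊥-elim (<-irrefl (trans (sym e2) (trans (sym e) e1)) (s≤s b))
  ... | inj₂ (inj₁ (p' , h1 , _)) | inj₂ (inj₁ (q' , h2 , _)) = i1 p q c p' c' q' (trans h1 (sym h2))
  ... | inj₂ (inj₁ (_ , _ , e1)) | inj₂ (inj₂ (q' , _ , e2)) = ⊥-elim (<-irrefl (sym (trans (sym e1) (trans e e2))) (s≤s (proj₂ (r q c' q'))))
  ... | inj₂ (inj₂ (_ , ne , e1)) | inj₁ (_ , e2) = ⊥-elim (ne (trans (sym e1) (trans e e2)))
  ... | inj₂ (inj₂ (p' , _ , e1)) | inj₂ (inj₁ (_ , _ , e2)) = ⊥-elim (<-irrefl (sym (trans (sym e2) (trans (sym e) e1))) (s≤s (proj₂ (r p c p'))))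
  ... | inj₂ (inj₂ (p' , _ , e1)) | inj₂ (inj₂ (q' , _ , e2)) = i1 p q c p' c' q' (trans (sym e1) (trans e e2))

orbit-range : ∀ n v → IsPerm n v → 1 ≤ n → ∀ t → 1 ≤ orbit v t × orbit v t ≤ n
orbit-range n v P h zero = s≤s z≤n , h
orbit-range n v P h (suc t) = let (a , b) = orbit-range n v P h t in perm-rng n v P (orbit v t) a b

-- The n points orbit v 0, …, orbit v (n - 1) are distinct and lie in [1, n], so they exhaust it.
orbit-onto′ : ∀ n v → IsPerm n v → Cyc n v → ∀ y → 1 ≤ y → y ≤ n → ∃ λ k → k < n × orbit v k ≡ y
orbit-onto′ n v P C y a b = go (y ∈? L)
  where
  L = map (orbit v) (upTo n)
  lenL : length L ≡ n
  lenL = trans (length-map (orbit v) (upTo n)) (length-upTo n)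
  n≥1 : 1 ≤ n
  n≥1 = ≤-trans a b
  appL : ∀ i → i < length L → L ! i ≡ orbit v i
  appL i il = let il0 = subst (i <_) (length-map (orbit v) (upTo n)) il
                  il' = subst (i <_) (length-upTo n) il0 in
              trans (app-map (orbit v) (upTo n) i il0) (cong (orbit v) (app-applyUpTo id n i il'))
  uL : Unique L
  uL = inj⇒unique L λ i j p q e → C i j (subst (i <_) lenL p) (subst (j <_) lenL q)
         (trans (sym (appL i p)) (trans e (appL j q)))
  go : Dec (y ∈ L) → ∃ λ k → k < n × orbit v k ≡ y
  go (yes y∈) with ∈⇒index L y∈
  ... | i , il , e = i , subst (i <_) lenL il , trans (sym (appL i il)) e
  go (no y∉) = ⊥-elim (<-irrefl refl (≤-trans len (≤-reflexive (length-range1 n))))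
    where
    uyL : Unique (y ∷ L)
    uyL = app-All L (λ i il e → y∉ (subst (_∈ L) (sym e) (index⇒∈ L i il))) ∷ uL
    sub : ∀ {z} → z ∈ y ∷ L → z ∈ range1 n
    sub (here refl) = ∈-range1⁺ n y a b
    sub (there z∈) with ∈⇒index L z∈
    ... | i , il , refl = let r = orbit-range n v P n≥1 i
                              e = appL i il in
                          ∈-range1⁺ n (L ! i) (subst (1 ≤_) (sym e) (proj₁ r)) (subst (_≤ n) (sym e) (proj₂ r))
    len : suc n ≤ length (range1 n)
    len = subst (_≤ length (range1 n)) (cong suc lenL) (unique-length (y ∷ L) (range1 n) uyL sub)

-- Opaque so that goals mentioning the returned index never unfold the search.
opaque
  orbit-onto : ∀ n v → IsPerm n v → Cyc n v → ∀ y → 1 ≤ y → y ≤ n → ∃ λ k → k < n × orbit v k ≡ y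
  orbit-onto = orbit-onto′

opaque
  insertSeq : (ℕ → ℕ) → ℕ → ℕ → ℕ → ℕ
  insertSeq o K N t with <-cmp t K
  ... | tri< _ _ _ = o t
  ... | tri≈ _ _ _ = N
  ... | tri> _ _ _ = o (pred t)

  insertSeq-< : ∀ o K N t → t < K → insertSeq o K N t ≡ o t
  insertSeq-< o K N t p with <-cmp t K
  ... | tri< _ _ _ = refl
  ... | tri≈ ¬a _ _ = ⊥-elim (¬a p)
  ... | tri> ¬a _ _ = ⊥-elim (¬a p)

  insertSeq-≡ : ∀ o K N → insertSeq o K N K ≡ N
  insertSeq-≡ o K N with <-cmp K K
  ... | tri< _ ¬b _ = ⊥-elim (¬b refl)
  ... | tri≈ _ _ _ = refl
  ... | tri> _ ¬b _ = ⊥-elim (¬b refl)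

  insertSeq-> : ∀ o K N t → K < t → insertSeq o K N t ≡ o (pred t)
  insertSeq-> o K N t p with <-cmp t K
  ... | tri< _ _ ¬c = ⊥-elim (¬c p)
  ... | tri≈ _ _ ¬c = ⊥-elim (¬c p)
  ... | tri> _ _ _ = refl

skip : ℕ → ℕ → ℕ
skip K t with t <? K
... | yes _ = t
... | no _ = suc t

skip-< : ∀ K t → t < K → skip K t ≡ t
skip-< K t p with t <? K
... | yes _ = refl
... | no np = ⊥-elim (np p)

skip-≥ : ∀ K t → K ≤ t → skip K t ≡ suc t
skip-≥ K t p with t <? K
... | yes q = ⊥-elim (<⇒≱ q p)
... | no _ = refl

skip-mono : ∀ K s t → s < t → skip K s < skip K t
skip-mono K s t p with s <? K | t <? K
... | yes _ | yes _ = p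
... | yes _ | no _ = m<n⇒m<1+n p
... | no a | yes b = ⊥-elim (a (<-trans p b))
... | no _ | no _ = s≤s p

skip-bound : ∀ K n t → t < n → skip K t < suc n
skip-bound K n t p with t <? K
... | yes _ = m<n⇒m<1+n p
... | no _ = s≤s p

orbit-insA : ∀ n x v k → IsPerm n v → Cyc n v → 1 ≤ x → x ≤ n → k < n → orbit v k ≡ x →
       ∀ t → t ≤ n → orbit (insA x v) t ≡ insertSeq (orbit v) (suc k) (suc n) t
orbit-insA n x v k P C a b kn ok = go
  where
  l = proj₁ P
  n≥1 = ≤-trans a b
  b' : x ≤ length v
  b' = subst (x ≤_) (sym l) b
  wx : app (insA x v) x ≡ suc n
  wx = trans (insA-x x v a b') (cong suc l)
  wN : app (insA x v) (suc n) ≡ app v x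
  wN = subst (λ m → app (insA x v) (suc m) ≡ app v x) l (insA-N x v b')
  wo : ∀ p → 1 ≤ p → p ≤ n → p ≢ x → app (insA x v) p ≡ app v p
  wo p c d ne = insA-o x v p c (subst (p ≤_) (sym l) d) ne
  rv = orbit-range n v P n≥1
  go : ∀ t → t ≤ n → orbit (insA x v) t ≡ insertSeq (orbit v) (suc k) (suc n) t
  go zero _ = sym (insertSeq-< (orbit v) (suc k) (suc n) 0 (s≤s z≤n))
  go (suc t) tn with <-cmp t k | go t (≤-trans (n≤1+n t) tn)
  ... | tri< t<k _ _ | ih =
    trans (cong (app (insA x v)) (trans ih (insertSeq-< (orbit v) (suc k) (suc n) t (m<n⇒m<1+n t<k))))
      (trans (wo (orbit v t) (proj₁ (rv t)) (proj₂ (rv t)) (λ e → <-irrefl (C t k (<-trans t<k kn) kn (trans e (sym ok))) t<k))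
        (sym (insertSeq-< (orbit v) (suc k) (suc n) (suc t) (s≤s t<k))))
  ... | tri≈ _ refl _ | ih =
    trans (cong (app (insA x v)) (trans ih (trans (insertSeq-< (orbit v) (suc t) (suc n) t ≤-refl) ok)))
      (trans wx (sym (insertSeq-≡ (orbit v) (suc t) (suc n))))
  ... | tri> _ _ k<t | ih with <-cmp t (suc k)
  ...   | tri< a' _ _ = ⊥-elim (<-irrefl refl (<-≤-trans a' k<t))
  ...   | tri≈ _ refl _ =
    trans (cong (app (insA x v)) (trans ih (insertSeq-≡ (orbit v) (suc k) (suc n))))
      (trans wN (trans (cong (app v) (sym ok)) (sym (insertSeq-> (orbit v) (suc k) (suc n) (suc (suc k)) (s≤s ≤-refl)))))
  ...   | tri> _ _ sk<t = lastA t sk<t tn ih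
    where
    lastA : ∀ t → suc k < t → suc t ≤ n → orbit (insA x v) t ≡ insertSeq (orbit v) (suc k) (suc n) t →
           app (insA x v) (orbit (insA x v) t) ≡ insertSeq (orbit v) (suc k) (suc n) (suc t)
    lastA (suc t') sk<t tn ih =
      trans (cong (app (insA x v)) (trans ih (insertSeq-> (orbit v) (suc k) (suc n) (suc t') sk<t)))
        (trans (wo (orbit v t') (proj₁ (rv t')) (proj₂ (rv t'))
                  (λ e → <-irrefl (sym (C t' k (<-trans (n<1+n t') tn) kn (trans e (sym ok)))) (≤-pred sk<t)))
          (sym (insertSeq-> (orbit v) (suc k) (suc n) (suc (suc t')) (<-trans sk<t (n<1+n (suc t'))))))

orbit-insB : ∀ n x v k → IsPerm n v → Cyc n v → 1 ≤ x → x ≤ n → 1 ≤ k → k < n → orbit v k ≡ x →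
       ∀ t → t ≤ n → orbit (insB x v) t ≡ insertSeq (orbit v) k (suc n) t
orbit-insB n x v k P C a b k1 kn ok = go
  where
  l = proj₁ P
  n≥1 = ≤-trans a b
  wN : app (insB x v) (suc n) ≡ x
  wN = subst (λ m → app (insB x v) (suc m) ≡ x) l (insB-N x v)
  wh : ∀ p → 1 ≤ p → p ≤ n → app v p ≡ x → app (insB x v) p ≡ suc n
  wh p c d e = trans (insB-hit x v p c (subst (p ≤_) (sym l) d) e) (cong suc l)
  wo : ∀ p → 1 ≤ p → p ≤ n → app v p ≢ x → app (insB x v) p ≡ app v p
  wo p c d ne = insB-o x v p c (subst (p ≤_) (sym l) d) ne
  rv = orbit-range n v P n≥1
  go : ∀ t → t ≤ n → orbit (insB x v) t ≡ insertSeq (orbit v) k (suc n) t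
  go zero _ = sym (insertSeq-< (orbit v) k (suc n) 0 k1)
  go (suc t) tn with <-cmp (suc t) k | go t (≤-trans (n≤1+n t) tn)
  ... | tri< st<k _ _ | ih =
    trans (cong (app (insB x v)) (trans ih (insertSeq-< (orbit v) k (suc n) t (<-trans (n<1+n t) st<k))))
      (trans (wo (orbit v t) (proj₁ (rv t)) (proj₂ (rv t)) (λ e → <-irrefl (C (suc t) k (<-trans st<k kn) kn (trans e (sym ok))) st<k))
        (sym (insertSeq-< (orbit v) k (suc n) (suc t) st<k)))
  ... | tri≈ _ refl _ | ih =
    trans (cong (app (insB x v)) (trans ih (insertSeq-< (orbit v) (suc t) (suc n) t ≤-refl)))
      (trans (wh (orbit v t) (proj₁ (rv t)) (proj₂ (rv t)) ok) (sym (insertSeq-≡ (orbit v) (suc t) (suc n))))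
  ... | tri> _ _ k<st | ih with <-cmp t k
  ...   | tri< t<k _ _ = ⊥-elim (<-irrefl refl (<-≤-trans t<k (≤-pred k<st)))
  ...   | tri≈ _ refl _ =
    trans (cong (app (insB x v)) (trans ih (insertSeq-≡ (orbit v) t (suc n))))
      (trans wN (trans (sym ok) (sym (insertSeq-> (orbit v) t (suc n) (suc t) ≤-refl))))
  ...   | tri> _ _ k<t = lastB t k<t tn ih
    where
    lastB : ∀ t → k < t → suc t ≤ n → orbit (insB x v) t ≡ insertSeq (orbit v) k (suc n) t →
           app (insB x v) (orbit (insB x v) t) ≡ insertSeq (orbit v) k (suc n) (suc t)
    lastB (suc t') k<t tn ih =
      trans (cong (app (insB x v)) (trans ih (insertSeq-> (orbit v) k (suc n) (suc t') k<t)))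
        (trans (wo (orbit v t') (proj₁ (rv t')) (proj₂ (rv t'))
                  (λ e → <-irrefl (sym (C (suc t') k tn kn (trans e (sym ok)))) k<t))
          (sym (insertSeq-> (orbit v) k (suc n) (suc (suc t')) (<-trans k<t (n<1+n (suc t'))))))

pred<-of-> : ∀ {K t n} → K < t → t < suc n → pred t < n
pred<-of-> {t = suc t} _ tn = ≤-pred tn

pred-injective-of-> : ∀ {K s t} → K < s → K < t → pred s ≡ pred t → s ≡ t
pred-injective-of-> {s = suc s} {t = suc t} _ _ e = cong suc e

insertSeq-injective : ∀ (o : ℕ → ℕ) K N n → (∀ s t → s < n → t < n → o s ≡ o t → s ≡ t) → (∀ t → t < n → o t ≢ N) → K ≤ n →
  ∀ s t → s < suc n → t < suc n → insertSeq o K N s ≡ insertSeq o K N t → s ≡ t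
insertSeq-injective o K N n inj new Kn s t sn tn e with <-cmp s K | <-cmp t K
... | tri< p _ _ | tri< q _ _ = inj s t (<-≤-trans p Kn) (<-≤-trans q Kn) (trans (sym (insertSeq-< o K N s p)) (trans e (insertSeq-< o K N t q)))
... | tri< p _ _ | tri≈ _ refl _ = ⊥-elim (new s (<-≤-trans p Kn) (trans (sym (insertSeq-< o K N s p)) (trans e (insertSeq-≡ o K N))))
... | tri< p _ _ | tri> _ _ q = ⊥-elim (<-irrefl (inj s (pred t) (<-≤-trans p Kn) (pred<-of-> q tn)
                       (trans (sym (insertSeq-< o K N s p)) (trans e (insertSeq-> o K N t q)))) (<-≤-trans p (<⇒≤pred q)))
... | tri≈ _ refl _ | tri< q _ _ = ⊥-elim (new t (<-≤-trans q Kn) (trans (sym (insertSeq-< o K N t q)) (trans (sym e) (insertSeq-≡ o K N))))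
... | tri≈ _ refl _ | tri≈ _ refl _ = refl
... | tri≈ _ refl _ | tri> _ _ q = ⊥-elim (new (pred t) (pred<-of-> q tn) (trans (sym (insertSeq-> o K N t q)) (trans (sym e) (insertSeq-≡ o K N))))
... | tri> _ _ p | tri< q _ _ = ⊥-elim (<-irrefl (inj t (pred s) (<-≤-trans q Kn) (pred<-of-> p sn)
                       (trans (sym (insertSeq-< o K N t q)) (trans (sym e) (insertSeq-> o K N s p)))) (<-≤-trans q (<⇒≤pred p)))
... | tri> _ _ p | tri≈ _ refl _ = ⊥-elim (new (pred s) (pred<-of-> p sn) (trans (sym (insertSeq-> o K N s p)) (trans e (insertSeq-≡ o K N))))
... | tri> _ _ p | tri> _ _ q = pred-injective-of-> p q (inj (pred s) (pred t) (pred<-of-> p sn) (pred<-of-> q tn)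
                       (trans (sym (insertSeq-> o K N s p)) (trans e (insertSeq-> o K N t q))))

cyclic-insA : ∀ n x v k → IsPerm n v → Cyc n v → 1 ≤ x → x ≤ n → k < n → orbit v k ≡ x → Cyc (suc n) (insA x v)
cyclic-insA n x v k P C a b kn ok s t sn tn e =
  insertSeq-injective (orbit v) (suc k) (suc n) n C (λ t _ e → <-irrefl e (s≤s (proj₂ (orbit-range n v P (≤-trans a b) t)))) kn s t sn tn
    (trans (sym (orbit-insA n x v k P C a b kn ok s (≤-pred sn))) (trans e (orbit-insA n x v k P C a b kn ok t (≤-pred tn))))

cyclic-insB : ∀ n x v k → IsPerm n v → Cyc n v → 1 ≤ x → x ≤ n → 1 ≤ k → k < n → orbit v k ≡ x → Cyc (suc n) (insB x v)
cyclic-insB n x v k P C a b k1 kn ok s t sn tn e =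
  insertSeq-injective (orbit v) k (suc n) n C (λ t _ e → <-irrefl e (s≤s (proj₂ (orbit-range n v P (≤-trans a b) t)))) (<⇒≤ kn) s t sn tn
    (trans (sym (orbit-insB n x v k P C a b k1 kn ok s (≤-pred sn))) (trans e (orbit-insB n x v k P C a b k1 kn ok t (≤-pred tn))))

skip-injective : ∀ K s t → skip K s ≡ skip K t → s ≡ t
skip-injective K s t e with <-cmp s t
... | tri< p _ _ = ⊥-elim (<-irrefl e (skip-mono K s t p))
... | tri≈ _ p _ = p
... | tri> _ _ p = ⊥-elim (<-irrefl (sym e) (skip-mono K t s p))

module MaxPosition (n : ℕ) (w : List ℕ) (PW : IsPerm (suc n) w) (CW : Cyc (suc n) w) (K : ℕ) (Kn : K ≤ n) (oK : orbit w K ≡ suc n) where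
  rw = orbit-range (suc n) w PW (s≤s z≤n)
  small : ∀ t → t ≤ n → t ≢ K → orbit w t ≤ n
  small t tn ne with m≤n⇒m<n∨m≡n (proj₂ (rw t))
  ... | inj₁ p = ≤-pred p
  ... | inj₂ e = ⊥-elim (ne (CW t K (s≤s tn) (s≤s Kn) (trans e (sym oK))))
  hitK : ∀ t → t ≤ n → orbit w t ≡ suc n → t ≡ K
  hitK t tn e = CW t K (s≤s tn) (s≤s Kn) (trans e (sym oK))

orbit-skip-insA : ∀ n x v K → length v ≡ n → IsPerm (suc n) (insA x v) → Cyc (suc n) (insA x v) → 1 ≤ x → x ≤ n →
  K ≤ n → orbit (insA x v) K ≡ suc n → ∀ t → t < n → orbit v t ≡ orbit (insA x v) (skip K t)
orbit-skip-insA n x v K l PW CW a b Kn oK = go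
  where
  w = insA x v
  open MaxPosition n w PW CW K Kn oK
  b' : x ≤ length v
  b' = subst (x ≤_) (sym l) b
  wx : app w x ≡ suc n
  wx = trans (insA-x x v a b') (cong suc l)
  wN : app w (suc n) ≡ app v x
  wN = subst (λ m → app w (suc m) ≡ app v x) l (insA-N x v b')
  wo : ∀ p → 1 ≤ p → p ≤ n → p ≢ x → app w p ≡ app v p
  wo p c d ne = insA-o x v p c (subst (p ≤_) (sym l) d) ne
  K1 : 1 ≤ K
  K1 = k1 K oK
    where
    k1 : ∀ K → orbit w K ≡ suc n → 1 ≤ K
    k1 zero e = ⊥-elim (<-irrefl e (s≤s (≤-trans a b)))
    k1 (suc _) _ = s≤s z≤n
  go : ∀ t → t < n → orbit v t ≡ orbit w (skip K t)
  go zero _ rewrite skip-< K 0 K1 = refl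
  go (suc t) tn with <-cmp (suc t) K | go t (<-trans (n<1+n t) tn)
  ... | tri< st<K _ _ | ih rewrite skip-< K t (<-trans (n<1+n t) st<K) | skip-< K (suc t) st<K =
    trans (cong (app v) ih) (sym (wo (orbit w t) (proj₁ (rw t)) (small t tle tK)
      (λ e → <-irrefl (hitK (suc t) (<⇒≤ tn) (trans (cong (app w) e) wx)) st<K)))
    where
    tle = ≤-trans (n≤1+n t) (<⇒≤ tn)
    tK : t ≢ K
    tK e = <-irrefl e (<-trans (n<1+n t) st<K)
  ... | tri≈ _ refl _ | ih rewrite skip-< (suc t) t ≤-refl | skip-≥ (suc t) (suc t) ≤-refl =
    trans (cong (app v) (trans ih yx)) (trans (sym wN) (cong (app w) (sym oK)))
    where
    yx : orbit w t ≡ x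
    yx = perm-inj (suc n) w PW (orbit w t) x (proj₁ (rw t)) (proj₂ (rw t)) a (≤-trans b (n≤1+n n)) (trans oK (sym wx))
  ... | tri> _ _ K<st | ih rewrite skip-≥ K t (≤-pred K<st) | skip-≥ K (suc t) (<⇒≤ K<st) =
    trans (cong (app v) ih) (sym (wo (orbit w (suc t)) (proj₁ (rw (suc t))) (small (suc t) (<⇒≤ tn) (λ e → <-irrefl (sym e) K<st))
      (λ e → <-irrefl (sym (hitK (suc (suc t)) tn (trans (cong (app w) e) wx))) (<-trans K<st (n<1+n (suc t))))))

orbit-skip-insB : ∀ n x v K → IsPerm n v → IsPerm (suc n) (insB x v) → Cyc (suc n) (insB x v) → 1 ≤ x → x ≤ n →
  K ≤ n → orbit (insB x v) K ≡ suc n → ∀ t → t < n → orbit v t ≡ orbit (insB x v) (skip K t)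
orbit-skip-insB n x v K PV PW CW a b Kn oK = go
  where
  w = insB x v
  open MaxPosition n w PW CW K Kn oK
  l = proj₁ PV
  wN : app w (suc n) ≡ x
  wN = subst (λ m → app w (suc m) ≡ x) l (insB-N x v)
  wh : ∀ p → 1 ≤ p → p ≤ n → app v p ≡ x → app w p ≡ suc n
  wh p c d e = trans (insB-hit x v p c (subst (p ≤_) (sym l) d) e) (cong suc l)
  wo : ∀ p → 1 ≤ p → p ≤ n → app v p ≢ x → app w p ≡ app v p
  wo p c d ne = insB-o x v p c (subst (p ≤_) (sym l) d) ne
  rv = perm-rng n v PV
  K1 : 1 ≤ K
  K1 = k1 K oK
    where
    k1 : ∀ K → orbit w K ≡ suc n → 1 ≤ K
    k1 zero e = ⊥-elim (<-irrefl e (s≤s (≤-trans a b)))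
    k1 (suc _) _ = s≤s z≤n
  go : ∀ t → t < n → orbit v t ≡ orbit w (skip K t)
  go zero _ rewrite skip-< K 0 K1 = refl
  go (suc t) tn with <-cmp (suc t) K | go t (<-trans (n<1+n t) tn)
  ... | tri< st<K _ _ | ih rewrite skip-< K t (<-trans (n<1+n t) st<K) | skip-< K (suc t) st<K =
    trans (cong (app v) ih) (sym (wo (orbit w t) (proj₁ (rw t)) (small t tle tK)
      (λ e → <-irrefl (hitK (suc t) (<⇒≤ tn) (wh (orbit w t) (proj₁ (rw t)) (small t tle tK) e)) st<K)))
    where
    tle = ≤-trans (n≤1+n t) (<⇒≤ tn)
    tK : t ≢ K
    tK e = <-irrefl e (<-trans (n<1+n t) st<K)
  ... | tri≈ _ refl _ | ih rewrite skip-< (suc t) t ≤-refl | skip-≥ (suc t) (suc t) ≤-refl =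
    trans (cong (app v) ih) (trans vx (trans (sym wN) (cong (app w) (sym oK))))
    where
    y = orbit w t
    y1 = proj₁ (rw t)
    yn = small t (≤-trans (n≤1+n t) (<⇒≤ tn)) (λ e → <-irrefl e ≤-refl)
    vx : app v y ≡ x
    vx with app v y ≟ x
    ... | yes e = e
    ... | no ne = ⊥-elim (<-irrefl (trans (sym (wo y y1 yn ne)) oK) (s≤s (proj₂ (rv y y1 yn))))
  ... | tri> _ _ K<st | ih rewrite skip-≥ K t (≤-pred K<st) | skip-≥ K (suc t) (<⇒≤ K<st) =
    trans (cong (app v) ih) (sym (wo y y1 yn
      (λ e → <-irrefl (sym (hitK (suc (suc t)) tn (wh y y1 yn e))) (<-trans K<st (n<1+n (suc t))))))
    where
    y = orbit w (suc t)
    y1 = proj₁ (rw (suc t))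
    yn = small (suc t) (<⇒≤ tn) (λ e → <-irrefl (sym e) K<st)

cyclic-skip : ∀ n v w K → Cyc (suc n) w → K ≤ n → (∀ t → t < n → orbit v t ≡ orbit w (skip K t)) → Cyc n v
cyclic-skip n v w K CW Kn h s t sn tn e =
  skip-injective K s t (CW (skip K s) (skip K t) (skip-bound K n s sn) (skip-bound K n t tn) (trans (sym (h s sn)) (trans e (h t tn))))

OccSeq-skip : ∀ (o o' : ℕ → ℕ) K n ρ → (∀ t → t < n → o t ≡ o' (skip K t)) → OccSeq o n ρ → OccSeq o' (suc n) ρ
OccSeq-skip o o' K n ρ h (i , j , k , ij , jk , kn , iso) =
  skip K i , skip K j , skip K k , skip-mono K i j ij , skip-mono K j k jk , skip-bound K n k kn ,
  subst (λ z → orderIsoᵇ z ρ ≡ true)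
    (cong₂ _∷_ (h i (<-trans ij (<-trans jk kn))) (cong₂ _∷_ (h j (<-trans jk kn)) (cong (_∷ []) (h k kn)))) iso

unskip : ℕ → ℕ → ℕ
unskip K t with t <? K
... | yes _ = t
... | no _ = pred t

insertSeq-unskip : ∀ o K N t → t ≢ K → insertSeq o K N t ≡ o (unskip K t)
insertSeq-unskip o K N t ne with t <? K
... | yes p = insertSeq-< o K N t p
... | no np with <-cmp t K
...   | tri< p _ _ = ⊥-elim (np p)
...   | tri≈ _ p _ = ⊥-elim (ne p)
...   | tri> _ _ p = insertSeq-> o K N t p

pred-mono-<-of-> : ∀ {K s t} → K < s → s < t → pred s < pred t
pred-mono-<-of-> {s = suc s} {t = suc t} _ (s≤s p) = p

unskip-mono : ∀ K s t → s ≢ K → t ≢ K → s < t → unskip K s < unskip K t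
unskip-mono K s t sK tK st with s <? K | t <? K
... | yes p | yes q = st
... | yes p | no q = ≤-trans p (<⇒≤pred (≤∧≢⇒< (≮⇒≥ q) (tK ∘ sym)))
... | no p | yes q = ⊥-elim (p (<-trans st q))
... | no p | no q = pred-mono-<-of-> (≤∧≢⇒< (≮⇒≥ p) (sK ∘ sym)) st

unskip-bound : ∀ K n t → K ≤ n → t ≤ n → t ≢ K → unskip K t < n
unskip-bound K n t Kn tn tK with t <? K
... | yes p = <-≤-trans p Kn
... | no p = pred<-of-> (≤∧≢⇒< (≮⇒≥ p) (tK ∘ sym)) (s≤s tn)

OccSeq-unskip : ∀ (o o' : ℕ → ℕ) K N n ρ → (∀ t → t ≤ n → o' t ≡ insertSeq o K N t) → K ≤ n →
  ∀ i j k → i < j → j < k → k < suc n → i ≢ K → j ≢ K → k ≢ K →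
  orderIsoᵇ (o' i ∷ o' j ∷ o' k ∷ []) ρ ≡ true → OccSeq o n ρ
OccSeq-unskip o o' K N n ρ h Kn i j k ij jk kn iK jK kK iso =
  unskip K i , unskip K j , unskip K k , unskip-mono K i j iK jK ij , unskip-mono K j k jK kK jk ,
  unskip-bound K n k Kn (≤-pred kn) kK ,
  subst (λ z → orderIsoᵇ z ρ ≡ true)
    (cong₂ _∷_ (val i (≤-pred (<-trans ij (<-trans jk kn))) iK)
      (cong₂ _∷_ (val j (≤-pred (<-trans jk kn)) jK) (cong (_∷ []) (val k (≤-pred kn) kK)))) iso
  where
  val : ∀ t → t ≤ n → t ≢ K → o' t ≡ o (unskip K t)
  val t tn tK = trans (h t tn) (insertSeq-unskip o K N t tK)

module InsertedMax (n : ℕ) (u : List ℕ) (PU : IsPerm n u) (CU : Cyc n u) (n1 : 1 ≤ n)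
                 (o' : ℕ → ℕ) (K : ℕ) (Kn : K ≤ n) (h : ∀ t → t ≤ n → o' t ≡ insertSeq (orbit u) K (suc n) t) where
  ru = orbit-range n u PU n1
  valK : o' K ≡ suc n
  valK = trans (h K Kn) (insertSeq-≡ (orbit u) K (suc n))
  valo : ∀ t → t ≤ n → t ≢ K → o' t ≤ n
  valo t tn tK = subst (_≤ n) (sym (trans (h t tn) (insertSeq-unskip (orbit u) K (suc n) t tK))) (proj₂ (ru (unskip K t)))
  valle : ∀ t → t ≤ n → o' t ≤ suc n
  valle t tn with t ≟ K
  ... | yes refl = ≤-reflexive valK
  ... | no ne = m≤n⇒m≤1+n (valo t tn ne)

insertMax-avoids213 : ∀ n u (PU : IsPerm n u) (CU : Cyc n u) (n1 : 1 ≤ n) o' K (Kn : K ≤ n)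
  (h : ∀ t → t ≤ n → o' t ≡ insertSeq (orbit u) K (suc n) t) →
  ∀ j → j < n → orbit u j ≡ n → K ≤ suc j →
  ¬ OccSeq (orbit u) n (2 ∷ 1 ∷ 3 ∷ []) → ¬ OccSeq o' (suc n) (2 ∷ 1 ∷ 3 ∷ [])
insertMax-avoids213 n u PU CU n1 o' K Kn h j jn oj Kj av (t1 , t2 , t3 , p12 , p23 , p3 , iso) = go
  where
  open InsertedMax n u PU CU n1 o' K Kn h
  e = iso213⁻ iso
  t3n = ≤-pred p3
  t2n = ≤-trans (<⇒≤ p23) t3n
  t1n = ≤-trans (<⇒≤ p12) t2n
  go : ⊥
  go with t1 ≟ K | t2 ≟ K | t3 ≟ K
  ... | yes refl | _ | _ = <-irrefl refl (≤-trans (s≤s (subst (_≤ o' t3) valK (proj₂ e))) (s≤s (valo t3 t3n (λ q → <-irrefl (sym q) (<-trans p12 p23)))))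
  ... | no _ | yes refl | _ = <-irrefl refl (≤-trans (subst (_< o' t1) valK (proj₁ e)) (valle t1 t1n))
  ... | no n1K | no n2K | yes refl = case (<-cmp t2 j)
    where
    ea : o' t1 ≡ orbit u t1
    ea = trans (h t1 t1n) (insertSeq-< (orbit u) t3 (suc n) t1 (<-trans p12 p23))
    eb : o' t2 ≡ orbit u t2
    eb = trans (h t2 t2n) (insertSeq-< (orbit u) t3 (suc n) t2 p23)
    case : Tri (t2 < j) (t2 ≡ j) (j < t2) → ⊥
    case (tri< t2<j _ _) = av (t1 , t2 , j , p12 , t2<j , jn ,
      iso213⁺ (subst₂ _<_ eb ea (proj₁ e))
            (subst (_< orbit u j) ea (subst (o' t1 <_) (sym oj) (≤∧≢⇒< (valo t1 t1n n1K)
              (λ q → <-irrefl (CU t1 j (<-trans (<-trans p12 t2<j) jn) jn (trans (sym ea) (trans q (sym oj)))) (<-trans p12 t2<j))))))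
    case (tri≈ _ refl _) = <-irrefl refl (<-≤-trans (proj₁ e) (subst (o' t1 ≤_) (sym (trans eb oj)) (valo t1 t1n n1K)))
    case (tri> _ _ j<t2) = <-irrefl refl (<-≤-trans j<t2 (≤-pred (≤-trans p23 Kj)))
  ... | no n1K | no n2K | no n3K = av (OccSeq-unskip (orbit u) o' K (suc n) n (2 ∷ 1 ∷ 3 ∷ []) h Kn t1 t2 t3 p12 p23 p3 n1K n2K n3K iso)

insertMax-avoids312 : ∀ n u (PU : IsPerm n u) (CU : Cyc n u) (n1 : 1 ≤ n) o' K (Kn : K ≤ n)
  (h : ∀ t → t ≤ n → o' t ≡ insertSeq (orbit u) K (suc n) t) →
  ∀ j → j < n → orbit u j ≡ n → j ≤ K →
  ¬ OccSeq (orbit u) n (3 ∷ 1 ∷ 2 ∷ []) → ¬ OccSeq o' (suc n) (3 ∷ 1 ∷ 2 ∷ [])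
insertMax-avoids312 n u PU CU n1 o' K Kn h j jn oj jK av (t1 , t2 , t3 , p12 , p23 , p3 , iso) = go
  where
  open InsertedMax n u PU CU n1 o' K Kn h
  e = iso312⁻ iso
  t3n = ≤-pred p3
  t2n = ≤-trans (<⇒≤ p23) t3n
  t1n = ≤-trans (<⇒≤ p12) t2n
  go : ⊥
  go with t1 ≟ K | t2 ≟ K | t3 ≟ K
  ... | _ | yes refl | _ = <-irrefl refl (≤-trans (subst (_< o' t1) valK (proj₁ e)) (valle t1 t1n))
  ... | _ | _ | yes refl = <-irrefl refl (≤-trans (subst (_< o' t1) valK (proj₁ (proj₂ e))) (valle t1 t1n))
  ... | yes refl | no n2K | no n3K = case (<-cmp (pred t2) j)
    where
    pt : ∀ t → t1 < t → suc (pred t) ≡ t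
    pt (suc t) _ = refl
    eb : o' t2 ≡ orbit u (pred t2)
    eb = trans (h t2 t2n) (insertSeq-> (orbit u) t1 (suc n) t2 p12)
    ec : o' t3 ≡ orbit u (pred t3)
    ec = trans (h t3 t3n) (insertSeq-> (orbit u) t1 (suc n) t3 (<-trans p12 p23))
    pt3n : pred t3 < n
    pt3n = subst (_≤ n) (sym (pt t3 (<-trans p12 p23))) t3n
    p23' : pred t2 < pred t3
    p23' = ≤-pred (subst₂ _<_ (sym (pt t2 p12)) (sym (pt t3 (<-trans p12 p23))) p23)
    bc : orbit u (pred t2) < orbit u (pred t3)
    bc = ≤∧≢⇒< (subst₂ _≤_ eb ec (proj₂ (proj₂ e)))
           (λ q → <-irrefl (CU (pred t2) (pred t3) (<-trans p23' pt3n) pt3n q) p23')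
    case : Tri ((pred t2) < j) ((pred t2) ≡ j) (j < (pred t2)) → ⊥
    case (tri< q _ _) = <-irrefl refl (<-≤-trans q (≤-trans jK (≤-pred (subst (t1 <_) (sym (pt t2 p12)) p12))))
    case (tri≈ _ q _) = <-irrefl refl (<-≤-trans bc (subst (orbit u (pred t3) ≤_) (trans (sym oj) (cong (orbit u) (sym q))) (proj₂ (ru (pred t3)))))
    case (tri> _ _ q) = av (j , pred t2 , pred t3 , q , p23' , pt3n ,
      iso312⁺ bc (≤∧≢⇒< (subst (orbit u (pred t3) ≤_) (sym oj) (proj₂ (ru (pred t3))))
                 (λ r → <-irrefl (CU j (pred t3) jn pt3n (sym r)) (<-trans q p23'))))
  ... | no n1K | no n2K | no n3K = av (OccSeq-unskip (orbit u) o' K (suc n) n (3 ∷ 1 ∷ 2 ∷ []) h Kn t1 t2 t3 p12 p23 p3 n1K n2K n3K iso)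

bump : ℕ → ℕ → ℕ → ℕ
bump x N y = ifeq y x N y

bump-self : ∀ x N → bump x N x ≡ N
bump-self x N = ifeq-y x x N x refl

bump-other : ∀ x N y → y ≢ x → bump x N y ≡ y
bump-other x N y ne = ifeq-n y x N y ne

bump-mono : ∀ x N → x < N → ∀ y z → y ≤ x → z ≤ x → y < z → bump x N y < bump x N z
bump-mono x N xN y z yx zx yz with z ≟ x
... | yes refl = subst₂ _<_ (sym (bump-other z N y (λ e → <-irrefl e yz))) (sym (bump-self z N)) (≤-trans (s≤s yx) xN)
... | no ne = subst₂ _<_ (sym (bump-other x N y (λ e → <-irrefl refl (<-≤-trans yz (subst (z ≤_) (sym e) zx))))) (sym (bump-other x N z ne)) yz

-- With n = length v, in cycle notation: opA puts n + 1 right after n, opB right before n,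
-- opAC replaces n by (n + 2) n (n + 1), and opD replaces n by (n + 1) n (n + 2).
opA opB opAC opD : List ℕ → List ℕ
opA v = insA (length v) v
opB v = insB (length v) v
opAC v = insB (length v) (insA (length v) v)
opD v = insA (length v) (insB (length v) v)

module Tables (m : ℕ) (v : List ℕ) (l : length v ≡ suc m) where
  n = suc m
  L = length v
  u = insA L v
  u' = insB L v
  lu : length u ≡ suc L
  lu = length-insA L v
  lu' : length u' ≡ suc L
  lu' = length-insB L v

  lx : ∀ {i} → i < n → suc i ≤ L
  lx {i} p = subst (suc i ≤_) (sym l) p
  ne-L : ∀ {i} → i < m → suc i ≢ L
  ne-L {i} p e = <-irrefl (suc-injective (trans e l)) p

  A-lt : ∀ i → i < m → opA v ! i ≡ v ! i
  A-lt i p = insA-o L v (suc i) (s≤s z≤n) (lx (m<n⇒m<1+n p)) (ne-L p)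
  A-m : opA v ! m ≡ suc n
  A-m = subst (λ q → app (opA v) q ≡ suc q) l (insA-x L v (subst (1 ≤_) (sym l) (s≤s z≤n)) ≤-refl)
  A-sm : opA v ! suc m ≡ v ! m
  A-sm = subst (λ q → app (opA v) (suc q) ≡ app v q) l (insA-N L v ≤-refl)

  hB : ∀ x (z : List ℕ) K → length z ≡ K → ∀ i → i < K → insB x z ! i ≡ bump x (suc K) (z ! i)
  hB x z K lz i p with (z ! i) ≟ x
  ... | yes e = trans (trans (insB-hit x z (suc i) (s≤s z≤n) (subst (suc i ≤_) (sym lz) p) e) (cong suc lz))
                     (trans (sym (bump-self x (suc K))) (cong (bump x (suc K)) (sym e)))
  ... | no ne = trans (insB-o x z (suc i) (s≤s z≤n) (subst (suc i ≤_) (sym lz) p) ne) (sym (bump-other x (suc K) (z ! i) ne))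

  hB' : ∀ x (z : List ℕ) K → length z ≡ K → insB x z ! K ≡ x
  hB' x z K lz = subst (λ q → app (insB x z) (suc q) ≡ x) lz (insB-N x z)

  B-le : ∀ i → i < n → opB v ! i ≡ bump n (suc n) (v ! i)
  B-le i p = subst (λ q → opB v ! i ≡ bump q (suc q) (v ! i)) l (hB L v L refl i (subst (i <_) (sym l) p))
  B-n : opB v ! n ≡ n
  B-n = subst (λ q → opB v ! q ≡ q) l (hB' L v L refl)


  AC-lt : ∀ i → i < m → opAC v ! i ≡ bump n (suc (suc n)) (v ! i)
  AC-lt i p = subst (λ q → opAC v ! i ≡ bump q (suc (suc q)) (v ! i)) l
    (trans (hB L u (suc L) lu i (m<n⇒m<1+n (lx (m<n⇒m<1+n p)))) (cong (bump L (suc (suc L))) (A-lt i p)))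
  AC-m : opAC v ! m ≡ suc n
  AC-m = trans (subst (λ q → opAC v ! m ≡ bump q (suc (suc q)) (u ! m)) l (hB L u (suc L) lu m (m<n⇒m<1+n (subst (m <_) (sym l) (n<1+n m)))))
               (trans (cong (bump n (suc (suc n))) A-m) (bump-other n _ (suc n) (λ e → <-irrefl (sym e) ≤-refl)))
  AC-sm : opAC v ! suc m ≡ bump n (suc (suc n)) (v ! m)
  AC-sm = trans (subst (λ q → opAC v ! suc m ≡ bump q (suc (suc q)) (u ! suc m)) l (hB L u (suc L) lu (suc m) (subst (suc m <_) (cong suc (sym l)) ≤-refl)))
                (cong (bump n (suc (suc n))) A-sm)
  AC-ssm : opAC v ! suc (suc m) ≡ n
  AC-ssm = subst (λ q → opAC v ! suc q ≡ q) l (hB' L u (suc L) lu)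


  D-lt : ∀ i → i < m → opD v ! i ≡ bump n (suc n) (v ! i)
  D-lt i p = trans (insA-o L u' (suc i) (s≤s z≤n) (subst (suc i ≤_) (sym lu') (m≤n⇒m≤1+n (lx (m<n⇒m<1+n p)))) (ne-L p))
                   (B-le i (m<n⇒m<1+n p))
  D-m : opD v ! m ≡ suc (suc n)
  D-m = subst (λ q → app (opD v) q ≡ suc (suc q)) l
          (trans (insA-x L u' (subst (1 ≤_) (sym l) (s≤s z≤n)) (subst (L ≤_) (sym lu') (n≤1+n L))) (cong suc lu'))
  D-sm : opD v ! suc m ≡ n
  D-sm = trans (subst (λ q → app (opD v) (suc q) ≡ app u' (suc q)) l
                 (insA-o L u' (suc L) (s≤s z≤n) (≤-reflexive (sym lu')) (λ e → <-irrefl (sym e) ≤-refl))) B-n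
  D-ssm : opD v ! suc (suc m) ≡ bump n (suc n) (v ! m)
  D-ssm = trans (subst (λ q → app (opD v) (suc (suc q)) ≡ app u' q) l
                   (subst (λ q → app (insA L u') (suc q) ≡ app u' L) lu' (insA-N L u' (subst (L ≤_) (sym lu') (n≤1+n L)))))
                (B-le m ≤-refl)

Occ4-reflect : ∀ v s1 s2 s3 s4 (h : ℕ → ℕ) (D : ℕ → Set) → (∀ y z → D y → D z → y < z → h y < h z) →
  ∀ i j k l → i < j → j < k → k < l → l < length v → D (v ! i) → D (v ! j) → D (v ! k) → D (v ! l) →
  ∀ a b c d → a ≡ h (v ! i) → b ≡ h (v ! j) → c ≡ h (v ! k) → d ≡ h (v ! l) →
  orderIsoᵇ (a ∷ b ∷ c ∷ d ∷ []) (s1 ∷ s2 ∷ s3 ∷ s4 ∷ []) ≡ true → Occ4 v (s1 ∷ s2 ∷ s3 ∷ s4 ∷ [])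
Occ4-reflect v s1 s2 s3 s4 h D mono i j k l ij jk kl lv Di Dj Dk Dl a b c d refl refl refl refl iso =
  i , j , k , l , ij , jk , kl , lv ,
  trans (sym (orderIso4-cong (v ! i) (v ! j) (v ! k) (v ! l) (h (v ! i)) (h (v ! j)) (h (v ! k)) (h (v ! l)) s1 s2 s3 s4
     (mc (v ! i) (v ! j) Di Dj) (mc (v ! i) (v ! k) Di Dk) (mc (v ! i) (v ! l) Di Dl)
     (mc (v ! j) (v ! k) Dj Dk) (mc (v ! j) (v ! l) Dj Dl) (mc (v ! k) (v ! l) Dk Dl))) iso
  where
  mc : ∀ x y → D x → D y → (h y <ᵇ h x) ≡ (y <ᵇ x)
  mc x y Dx Dy = monotone⇒<ᵇ-preserved h D mono x y Dx Dy

id-mono : ∀ (D : ℕ → Set) → ∀ y z → D y → D z → y < z → id y < id z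
id-mono D y z _ _ p = p

Occ4-transport : ∀ v w s1 s2 s3 s4 (f : ℕ → ℕ) (h : ℕ → ℕ) (D : ℕ → Set) → (∀ y z → D y → D z → y < z → h y < h z) →
  (∀ i j → i < j → j < length v → f i < f j) → (∀ i → i < length v → f i < length w) →
  (∀ i → i < length v → D (v ! i)) → (∀ i → i < length v → w ! f i ≡ h (v ! i)) →
  Occ4 v (s1 ∷ s2 ∷ s3 ∷ s4 ∷ []) → Occ4 w (s1 ∷ s2 ∷ s3 ∷ s4 ∷ [])
Occ4-transport v w s1 s2 s3 s4 f h D mono fm fb Dv hw (i , j , k , l , ij , jk , kl , lv , iso) =
  f i , f j , f k , f l , fm i j ij jv , fm j k jk kv , fm k l kl lv , fb l lv ,
  trans (orderIso4-cong (v ! i) (v ! j) (v ! k) (v ! l) (w ! f i) (w ! f j) (w ! f k) (w ! f l) s1 s2 s3 s4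
     (mc i j iv jv) (mc i k iv kv) (mc i l iv lv) (mc j k jv kv) (mc j l jv lv) (mc k l kv lv)) iso
  where
  kv = <-trans kl lv
  jv = <-trans jk kv
  iv = <-trans ij jv
  mc : ∀ x y → x < length v → y < length v → (w ! f y <ᵇ w ! f x) ≡ (v ! y <ᵇ v ! x)
  mc x y xv yv rewrite hw x xv | hw y yv = monotone⇒<ᵇ-preserved h D mono (v ! x) (v ! y) (Dv x xv) (Dv y yv)

P4321 P3412 : List ℕ
P4321 = 4 ∷ 3 ∷ 2 ∷ 1 ∷ []
P3412 = 3 ∷ 4 ∷ 1 ∷ 2 ∷ []

perm-le : ∀ M w → IsPerm M w → ∀ i → i < M → w ! i ≤ M
perm-le M w P i p = proj₂ (proj₁ (proj₂ P) i p)

perm-inj0 : ∀ M w → IsPerm M w → ∀ i j → i < M → j < M → w ! i ≡ w ! j → i ≡ j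
perm-inj0 M w (l , _ , inj) i j p q e = inj i j (subst (i <_) (sym l) p) (subst (j <_) (sym l) q) e

permA : ∀ m v → IsPerm (suc m) v → IsPerm (suc (suc m)) (opA v)
permA m v PV = insA-perm (suc m) (length v) v PV (subst (1 ≤_) (sym (proj₁ PV)) (s≤s z≤n)) (≤-reflexive (proj₁ PV))

permB : ∀ m v → IsPerm (suc m) v → IsPerm (suc (suc m)) (opB v)
permB m v PV = insB-perm (suc m) (length v) v PV (subst (1 ≤_) (sym (proj₁ PV)) (s≤s z≤n)) (≤-reflexive (proj₁ PV))

permAC : ∀ m v → IsPerm (suc m) v → IsPerm (suc (suc (suc m))) (opAC v)
permAC m v PV = insB-perm (suc (suc m)) (length v) (insA (length v) v) (permA m v PV)
  (subst (1 ≤_) (sym (proj₁ PV)) (s≤s z≤n)) (≤-trans (≤-reflexive (proj₁ PV)) (n≤1+n _))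

permD : ∀ m v → IsPerm (suc m) v → IsPerm (suc (suc (suc m))) (opD v)
permD m v PV = insA-perm (suc (suc m)) (length v) (insB (length v) v) (permB m v PV)
  (subst (1 ≤_) (sym (proj₁ PV)) (s≤s z≤n)) (≤-trans (≤-reflexive (proj₁ PV)) (n≤1+n _))

module PermTables (m : ℕ) (v : List ℕ) (PV : IsPerm (suc m) v) where
  open Tables m v (proj₁ PV) public
  vb : ∀ i → i < n → v ! i ≤ n
  vb = perm-le n v PV
  Dn : ℕ → Set
  Dn y = y ≤ n
  lv : length v ≡ n
  lv = proj₁ PV
  h1 h2 : ℕ → ℕ
  h1 = bump n (suc n)
  h2 = bump n (suc (suc n))
  m1 : ∀ y z → Dn y → Dn z → y < z → h1 y < h1 z
  m1 = bump-mono n (suc n) ≤-refl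
  m2 : ∀ y z → Dn y → Dn z → y < z → h2 y < h2 z
  m2 = bump-mono n (suc (suc n)) (<-trans (n<1+n _) (n<1+n _))
  lenA : length (opA v) ≡ suc n
  lenA = trans (length-insA (length v) v) (cong suc lv)
  lenB : length (opB v) ≡ suc n
  lenB = trans (length-insB (length v) v) (cong suc lv)
  lenAC : length (opAC v) ≡ suc (suc n)
  lenAC = trans (length-insB (length v) (insA (length v) v)) (cong suc lenA)
  lenD : length (opD v) ≡ suc (suc n)
  lenD = trans (length-insA (length v) (insB (length v) v)) (cong suc lenB)

-- An occurrence in opX v either misses the new entries, and then it is an occurrence in v, or it
-- uses one of them, and the sizes of the new entries rule that out.
module Occ4Avoidance (m : ℕ) (v : List ℕ) (PV : IsPerm (suc m) v) (no4 : ¬ Occ4 v P4321) (no3 : ¬ Occ4 v P3412) where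
  open PermTables m v PV

  occ-from-v : ∀ s1 s2 s3 s4 (h : ℕ → ℕ) → (∀ y z → Dn y → Dn z → y < z → h y < h z) →
    ∀ i j k q → i < j → j < k → k < q → q < n → ∀ a b c d →
    a ≡ h (v ! i) → b ≡ h (v ! j) → c ≡ h (v ! k) → d ≡ h (v ! q) →
    orderIsoᵇ (a ∷ b ∷ c ∷ d ∷ []) (s1 ∷ s2 ∷ s3 ∷ s4 ∷ []) ≡ true → Occ4 v (s1 ∷ s2 ∷ s3 ∷ s4 ∷ [])
  occ-from-v s1 s2 s3 s4 h mono i j k q ij jk kq qn a b c d ea eb ec ed iso =
    Occ4-reflect v s1 s2 s3 s4 h Dn mono i j k q ij jk kq (subst (q <_) (sym lv) qn)
      (vb i (<-trans ij (<-trans jk (<-trans kq qn)))) (vb j (<-trans jk (<-trans kq qn))) (vb k (<-trans kq qn)) (vb q qn)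
      a b c d ea eb ec ed iso

  opA-no4321 : ¬ Occ4 (opA v) P4321
  opA-no4321 (i , j , k , q , ij , jk , kq , qw , iso) with iso4321⁻ {opA v ! i} {opA v ! j} {opA v ! k} {opA v ! q} iso | <-cmp q m
  ... | (ba , cb , dc) | tri< q<m _ _ = no4 (occ-from-v 4 3 2 1 id (id-mono Dn) i j k q ij jk kq (m<n⇒m<1+n q<m) (opA v ! i) (opA v ! j) (opA v ! k) (opA v ! q)
        (A-lt i (<-trans ij (<-trans jk (<-trans kq q<m)))) (A-lt j (<-trans jk (<-trans kq q<m))) (A-lt k (<-trans kq q<m)) (A-lt q q<m) iso)
  ... | (ba , cb , dc) | tri≈ _ refl _ = <⇒≱ dc (subst₂ _≤_ (sym (A-lt k kq)) (sym A-m) (≤-trans (vb k (m<n⇒m<1+n kq)) (n≤1+n n)))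
  ... | (ba , cb , dc) | tri> _ _ m<q with <-cmp k m
  ...   | tri< k<m _ _ = no4 (occ-from-v 4 3 2 1 id (id-mono Dn) i j k m ij jk k<m ≤-refl (opA v ! i) (opA v ! j) (opA v ! k) (opA v ! q)
          (A-lt i (<-trans ij (<-trans jk k<m))) (A-lt j (<-trans jk k<m)) (A-lt k k<m) (trans (cong (opA v !_) (sq q m<q qw)) A-sm) iso)
    where
    sq : ∀ q → m < q → q < length (opA v) → q ≡ suc m
    sq q p r = ≤-antisym (≤-pred (subst (q <_) (trans (length-insA (length v) v) (cong suc lv)) r)) p
  ...   | tri≈ _ refl _ = <⇒≱ cb (subst₂ _≤_ (sym (A-lt j jk)) (sym A-m) (≤-trans (vb j (m<n⇒m<1+n jk)) (n≤1+n n)))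
  ...   | tri> _ _ m<k = <⇒≱ m<k (≤-pred (subst (k <_) (sq q m<q qw) kq))
    where
    sq : ∀ q → m < q → q < length (opA v) → q ≡ suc m
    sq q p r = ≤-antisym (≤-pred (subst (q <_) (trans (length-insA (length v) v) (cong suc lv)) r)) p

  sq1 : ∀ {q} → m < q → q < suc n → q ≡ suc m
  sq1 p r = ≤-antisym (≤-pred r) p

  opA-no3412 : ¬ Occ4 (opA v) P3412
  opA-no3412 (i , j , k , q , ij , jk , kq , qw , iso) with iso3412⁻ {opA v ! i} {opA v ! j} {opA v ! k} {opA v ! q} iso | <-cmp q m
  ... | _ | tri< q<m _ _ = no3 (occ-from-v 3 4 1 2 id (id-mono Dn) i j k q ij jk kq (m<n⇒m<1+n q<m) (opA v ! i) (opA v ! j) (opA v ! k) (opA v ! q)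
        (A-lt i (<-trans ij (<-trans jk (<-trans kq q<m)))) (A-lt j (<-trans jk (<-trans kq q<m))) (A-lt k (<-trans kq q<m)) (A-lt q q<m) iso)
  ... | (ab , ca , da , cb , db , cd) | tri≈ _ refl _ = <⇒≱ da (subst₂ _≤_ (sym (A-lt i im)) (sym A-m) (≤-trans (vb i (m<n⇒m<1+n im)) (n≤1+n n)))
    where im = <-trans ij (<-trans jk kq)
  ... | (ab , ca , da , cb , db , cd) | tri> _ _ m<q with <-cmp k m
  ...   | tri< k<m _ _ = no3 (occ-from-v 3 4 1 2 id (id-mono Dn) i j k m ij jk k<m ≤-refl (opA v ! i) (opA v ! j) (opA v ! k) (opA v ! q)
          (A-lt i (<-trans ij (<-trans jk k<m))) (A-lt j (<-trans jk k<m)) (A-lt k k<m)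
          (trans (cong (opA v !_) (sq1 m<q (subst (q <_) lenA qw))) A-sm) iso)
  ...   | tri≈ _ refl _ = <⇒≱ ca (subst₂ _≤_ (sym (A-lt i (<-trans ij jk))) (sym A-m) (≤-trans (vb i (m<n⇒m<1+n (<-trans ij jk))) (n≤1+n n)))
  ...   | tri> _ _ m<k = <⇒≱ m<k (≤-pred (subst (k <_) (sq1 m<q (subst (q <_) lenA qw)) kq))

  module ViaB where
    W = opB v
    PW = permB m v PV
    WB : ∀ i → i < suc n → W ! i ≤ suc n
    WB = perm-le (suc n) W PW
    Wi : ∀ i j → i < suc n → j < suc n → W ! i ≡ W ! j → i ≡ j
    Wi = perm-inj0 (suc n) W PW

    opB-no4321 : ¬ Occ4 (opB v) P4321
    opB-no4321 (i , j , k , q , ij , jk , kq , qw , iso) with iso4321⁻ {W ! i} {W ! j} {W ! k} {W ! q} iso | <-cmp q n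
    ... | _ | tri< q<n _ _ = no4 (occ-from-v 4 3 2 1 h1 m1 i j k q ij jk kq q<n (W ! i) (W ! j) (W ! k) (W ! q)
          (B-le i (<-trans ij (<-trans jk (<-trans kq q<n)))) (B-le j (<-trans jk (<-trans kq q<n))) (B-le k (<-trans kq q<n)) (B-le q q<n) iso)
    ... | (ba , cb , dc) | tri≈ _ refl _ = <⇒≱ (≤-trans (s≤s (subst (_< W ! k) B-n dc)) cb) (WB j (<-trans jk (<-trans kq qw')))
      where qw' = subst (q <_) lenB qw
    ... | _ | tri> _ _ n<q = <⇒≱ n<q (≤-pred (subst (q <_) lenB qw))

    opB-no3412 : ¬ Occ4 (opB v) P3412
    opB-no3412 (i , j , k , q , ij , jk , kq , qw , iso) with iso3412⁻ {W ! i} {W ! j} {W ! k} {W ! q} iso | <-cmp q n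
    ... | _ | tri< q<n _ _ = no3 (occ-from-v 3 4 1 2 h1 m1 i j k q ij jk kq q<n (W ! i) (W ! j) (W ! k) (W ! q)
          (B-le i (<-trans ij (<-trans jk (<-trans kq q<n)))) (B-le j (<-trans jk (<-trans kq q<n))) (B-le k (<-trans kq q<n)) (B-le q q<n) iso)
    ... | (ab , ca , da , cb , db , cd) | tri≈ _ refl _ =
      <-irrefl (Wi i j i< j< (trans ai (sym bj))) ij
      where
      qw' = subst (q <_) lenB qw
      j< = <-trans jk (<-trans kq qw')
      i< = <-trans ij j<
      ai : W ! i ≡ suc n
      ai = ≤-antisym (WB i i<) (subst (_< W ! i) B-n da)
      bj : W ! j ≡ suc n
      bj = ≤-antisym (WB j j<) (subst (_< W ! j) B-n db)
    ... | _ | tri> _ _ n<q = <⇒≱ n<q (≤-pred (subst (q <_) lenB qw))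

  sq2 : ∀ {q} → suc m < q → q < suc (suc n) → q ≡ suc (suc m)
  sq2 p r = ≤-antisym (≤-pred r) p

  open ViaB public using (opB-no4321; opB-no3412)

  module ViaAC where
    W = opAC v
    PW = permAC m v PV
    WB : ∀ i → i < suc (suc n) → W ! i ≤ suc (suc n)
    WB = perm-le (suc (suc n)) W PW
    Wi : ∀ i j → i < suc (suc n) → j < suc (suc n) → W ! i ≡ W ! j → i ≡ j
    Wi = perm-inj0 (suc (suc n)) W PW
    lw : ∀ {q} → q < length W → q < suc (suc n)
    lw {q} p = subst (q <_) lenAC p

    opAC-no4321 : ¬ Occ4 (opAC v) P4321
    opAC-no4321 (i , j , k , q , ij , jk , kq , qw , iso) with iso4321⁻ {W ! i} {W ! j} {W ! k} {W ! q} iso | <-cmp q m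
    ... | _ | tri< q<m _ _ = no4 (occ-from-v 4 3 2 1 h2 m2 i j k q ij jk kq (m<n⇒m<1+n q<m) (W ! i) (W ! j) (W ! k) (W ! q)
          (AC-lt i (<-trans ij (<-trans jk (<-trans kq q<m)))) (AC-lt j (<-trans jk (<-trans kq q<m))) (AC-lt k (<-trans kq q<m)) (AC-lt q q<m) iso)
    ... | (ba , cb , dc) | tri≈ _ refl _ = <⇒≱ (≤-trans (s≤s (subst (_< W ! k) AC-m dc)) cb) (WB j (<-trans jk (<-trans kq (lw qw))))
    ... | (ba , cb , dc) | tri> _ _ m<q with <-cmp q (suc m)
    ...   | tri< q<sm _ _ = <⇒≱ m<q (≤-pred q<sm)
    ...   | tri≈ _ refl _ with <-cmp k m
    ...     | tri< k<m _ _ = no4 (occ-from-v 4 3 2 1 h2 m2 i j k m ij jk k<m ≤-refl (W ! i) (W ! j) (W ! k) (W ! q)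
              (AC-lt i (<-trans ij (<-trans jk k<m))) (AC-lt j (<-trans jk k<m)) (AC-lt k k<m) AC-sm iso)
    ...     | tri≈ _ refl _ = <⇒≱ (≤-trans (s≤s (subst (_< W ! j) AC-m cb)) ba) (WB i (<-trans ij (<-trans jk (lw (<-trans kq qw)))))
    ...     | tri> _ _ m<k = <⇒≱ m<k (≤-pred kq)
    opAC-no4321 (i , j , k , q , ij , jk , kq , qw , iso) | (ba , cb , dc) | tri> _ _ m<q | tri> _ _ sm<q =
      <⇒≱ (≤-trans (s≤s (≤-trans (s≤s (subst (_< W ! k) (trans (cong (W !_) (sq2 sm<q (lw qw))) AC-ssm) dc)) cb)) ba)
                   (WB i (<-trans ij (<-trans jk (<-trans kq (lw qw)))))

    opAC-no3412 : ¬ Occ4 (opAC v) P3412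
    opAC-no3412 (i , j , k , q , ij , jk , kq , qw , iso) with iso3412⁻ {W ! i} {W ! j} {W ! k} {W ! q} iso | <-cmp q m
    ... | _ | tri< q<m _ _ = no3 (occ-from-v 3 4 1 2 h2 m2 i j k q ij jk kq (m<n⇒m<1+n q<m) (W ! i) (W ! j) (W ! k) (W ! q)
          (AC-lt i (<-trans ij (<-trans jk (<-trans kq q<m)))) (AC-lt j (<-trans jk (<-trans kq q<m))) (AC-lt k (<-trans kq q<m)) (AC-lt q q<m) iso)
    ... | (ab , ca , da , cb , db , cd) | tri≈ _ refl _ = <-irrefl (Wi i j i< j< (trans ai (sym bj))) ij
      where
      j< = <-trans jk (<-trans kq (lw qw))
      i< = <-trans ij j<
      ai = ≤-antisym (WB i i<) (subst (_< W ! i) AC-m da)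
      bj = ≤-antisym (WB j j<) (subst (_< W ! j) AC-m db)
    ... | (ab , ca , da , cb , db , cd) | tri> _ _ m<q with <-cmp q (suc m)
    ...   | tri< q<sm _ _ = <⇒≱ m<q (≤-pred q<sm)
    ...   | tri≈ _ refl _ with <-cmp k m
    ...     | tri< k<m _ _ = no3 (occ-from-v 3 4 1 2 h2 m2 i j k m ij jk k<m ≤-refl (W ! i) (W ! j) (W ! k) (W ! q)
              (AC-lt i (<-trans ij (<-trans jk k<m))) (AC-lt j (<-trans jk k<m)) (AC-lt k k<m) AC-sm iso)
    ...     | tri≈ _ refl _ = <-irrefl (Wi i j i< j< (trans ai (sym bj))) ij
      where
      j< = <-trans jk (lw (<-trans kq qw))
      i< = <-trans ij j<
      ai = ≤-antisym (WB i i<) (subst (_< W ! i) AC-m ca)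
      bj = ≤-antisym (WB j j<) (subst (_< W ! j) AC-m cb)
    ...     | tri> _ _ m<k = <⇒≱ m<k (≤-pred kq)
    opAC-no3412 (i , j , k , q , ij , jk , kq , qw , iso) | (ab , ca , da , cb , db , cd) | tri> _ _ m<q | tri> _ _ sm<q = contra
      where
      q≡ = sq2 sm<q (lw qw)
      j< = <-trans jk (<-trans kq (lw qw))
      i< = <-trans ij j<
      dn : W ! q ≡ n
      dn = trans (cong (W !_) q≡) AC-ssm
      a≠b : W ! i ≢ W ! j
      a≠b e = <-irrefl (Wi i j i< j< e) ij
      a<b : W ! i < W ! j
      a<b = ≤∧≢⇒< ab a≠b
      ai : W ! i ≡ suc n
      ai = ≤-antisym (≤-pred (<-≤-trans a<b (WB j j<))) (subst (_< W ! i) dn da)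
      im : i ≡ m
      im = Wi i m i< (m<n⇒m<1+n (m<n⇒m<1+n ≤-refl)) (trans ai (sym AC-m))
      contra : ⊥
      contra = <⇒≱ (≤-trans (s≤s (subst (_< j) im ij)) jk) (≤-pred (subst (k <_) q≡ kq))

  open ViaAC public using (opAC-no4321; opAC-no3412)

  module ViaD where
    W = opD v
    PW = permD m v PV
    WB : ∀ i → i < suc (suc n) → W ! i ≤ suc (suc n)
    WB = perm-le (suc (suc n)) W PW
    Wi : ∀ i j → i < suc (suc n) → j < suc (suc n) → W ! i ≡ W ! j → i ≡ j
    Wi = perm-inj0 (suc (suc n)) W PW
    lw : ∀ {q} → q < length W → q < suc (suc n)
    lw {q} p = subst (q <_) lenD p
    mI : m < suc (suc n)
    mI = m<n⇒m<1+n (m<n⇒m<1+n ≤-refl)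

    opD-no4321 : ¬ Occ4 (opD v) P4321
    opD-no4321 (i , j , k , q , ij , jk , kq , qw , iso) with iso4321⁻ {W ! i} {W ! j} {W ! k} {W ! q} iso | <-cmp q m
    ... | _ | tri< q<m _ _ = no4 (occ-from-v 4 3 2 1 h1 m1 i j k q ij jk kq (m<n⇒m<1+n q<m) (W ! i) (W ! j) (W ! k) (W ! q)
          (D-lt i (<-trans ij (<-trans jk (<-trans kq q<m)))) (D-lt j (<-trans jk (<-trans kq q<m))) (D-lt k (<-trans kq q<m)) (D-lt q q<m) iso)
    ... | (ba , cb , dc) | tri≈ _ refl _ = <⇒≱ (subst (_< W ! k) D-m dc) (WB k (<-trans kq (lw qw)))
    ... | (ba , cb , dc) | tri> _ _ m<q with <-cmp q (suc m)
    ...   | tri< q<sm _ _ = <⇒≱ m<q (≤-pred q<sm)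
    ...   | tri≈ _ refl _ = <⇒≱ (≤-trans (s≤s (≤-trans (s≤s (subst (_< W ! k) D-sm dc)) cb)) ba) (WB i (<-trans ij (<-trans jk (<-trans kq (lw qw)))))
    ...   | tri> _ _ sm<q with <-cmp k m
    ...     | tri< k<m _ _ = no4 (occ-from-v 4 3 2 1 h1 m1 i j k m ij jk k<m ≤-refl (W ! i) (W ! j) (W ! k) (W ! q)
              (D-lt i (<-trans ij (<-trans jk k<m))) (D-lt j (<-trans jk k<m)) (D-lt k k<m)
              (trans (cong (W !_) (sq2 sm<q (lw qw))) D-ssm) iso)
    ...     | tri≈ _ refl _ = <⇒≱ (subst (_< W ! j) D-m cb) (WB j (<-trans jk (lw (<-trans kq qw))))
    ...     | tri> _ _ m<k with <-cmp k (suc m)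
    ...       | tri< k<sm _ _ = <⇒≱ m<k (≤-pred k<sm)
    ...       | tri> _ _ sm<k = <⇒≱ sm<k (≤-pred (subst (k <_) (sq2 sm<q (lw qw)) kq))
    ...       | tri≈ _ refl _ = <⇒≱ (subst (_< j) im ij) (≤-pred jk)
      where
      i< = <-trans ij (<-trans jk (lw (<-trans kq qw)))
      ai : W ! i ≡ suc (suc n)
      ai = ≤-antisym (WB i i<) (≤-trans (s≤s (subst (_< W ! j) D-sm cb)) ba)
      im : i ≡ m
      im = Wi i m i< mI (trans ai (sym D-m))

    opD-no3412 : ¬ Occ4 (opD v) P3412
    opD-no3412 (i , j , k , q , ij , jk , kq , qw , iso) with iso3412⁻ {W ! i} {W ! j} {W ! k} {W ! q} iso | <-cmp q m
    ... | _ | tri< q<m _ _ = no3 (occ-from-v 3 4 1 2 h1 m1 i j k q ij jk kq (m<n⇒m<1+n q<m) (W ! i) (W ! j) (W ! k) (W ! q)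
          (D-lt i (<-trans ij (<-trans jk (<-trans kq q<m)))) (D-lt j (<-trans jk (<-trans kq q<m))) (D-lt k (<-trans kq q<m)) (D-lt q q<m) iso)
    ... | (ab , ca , da , cb , db , cd) | tri≈ _ refl _ = <⇒≱ (subst (_< W ! i) D-m da) (WB i (<-trans ij (<-trans jk (<-trans kq (lw qw)))))
    ... | (ab , ca , da , cb , db , cd) | tri> _ _ m<q with <-cmp q (suc m)
    ...   | tri< q<sm _ _ = <⇒≱ m<q (≤-pred q<sm)
    ...   | tri≈ _ refl _ = <⇒≱ jm' (≤-pred kq)
      where
      j< = <-trans jk (<-trans kq (lw qw))
      i< = <-trans ij j<
      a<b : W ! i < W ! j
      a<b = ≤∧≢⇒< ab (λ e → <-irrefl (Wi i j i< j< e) ij)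
      bj : W ! j ≡ suc (suc n)
      bj = ≤-antisym (WB j j<) (≤-trans (s≤s (subst (_< W ! i) D-sm da)) a<b)
      jm : j ≡ m
      jm = Wi j m j< mI (trans bj (sym D-m))
      jm' : m < k
      jm' = subst (_< k) jm jk
    ...   | tri> _ _ sm<q with <-cmp k m
    ...     | tri< k<m _ _ = no3 (occ-from-v 3 4 1 2 h1 m1 i j k m ij jk k<m ≤-refl (W ! i) (W ! j) (W ! k) (W ! q)
              (D-lt i (<-trans ij (<-trans jk k<m))) (D-lt j (<-trans jk k<m)) (D-lt k k<m)
              (trans (cong (W !_) (sq2 sm<q (lw qw))) D-ssm) iso)
    ...     | tri≈ _ refl _ = <⇒≱ (subst (_< W ! i) D-m ca) (WB i (<-trans ij (<-trans jk (lw (<-trans kq qw)))))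
    ...     | tri> _ _ m<k with <-cmp k (suc m)
    ...       | tri< k<sm _ _ = <⇒≱ m<k (≤-pred k<sm)
    ...       | tri> _ _ sm<k = <⇒≱ sm<k (≤-pred (subst (k <_) (sq2 sm<q (lw qw)) kq))
    ...       | tri≈ _ refl _ = <-irrefl (Wi k q k< q< (trans cn (sym dn))) kq
      where
      q< = lw qw
      k< = <-trans kq q<
      j< = <-trans jk k<
      i< = <-trans ij j<
      cn : W ! k ≡ n
      cn = D-sm
      a<b : W ! i < W ! j
      a<b = ≤∧≢⇒< ab (λ e → <-irrefl (Wi i j i< j< e) ij)
      an : W ! i ≡ suc n
      an = ≤-antisym (≤-pred (<-≤-trans a<b (WB j j<))) (subst (_< W ! i) cn ca)
      dn : W ! q ≡ n
      dn = ≤-antisym (≤-pred (subst (W ! q <_) an da)) (subst (_≤ W ! q) cn cd)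

  open ViaD public using (opD-no4321; opD-no3412)

skip2 : ℕ → ℕ → ℕ
skip2 K t with t <? K
... | yes _ = t
... | no _ = suc (suc t)

skip2-< : ∀ K t → t < K → skip2 K t ≡ t
skip2-< K t p with t <? K
... | yes _ = refl
... | no np = ⊥-elim (np p)

skip2-≥ : ∀ K t → K ≤ t → skip2 K t ≡ suc (suc t)
skip2-≥ K t p with t <? K
... | yes q = ⊥-elim (<⇒≱ q p)
... | no _ = refl

skip2-mono : ∀ K s t → s < t → skip2 K s < skip2 K t
skip2-mono K s t p with s <? K | t <? K
... | yes _ | yes _ = p
... | yes _ | no _ = m<n⇒m<1+n (m<n⇒m<1+n p)
... | no a | yes b = ⊥-elim (a (<-trans p b))
... | no _ | no _ = s≤s (s≤s p)

-- The old positions sit inside opX v in the same order, with values changed by a monotone bump.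
module Occ4Lift (m : ℕ) (v : List ℕ) (PV : IsPerm (suc m) v) where
  open PermTables m v PV

  im : ∀ {i} → i < length v → i < suc m
  im {i} p = subst (i <_) lv p
  Dv : ∀ i → i < length v → Dn (v ! i)
  Dv i p = vb i (im p)

  Occ4-opA : ∀ s1 s2 s3 s4 → Occ4 v (s1 ∷ s2 ∷ s3 ∷ s4 ∷ []) → Occ4 (opA v) (s1 ∷ s2 ∷ s3 ∷ s4 ∷ [])
  Occ4-opA s1 s2 s3 s4 = Occ4-transport v (opA v) s1 s2 s3 s4 (skip m) id Dn (id-mono Dn)
    (λ i j ij _ → skip-mono m i j ij) (λ i p → subst (skip m i <_) (sym lenA) (skip-bound m n i (im p))) Dv val
    where
    val : ∀ i → i < length v → opA v ! skip m i ≡ v ! i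
    val i p with <-cmp i m
    ... | tri< q _ _ = trans (cong (opA v !_) (skip-< m i q)) (A-lt i q)
    ... | tri≈ _ refl _ = trans (cong (opA v !_) (skip-≥ m i ≤-refl)) A-sm
    ... | tri> _ _ q = ⊥-elim (<-irrefl refl (<-≤-trans q (≤-pred (im p))))

  Occ4-opB : ∀ s1 s2 s3 s4 → Occ4 v (s1 ∷ s2 ∷ s3 ∷ s4 ∷ []) → Occ4 (opB v) (s1 ∷ s2 ∷ s3 ∷ s4 ∷ [])
  Occ4-opB s1 s2 s3 s4 = Occ4-transport v (opB v) s1 s2 s3 s4 id h1 Dn m1
    (λ i j ij _ → ij) (λ i p → subst (i <_) (sym lenB) (m<n⇒m<1+n (im p))) Dv (λ i p → B-le i (im p))

  Occ4-opAC : ∀ s1 s2 s3 s4 → Occ4 v (s1 ∷ s2 ∷ s3 ∷ s4 ∷ []) → Occ4 (opAC v) (s1 ∷ s2 ∷ s3 ∷ s4 ∷ [])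
  Occ4-opAC s1 s2 s3 s4 = Occ4-transport v (opAC v) s1 s2 s3 s4 (skip m) h2 Dn m2
    (λ i j ij _ → skip-mono m i j ij) (λ i p → subst (skip m i <_) (sym lenAC) (m<n⇒m<1+n (skip-bound m n i (im p)))) Dv val
    where
    val : ∀ i → i < length v → opAC v ! skip m i ≡ h2 (v ! i)
    val i p with <-cmp i m
    ... | tri< q _ _ = trans (cong (opAC v !_) (skip-< m i q)) (AC-lt i q)
    ... | tri≈ _ refl _ = trans (cong (opAC v !_) (skip-≥ m i ≤-refl)) AC-sm
    ... | tri> _ _ q = ⊥-elim (<-irrefl refl (<-≤-trans q (≤-pred (im p))))

  Occ4-opD : ∀ s1 s2 s3 s4 → Occ4 v (s1 ∷ s2 ∷ s3 ∷ s4 ∷ []) → Occ4 (opD v) (s1 ∷ s2 ∷ s3 ∷ s4 ∷ [])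
  Occ4-opD s1 s2 s3 s4 = Occ4-transport v (opD v) s1 s2 s3 s4 (skip2 m) h1 Dn m1
    (λ i j ij _ → skip2-mono m i j ij) bnd Dv val
    where
    bnd : ∀ i → i < length v → skip2 m i < length (opD v)
    bnd i p with <-cmp i m
    ... | tri< q _ _ = subst₂ _<_ (sym (skip2-< m i q)) (sym lenD) (<-trans q (<-trans (n<1+n m) (<-trans (n<1+n n) (n<1+n (suc n)))))
    ... | tri≈ _ refl _ = subst₂ _<_ (sym (skip2-≥ i i ≤-refl)) (sym lenD) ≤-refl
    ... | tri> _ _ q = ⊥-elim (<-irrefl refl (<-≤-trans q (≤-pred (im p))))
    val : ∀ i → i < length v → opD v ! skip2 m i ≡ h1 (v ! i)
    val i p with <-cmp i m
    ... | tri< q _ _ = trans (cong (opD v !_) (skip2-< m i q)) (D-lt i q)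
    ... | tri≈ _ refl _ = trans (cong (opD v !_) (skip2-≥ m i ≤-refl)) D-ssm
    ... | tri> _ _ q = ⊥-elim (<-irrefl refl (<-≤-trans q (≤-pred (im p))))

ρ213 ρ312 : List ℕ
ρ213 = 2 ∷ 1 ∷ 3 ∷ []
ρ312 = 3 ∷ 1 ∷ 2 ∷ []

module GoodFacts (ρ : List ℕ) (m : ℕ) (v : List ℕ) (G : Good ρ (suc m) v) (m1 : 1 ≤ m) where
  open Good G public
  n = suc m
  L = length v
  lv : L ≡ n
  lv = proj₁ perm
  L1 : 1 ≤ L
  L1 = subst (1 ≤_) (sym lv) (s≤s z≤n)
  Ln : L ≤ n
  Ln = ≤-reflexive lv
  kk = orbit-onto n v perm cyc L L1 Ln
  k = proj₁ kk
  kn : k < n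
  kn = proj₁ (proj₂ kk)
  ok : orbit v k ≡ L
  ok = proj₂ (proj₂ kk)
  ok' : orbit v k ≡ n
  ok' = trans ok lv
  k1 : 1 ≤ k
  k1 with k | ok'
  ... | zero | e = ⊥-elim (<-irrefl (suc-injective e) m1)
  ... | suc _ | _ = s≤s z≤n
  n1 : 1 ≤ n
  n1 = s≤s z≤n

  uA = opA v
  uB = opB v
  PA : IsPerm (suc n) uA
  PA = permA m v perm
  PB : IsPerm (suc n) uB
  PB = permB m v perm
  oA : ∀ t → t ≤ n → orbit uA t ≡ insertSeq (orbit v) (suc k) (suc n) t
  oA = orbit-insA n L v k perm cyc L1 Ln kn ok
  oB : ∀ t → t ≤ n → orbit uB t ≡ insertSeq (orbit v) k (suc n) t
  oB = orbit-insB n L v k perm cyc L1 Ln k1 kn ok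
  CA : Cyc (suc n) uA
  CA = cyclic-insA n L v k perm cyc L1 Ln kn ok
  CB : Cyc (suc n) uB
  CB = cyclic-insB n L v k perm cyc L1 Ln k1 kn ok
  open Occ4Avoidance m v perm no4321 no3412 public using (opA-no4321; opA-no3412; opB-no4321; opB-no3412; opAC-no4321; opAC-no3412; opD-no4321; opD-no3412)

sound-A213 : ∀ m v → 1 ≤ m → Good ρ213 (suc m) v → Good ρ213 (suc (suc m)) (opA v)
sound-A213 m v m1 G = record { perm = PA ; cyc = CA ; no4321 = opA-no4321 ; no3412 = opA-no3412 ;
  noρ = insertMax-avoids213 n v perm cyc n1 (orbit uA) (suc k) kn oA k kn ok' ≤-refl noρ }
  where open GoodFacts ρ213 m v G m1

sound-B213 : ∀ m v → 1 ≤ m → Good ρ213 (suc m) v → Good ρ213 (suc (suc m)) (opB v)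
sound-B213 m v m1 G = record { perm = PB ; cyc = CB ; no4321 = opB-no4321 ; no3412 = opB-no3412 ;
  noρ = insertMax-avoids213 n v perm cyc n1 (orbit uB) k (<⇒≤ kn) oB k kn ok' (n≤1+n k) noρ }
  where open GoodFacts ρ213 m v G m1

sound-A312 : ∀ m v → 1 ≤ m → Good ρ312 (suc m) v → Good ρ312 (suc (suc m)) (opA v)
sound-A312 m v m1 G = record { perm = PA ; cyc = CA ; no4321 = opA-no4321 ; no3412 = opA-no3412 ;
  noρ = insertMax-avoids312 n v perm cyc n1 (orbit uA) (suc k) kn oA k kn ok' (n≤1+n k) noρ }
  where open GoodFacts ρ312 m v G m1

sound-B312 : ∀ m v → 1 ≤ m → Good ρ312 (suc m) v → Good ρ312 (suc (suc m)) (opB v)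
sound-B312 m v m1 G = record { perm = PB ; cyc = CB ; no4321 = opB-no4321 ; no3412 = opB-no3412 ;
  noρ = insertMax-avoids312 n v perm cyc n1 (orbit uB) k (<⇒≤ kn) oB k kn ok' ≤-refl noρ }
  where open GoodFacts ρ312 m v G m1

sound-AC213 : ∀ m v → 1 ≤ m → Good ρ213 (suc m) v → Good ρ213 (suc (suc (suc m))) (opAC v)
sound-AC213 m v m1 G = record { perm = permAC m v perm ; cyc = CW ; no4321 = opAC-no4321 ; no3412 = opAC-no3412 ;
  noρ = insertMax-avoids213 (suc n) uA PA CA (s≤s z≤n) (orbit (opAC v)) k (m≤n⇒m≤1+n (<⇒≤ kn)) oW (suc k) (s≤s kn) omax (m≤n⇒m≤1+n (n≤1+n k)) (Good.noρ GA) }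
  where
  open GoodFacts ρ213 m v G m1
  GA = sound-A213 m v m1 G
  ku : orbit uA k ≡ L
  ku = trans (oA k (<⇒≤ kn)) (trans (insertSeq-< (orbit v) (suc k) (suc n) k ≤-refl) ok)
  omax : orbit uA (suc k) ≡ suc n
  omax = trans (oA (suc k) kn) (insertSeq-≡ (orbit v) (suc k) (suc n))
  L'1 : L ≤ suc n
  L'1 = ≤-trans Ln (n≤1+n n)
  oW : ∀ t → t ≤ suc n → orbit (opAC v) t ≡ insertSeq (orbit uA) k (suc (suc n)) t
  oW = orbit-insB (suc n) L uA k PA CA L1 L'1 k1 (m<n⇒m<1+n kn) ku
  CW : Cyc (suc (suc n)) (opAC v)
  CW = cyclic-insB (suc n) L uA k PA CA L1 L'1 k1 (m<n⇒m<1+n kn) ku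

sound-D312 : ∀ m v → 1 ≤ m → Good ρ312 (suc m) v → Good ρ312 (suc (suc (suc m))) (opD v)
sound-D312 m v m1 G = record { perm = permD m v perm ; cyc = CW ; no4321 = opD-no4321 ; no3412 = opD-no3412 ;
  noρ = insertMax-avoids312 (suc n) uB PB CB (s≤s z≤n) (orbit (opD v)) (suc (suc k)) (s≤s kn) oW k (m<n⇒m<1+n kn) omax
          (m≤n⇒m≤1+n (n≤1+n k)) (Good.noρ GB) }
  where
  open GoodFacts ρ312 m v G m1
  GB = sound-B312 m v m1 G
  ku : orbit uB (suc k) ≡ L
  ku = trans (oB (suc k) kn) (trans (insertSeq-> (orbit v) k (suc n) (suc k) ≤-refl) ok)
  omax : orbit uB k ≡ suc n
  omax = trans (oB k (<⇒≤ kn)) (insertSeq-≡ (orbit v) k (suc n))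
  L'1 : L ≤ suc n
  L'1 = ≤-trans Ln (n≤1+n n)
  oW : ∀ t → t ≤ suc n → orbit (opD v) t ≡ insertSeq (orbit uB) (suc (suc k)) (suc (suc n)) t
  oW = orbit-insA (suc n) L uB (suc k) PB CB L1 L'1 (s≤s kn) ku
  CW : Cyc (suc (suc n)) (opD v)
  CW = cyclic-insA (suc n) L uB (suc k) PB CB L1 L'1 (s≤s kn) ku

module TopValues (ρ : List ℕ) (q : ℕ) (w : List ℕ) (G : Good ρ (suc (suc (suc q))) w) (q1 : 1 ≤ q) where
  open Good G public
  M T T1 T2 : ℕ
  M = suc (suc (suc q))
  T = M
  T1 = suc (suc q)
  T2 = suc q
  π : ℕ → ℕ
  π = app w
  o : ℕ → ℕ
  o = orbit w
  lw : length w ≡ M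
  lw = proj₁ perm
  rngπ : ∀ y → 1 ≤ y → y ≤ M → 1 ≤ π y × π y ≤ M
  rngπ = perm-rng M w perm
  injπ : ∀ y z → 1 ≤ y → y ≤ M → 1 ≤ z → z ≤ M → π y ≡ π z → y ≡ z
  injπ = perm-inj M w perm
  rngo : ∀ t → 1 ≤ o t × o t ≤ M
  rngo = orbit-range M w perm (s≤s z≤n)
  I : ∀ y → 1 ≤ y → y ≤ M → ∃ λ k → k < M × o k ≡ y
  I = orbit-onto M w perm cyc
  close : o M ≡ 1
  close with I (o M) (proj₁ (rngo M)) (proj₂ (rngo M))
  ... | zero , _ , e = sym e
  ... | suc t , tM , e = ⊥-elim (<-irrefl tt (s≤s (≤-pred tM)))
    where
    e' : π (o t) ≡ π (o (suc (suc q)))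
    e' = e
    ot : o t ≡ o (suc (suc q))
    ot = injπ (o t) (o (suc (suc q))) (proj₁ (rngo t)) (proj₂ (rngo t)) (proj₁ (rngo (suc (suc q)))) (proj₂ (rngo (suc (suc q)))) e'
    tt : suc t ≡ M
    tt = cong suc (cyc t (suc (suc q)) (<-trans (n<1+n t) tM) ≤-refl ot)
  below : ∀ {y z} → y ≤ suc z → y ≢ suc z → y ≤ z
  below p ne = ≤-pred (≤∧≢⇒< p ne)
  belowT1 : ∀ y → y ≤ M → y ≢ T → y ≢ T1 → y < T1
  belowT1 y p a b = ≤∧≢⇒< (below p a) b
  idx1 : ∀ t → 1 ≤ t → suc (pred t) ≡ t
  idx1 (suc t) _ = refl
  pk : ∀ t → 1 ≤ t → pred t < t
  pk (suc t) _ = ≤-refl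
  πo' : ∀ t → 1 ≤ t → π (o (pred t)) ≡ o t
  πo' t p = cong o (idx1 t p)
  mk4 : ∀ σ P1 P2 P3 P4 → 1 ≤ P1 → P1 < P2 → P2 < P3 → P3 < P4 → P4 ≤ M →
        orderIsoᵇ (π P1 ∷ π P2 ∷ π P3 ∷ π P4 ∷ []) σ ≡ true → Occ4 w σ
  mk4 σ (suc i) (suc j) (suc k) (suc l) _ (s≤s ij) (s≤s jk) (s≤s kl) lM iso =
    i , j , k , l , ij , jk , kl , subst (l <_) (sym lw) lM , iso
  nz : ∀ t y → t < M → o t ≡ y → y ≢ 1 → 1 ≤ t
  nz zero y _ e ne = ⊥-elim (ne (sym e))
  nz (suc t) _ _ _ _ = s≤s z≤n
  T≢1 : T ≢ 1
  T≢1 ()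
  T1≢1 : T1 ≢ 1
  T1≢1 ()
  T≢T1 : T ≢ T1
  T≢T1 e = <-irrefl (sym e) ≤-refl
  kNs = I T (s≤s z≤n) ≤-refl
  kN = proj₁ kNs
  kNM = proj₁ (proj₂ kNs)
  okN : o kN ≡ T
  okN = proj₂ (proj₂ kNs)
  kPs = I T1 (s≤s z≤n) (n≤1+n _)
  kP = proj₁ kPs
  kPM = proj₁ (proj₂ kPs)
  okP : o kP ≡ T1
  okP = proj₂ (proj₂ kPs)
  kN1 : 1 ≤ kN
  kN1 = nz kN T kNM okN T≢1
  kP1 : 1 ≤ kP
  kP1 = nz kP T1 kPM okP T1≢1
  oLow : ∀ t → t < M → t ≢ kN → t ≢ kP → o t < T1
  oLow t tM a b = belowT1 (o t) (proj₂ (rngo t)) (λ e → a (cyc t kN tM kNM (trans e (sym okN))))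
                                              (λ e → b (cyc t kP tM kPM (trans e (sym okP))))

module Shape213 (q : ℕ) (w : List ℕ) (G : Good ρ213 (suc (suc (suc q))) w) (q1 : 1 ≤ q) where
  open TopValues ρ213 q w G q1

  no213 : ∀ t1 t2 t3 → t1 < t2 → t2 < t3 → t3 < M → o t2 < o t1 → o t1 < o t3 → ⊥
  no213 t1 t2 t3 p12 p23 p3 ba ac = noρ (t1 , t2 , t3 , p12 , p23 , p3 , iso213⁺ ba ac)

  -- Anything strictly between T1 and T in the cycle would be smaller than T1: a 213.
  T1-before-T : kP < kN → π T1 ≡ T
  T1-before-T kP<kN with <-cmp kP (pred kN)
  ... | tri≈ _ e _ = trans (cong π (sym okP)) (trans (cong o (trans (cong suc e) (idx1 kN kN1))) okN)
  ... | tri> _ _ g = ⊥-elim (<-irrefl refl (<-≤-trans g (≤-pred (subst (kP <_) (sym (idx1 kN kN1)) kP<kN))))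
  ... | tri< l _ _ = ⊥-elim (no213 kP (pred kN) kN l (pk kN kN1) kNM
                   (subst (o (pred kN) <_) (sym okP) (oLow (pred kN) (<-trans (pk kN kN1) kNM)
                      (λ e → <-irrefl e (pk kN kN1)) (λ e → <-irrefl (sym e) l)))
                   (subst₂ _<_ (sym okP) (sym okN) ≤-refl))

  -- The cycle reads … p T x … q' T1 u …, with at least one point between T and T1.
  module Gap (kN<kP : kN < kP) (skN<kP : suc kN < kP) where
    x = o (suc kN)
    q' = o (pred kP)
    u = π T1
    p = o (pred kN)
    πT : π T ≡ x
    πT = cong π (sym okN)
    πT1 : π T1 ≡ o (suc kP)
    πT1 = cong π (sym okP)
    πq' : π q' ≡ T1
    πq' = trans (πo' kP kP1) okP
    πp : π p ≡ T
    πp = trans (πo' kN kN1) okN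
    pkP = pk kP kP1
    pkN = pk kN kN1
    pkPM = <-trans pkP kPM
    pkNM = <-trans pkN kNM
    skNM = <-trans skN<kP kPM
    kN<pkP : kN < pred kP
    kN<pkP = ≤-pred (subst (suc kN <_) (sym (idx1 kP kP1)) skN<kP)
    pkN<pkP : pred kN < pred kP
    pkN<pkP = <-trans pkN kN<pkP
    q'<T1 : q' < T1
    q'<T1 = oLow (pred kP) pkPM (λ e → <-irrefl (sym e) kN<pkP) (λ e → <-irrefl e pkP)
    x<T1 : x < T1
    x<T1 = oLow (suc kN) skNM (λ e → <-irrefl (sym e) (n<1+n kN)) (λ e → <-irrefl e skN<kP)

    p<q' : p < q'
    p<q' with <-cmp p q'
    ... | tri< r _ _ = r
    ... | tri≈ _ e _ = ⊥-elim (<-irrefl (cyc (pred kN) (pred kP) pkNM pkPM e) pkN<pkP)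
    ... | tri> _ _ r = ⊥-elim (no213 (pred kN) (pred kP) kP pkN<pkP pkP kPM r
                   (subst (p <_) (sym okP) (oLow (pred kN) pkNM (λ e → <-irrefl e pkN) (λ e → <-irrefl e (<-trans pkN<pkP pkP)))))

    u<T1 : u < T1
    u<T1 = belowT1 u (proj₂ (rngπ T1 (s≤s z≤n) (n≤1+n _)))
      (λ e → <-irrefl (cyc (pred kN) kP pkNM kPM
                (trans (injπ p T1 (proj₁ (rngo (pred kN))) (proj₂ (rngo (pred kN))) (s≤s z≤n) (n≤1+n _) (trans πp (sym e)))
                       (sym okP)))
              (<-trans pkN kN<kP))
      (λ e → <-irrefl (cyc (pred kP) kP pkPM kPM
                (trans (injπ q' T1 (proj₁ (rngo (pred kP))) (proj₂ (rngo (pred kP))) (s≤s z≤n) (n≤1+n _) (trans πq' (sym e)))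
                       (sym okP)))
              pkP)

    -- Otherwise p q' T1 T carry the values T T1 u x, a 4321.
    u<x : u < x
    u<x with <-cmp u x
    ... | tri< r _ _ = r
    ... | tri≈ _ e _ = ⊥-elim (T≢T1 (sym (injπ T1 T (s≤s z≤n) (n≤1+n _) (s≤s z≤n) ≤-refl (trans e (sym πT)))))
    ... | tri> _ _ x<u = ⊥-elim (no4321 (mk4 P4321 p q' T1 T (proj₁ (rngo (pred kN))) p<q' q'<T1 ≤-refl ≤-refl
            (iso4321⁺ (subst₂ _<_ (sym πq') (sym πp) ≤-refl) (subst (u <_) (sym πq') u<T1) (subst (_< u) (sym πT) x<u))))

    -- Otherwise x q' T1 T carry the values π x, T1, u, x, a 3412.
    gap-one : suc kN ≡ pred kP
    gap-one with <-cmp (suc kN) (pred kP)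
    ... | tri≈ _ e _ = e
    ... | tri> _ _ g = ⊥-elim (<-irrefl refl (<-≤-trans g kN<pkP))
    ... | tri< l _ _ = ⊥-elim (no3412 (mk4 P3412 x q' T1 T (proj₁ (rngo (suc kN))) x<q' q'<T1 ≤-refl ≤-refl
            (iso3412⁺ (subst (u <_) (sym πT) u<x) (subst (_< π x) (sym πT) x<πx) (subst (π x <_) (sym πq') πx<T1))))
      where
      sskN = suc (suc kN)
      sskN<kP : sskN < kP
      sskN<kP = <-≤-trans (s≤s l) (≤-reflexive (idx1 kP kP1))
      x<q' : x < q'
      x<q' with <-cmp x q'
      ... | tri< r _ _ = r
      ... | tri≈ _ e _ = ⊥-elim (<-irrefl (cyc (suc kN) (pred kP) skNM pkPM e) l)
      ... | tri> _ _ r = ⊥-elim (no213 (suc kN) (pred kP) kP l pkP kPM r (subst (x <_) (sym okP) x<T1))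
      x<πx : x < π x
      x<πx with <-cmp x (π x)
      ... | tri< r _ _ = r
      ... | tri≈ _ e _ = ⊥-elim (<-irrefl (cyc (suc kN) sskN skNM (<-trans sskN<kP kPM) e) ≤-refl)
      ... | tri> _ _ r = ⊥-elim (no213 (suc kN) sskN kP ≤-refl sskN<kP kPM r (subst (x <_) (sym okP) x<T1))
      πx<T1 : π x < T1
      πx<T1 = oLow sskN (<-trans sskN<kP kPM) (λ e → <-irrefl (sym e) (<-trans (n<1+n kN) (n<1+n (suc kN))))
                (λ e → <-irrefl e sskN<kP)

    -- So the cycle reads … T x T1 u …; if x < T2, then wherever T2 sits it closes a 213.
    x≡T2 : x ≡ T2
    x≡T2 with x ≟ T2
    ... | yes e = e
    ... | no x≢T2 = ⊥-elim misplaced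
      where
      kQs = I T2 (s≤s z≤n) (≤-trans (n≤1+n _) (n≤1+n _))
      kQ = proj₁ kQs
      kQM = proj₁ (proj₂ kQs)
      okQ : o kQ ≡ T2
      okQ = proj₂ (proj₂ kQs)
      x<T2 : x < T2
      x<T2 = ≤∧≢⇒< (≤-pred x<T1) x≢T2
      kP≡ : kP ≡ suc (suc kN)
      kP≡ = trans (sym (idx1 kP kP1)) (cong suc (sym gap-one))
      misplaced : ⊥
      misplaced with <-cmp kQ kN
      ... | tri< r _ _ = no213 kQ (suc kN) kP (<-trans r (n<1+n kN)) skN<kP kPM (subst (x <_) (sym okQ) x<T2)
                       (subst₂ _<_ (sym okQ) (sym okP) ≤-refl)
      ... | tri≈ _ r _ = <-irrefl (trans (sym okQ) (trans (cong o r) okN)) (m<n⇒m<1+n (n<1+n _))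
      ... | tri> _ _ kN<kQ with <-cmp kQ kP
      ...   | tri≈ _ r _ = <-irrefl (trans (sym okQ) (trans (cong o r) okP)) ≤-refl
      ...   | tri< r _ _ = x≢T2 (trans (cong o (sym (≤-antisym (≤-pred (subst (kQ <_) kP≡ r)) kN<kQ))) okQ)
      ...   | tri> _ _ kP<kQ with <-cmp (suc kP) kQ
      ...     | tri≈ _ r _ = <-irrefl refl (<-trans (subst (_< x) (trans πT1 (trans (cong o r) okQ)) u<x) x<T2)
      ...     | tri> _ _ r = <-irrefl refl (<-≤-trans r kP<kQ)
      ...     | tri< r _ _ = no213 (suc kN) (suc kP) kQ (s≤s kN<kP) r kQM (subst (_< x) πT1 u<x) (subst (x <_) (sym okQ) x<T2)

    T→T2→T1 : π T ≡ T2 × π T2 ≡ T1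
    T→T2→T1 = trans πT x≡T2 , trans (cong π (sym x≡T2)) (trans (cong (λ z → π (o z)) gap-one) πq')

  top-shape : (π T1 ≡ T) ⊎ (π T ≡ T1) ⊎ (π T ≡ T2 × π T2 ≡ T1)
  top-shape with <-cmp kP kN
  ... | tri< kP<kN _ _ = inj₁ (T1-before-T kP<kN)
  ... | tri≈ _ e _ = ⊥-elim (T≢T1 (trans (sym okN) (trans (cong o (sym e)) okP)))
  ... | tri> _ _ kN<kP with <-cmp (suc kN) kP
  ...   | tri≈ _ e _ = inj₂ (inj₁ (trans (cong π (sym okN)) (trans (cong o e) okP)))
  ...   | tri> _ _ g = ⊥-elim (<-irrefl refl (<-≤-trans g kN<kP))
  ...   | tri< skN<kP _ _ = inj₂ (inj₂ (Gap.T→T2→T1 kN<kP skN<kP))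

module Shape312 (q : ℕ) (w : List ℕ) (G : Good ρ312 (suc (suc (suc q))) w) (q1 : 1 ≤ q) where
  open TopValues ρ312 q w G q1

  no312 : ∀ t1 t2 t3 → t1 < t2 → t2 < t3 → t3 < M → o t2 < o t3 → o t3 < o t1 → ⊥
  no312 t1 t2 t3 p12 p23 p3 bc ca = noρ (t1 , t2 , t3 , p12 , p23 , p3 , iso312⁺ bc ca)

  -- Anything strictly between T and T1 in the cycle would be smaller than T1: a 312.
  T-before-T1 : kN < kP → π T ≡ T1
  T-before-T1 kN<kP with <-cmp (suc kN) kP
  ... | tri≈ _ e _ = trans (cong π (sym okN)) (trans (cong o e) okP)
  ... | tri> _ _ g = ⊥-elim (<-irrefl refl (<-≤-trans g kN<kP))
  ... | tri< l _ _ = ⊥-elim (no312 kN (suc kN) kP ≤-refl l kPM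
                  (subst (o (suc kN) <_) (sym okP) (oLow (suc kN) (<-trans l kPM) (λ e → <-irrefl (sym e) ≤-refl) (λ e → <-irrefl e l)))
                  (subst₂ _<_ (sym okP) (sym okN) ≤-refl))

  -- The cycle reads … u' T1 q' … x' T …, with at least one point between T1 and T.
  module Gap (kP<kN : kP < kN) (skP<kN : suc kP < kN) where
    q' = o (suc kP)
    x' = o (pred kN)
    u' = o (pred kP)
    πT1 : π T1 ≡ q'
    πT1 = cong π (sym okP)
    πx' : π x' ≡ T
    πx' = trans (πo' kN kN1) okN
    πu' : π u' ≡ T1
    πu' = trans (πo' kP kP1) okP
    pkP = pk kP kP1
    pkN = pk kN kN1
    pkPM = <-trans pkP kPM
    pkNM = <-trans pkN kNM
    skPM = <-trans skP<kN kNM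
    kP<pkN : kP < pred kN
    kP<pkN = ≤-pred (subst (suc kP <_) (sym (idx1 kN kN1)) skP<kN)
    q'<T1 : q' < T1
    q'<T1 = oLow (suc kP) skPM (λ e → <-irrefl e skP<kN) (λ e → <-irrefl (sym e) ≤-refl)
    x'<T1 : x' < T1
    x'<T1 = oLow (pred kN) pkNM (λ e → <-irrefl e pkN) (λ e → <-irrefl (sym e) kP<pkN)

    πT<q' : π T < q'
    πT<q' with <-cmp (suc kN) M
    ... | tri> _ _ g = ⊥-elim (<-irrefl refl (<-≤-trans g kNM))
    ... | tri≈ _ e _ = subst (_< q') (sym (trans (cong π (sym okN)) (trans (cong o e) close)))
                   (≤∧≢⇒< (proj₁ (rngo (suc kP))) (λ e → 0≢1+n (cyc 0 (suc kP) (s≤s z≤n) skPM e)))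
    ... | tri< skNM _ _ with <-cmp (π T) q'
    ...   | tri< r _ _ = r
    ...   | tri≈ _ e _ = ⊥-elim (<-irrefl (sym (suc-injective (cyc (suc kN) (suc kP) skNM skPM (trans (sym (cong π (sym okN))) e)))) kP<kN)
    ...   | tri> _ _ r = ⊥-elim (no312 kP (suc kP) (suc kN) ≤-refl (s≤s kP<kN) skNM (subst (q' <_) (cong π (sym okN)) r)
                  (subst (o (suc kN) <_) (sym okP) (oLow (suc kN) skNM (λ e → <-irrefl (sym e) ≤-refl)
                     (λ e → <-irrefl (sym e) (<-trans kP<kN (n<1+n kN))))))

    -- Otherwise x' u' T1 T carry the values T T1 q' (π T), a 4321.
    u'<x' : u' < x'
    u'<x' with <-cmp x' u'
    ... | tri> _ _ r = r
    ... | tri≈ _ e _ = ⊥-elim (<-irrefl (sym (cyc (pred kN) (pred kP) pkNM pkPM e))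
                   (≤-pred (subst₂ _<_ (sym (idx1 kP kP1)) (sym (idx1 kN kN1)) kP<kN)))
    ... | tri< x'<u' _ _ = ⊥-elim (no4321 (mk4 P4321 x' u' T1 T (proj₁ (rngo (pred kN))) x'<u' u'<T1 ≤-refl ≤-refl
            (iso4321⁺ (subst₂ _<_ (sym πu') (sym πx') ≤-refl) (subst₂ _<_ (sym πT1) (sym πu') q'<T1) (subst (π T <_) (sym πT1) πT<q'))))
      where
      u'<T1 : u' < T1
      u'<T1 = oLow (pred kP) pkPM (λ e → <-irrefl e (<-trans pkP kP<kN)) (λ e → <-irrefl e pkP)

    -- Otherwise u' x' y T1, with y the point before x' in the cycle, carry the values T1 T x' q', a 3412.
    gap-one : suc kP ≡ pred kN
    gap-one with <-cmp (suc kP) (pred kN)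
    ... | tri≈ _ e _ = e
    ... | tri> _ _ g = ⊥-elim (<-irrefl refl (<-≤-trans g kP<pkN))
    ... | tri< l _ _ = ⊥-elim (no3412 (mk4 P3412 u' x' y T1 (proj₁ (rngo (pred kP))) u'<x' x'<y y<T1 (n≤1+n _)
              (iso3412⁺ (subst₂ _<_ (sym πy) (sym πT1) x'<q') (subst₂ _<_ (sym πT1) (sym πu') q'<T1) (subst₂ _<_ (sym πu') (sym πx') ≤-refl))))
      where
      pkN1 : 1 ≤ pred kN
      pkN1 = ≤-trans (s≤s z≤n) l
      ppkN = pred (pred kN)
      y = o ppkN
      πy : π y ≡ x'
      πy = πo' (pred kN) pkN1
      ppk<pk : ppkN < pred kN
      ppk<pk = pk (pred kN) pkN1
      kP<ppk : kP < ppkN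
      kP<ppk = ≤-pred (subst (suc kP <_) (sym (idx1 (pred kN) pkN1)) l)
      ppkM = <-trans ppk<pk pkNM
      x'<y : x' < y
      x'<y with <-cmp x' y
      ... | tri< r _ _ = r
      ... | tri≈ _ e _ = ⊥-elim (<-irrefl (sym (cyc (pred kN) ppkN pkNM ppkM e)) ppk<pk)
      ... | tri> _ _ r = ⊥-elim (no312 kP ppkN (pred kN) kP<ppk ppk<pk pkNM r (subst (x' <_) (sym okP) x'<T1))
      y<T1 : y < T1
      y<T1 = oLow ppkN ppkM (λ e → <-irrefl e (<-trans ppk<pk pkN)) (λ e → <-irrefl (sym e) kP<ppk)
      x'<q' : x' < q'
      x'<q' with <-cmp x' q'
      ... | tri< r _ _ = r
      ... | tri≈ _ e _ = ⊥-elim (<-irrefl (sym (cyc (pred kN) (suc kP) pkNM skPM e)) l)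
      ... | tri> _ _ r = ⊥-elim (no312 kP (suc kP) (pred kN) ≤-refl l pkNM r (subst (x' <_) (sym okP) x'<T1))

    -- So the cycle reads … u' T1 x' T …; if x' < T2, then wherever T2 sits it closes a 312.
    x'≡T2 : x' ≡ T2
    x'≡T2 with x' ≟ T2
    ... | yes e = e
    ... | no x'≢T2 = ⊥-elim misplaced
      where
      kQs = I T2 (s≤s z≤n) (≤-trans (n≤1+n _) (n≤1+n _))
      kQ = proj₁ kQs
      kQM = proj₁ (proj₂ kQs)
      okQ : o kQ ≡ T2
      okQ = proj₂ (proj₂ kQs)
      q'≡x' : q' ≡ x'
      q'≡x' = cong o gap-one
      x'<T2 : x' < T2
      x'<T2 = ≤∧≢⇒< (≤-pred x'<T1) x'≢T2
      q'<T2 : q' < T2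
      q'<T2 = subst (_< T2) (sym q'≡x') x'<T2
      misplaced : ⊥
      misplaced with <-cmp kQ (suc kP)
      ... | tri> _ _ r = no312 kP (suc kP) kQ ≤-refl r kQM (subst (q' <_) (sym okQ) q'<T2) (subst₂ _<_ (sym okQ) (sym okP) ≤-refl)
      ... | tri≈ _ r _ = x'≢T2 (trans (sym q'≡x') (trans (cong o (sym r)) okQ))
      ... | tri< r _ _ with <-cmp kQ kP
      ...   | tri≈ _ r' _ = <-irrefl (trans (sym okQ) (trans (cong o r') okP)) ≤-refl
      ...   | tri> _ _ r' = <-irrefl refl (<-≤-trans r' (≤-pred r))
      ...   | tri< r' _ _ with <-cmp kQ (pred kP)
      ...     | tri≈ _ r'' _ = <-irrefl refl (<-trans (subst (_< x') (trans (cong o (sym r'')) okQ) u'<x') x'<T2)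
      ...     | tri> _ _ r'' = <-irrefl refl (<-≤-trans r'' (≤-pred (subst (kQ <_) (sym (idx1 kP kP1)) r')))
      ...     | tri< r'' _ _ = no312 kQ (pred kP) (suc kP) r'' (<-trans pkP (n<1+n kP)) skPM
                   (subst (u' <_) (sym q'≡x') u'<x') (subst (q' <_) (sym okQ) q'<T2)

    T1→T2→T : π T1 ≡ T2 × π T2 ≡ T
    T1→T2→T = trans πT1 (trans q'≡x' x'≡T2) , trans (cong π (sym x'≡T2)) πx'
      where
      q'≡x' : q' ≡ x'
      q'≡x' = cong o gap-one

  top-shape : (π T1 ≡ T) ⊎ (π T ≡ T1) ⊎ (π T1 ≡ T2 × π T2 ≡ T)
  top-shape with <-cmp kN kP
  ... | tri< kN<kP _ _ = inj₂ (inj₁ (T-before-T1 kN<kP))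
  ... | tri≈ _ e _ = ⊥-elim (T≢T1 (trans (sym okN) (trans (cong o e) okP)))
  ... | tri> _ _ kP<kN with <-cmp (suc kP) kN
  ...   | tri≈ _ e _ = inj₁ (trans (cong π (sym okP)) (trans (cong o e) okN))
  ...   | tri> _ _ g = ⊥-elim (<-irrefl refl (<-≤-trans g kP<kN))
  ...   | tri< skP<kN _ _ = inj₂ (inj₂ (Gap.T1→T2→T kP<kN skP<kN))

-- delA N x and delB N x remove the value N + 1 from a permutation of [N + 1]; they invert insA x and insB x.
fdA : ℕ → ℕ → List ℕ → ℕ → ℕ
fdA N x w p = ifeq p x (app w (suc N)) (app w p)

fdB : ℕ → ℕ → List ℕ → ℕ → ℕ
fdB N x w p = ifeq (app w p) (suc N) x (app w p)

delA delB : ℕ → ℕ → List ℕ → List ℕ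
delA N x w = build N (fdA N x w)
delB N x w = build N (fdB N x w)

dA-x : ∀ N x w → 1 ≤ x → x ≤ N → app (delA N x w) x ≡ app w (suc N)
dA-x N x w a b = trans (app-build1 N (fdA N x w) x a b) (ifeq-y x x _ _ refl)

dA-o : ∀ N x w p → 1 ≤ p → p ≤ N → p ≢ x → app (delA N x w) p ≡ app w p
dA-o N x w p a b ne = trans (app-build1 N (fdA N x w) p a b) (ifeq-n p x _ _ ne)

dB-hit : ∀ N x w p → 1 ≤ p → p ≤ N → app w p ≡ suc N → app (delB N x w) p ≡ x
dB-hit N x w p a b e = trans (app-build1 N (fdB N x w) p a b) (ifeq-y (app w p) (suc N) _ _ e)

dB-o : ∀ N x w p → 1 ≤ p → p ≤ N → app w p ≢ suc N → app (delB N x w) p ≡ app w p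
dB-o N x w p a b ne = trans (app-build1 N (fdB N x w) p a b) (ifeq-n (app w p) (suc N) _ _ ne)

module DelPerm (N x : ℕ) (w : List ℕ) (PW : IsPerm (suc N) w) (a : 1 ≤ x) (b : x ≤ N) where
  r = perm-rng (suc N) w PW
  inj = perm-inj (suc N) w PW
  lw : length w ≡ suc N
  lw = proj₁ PW
  le1 : ∀ {p} → p ≤ N → p ≤ suc N
  le1 = m≤n⇒m≤1+n
  small : ∀ p → 1 ≤ p → p ≤ suc N → ∀ y → 1 ≤ y → y ≤ suc N → app w y ≡ suc N → p ≢ y → app w p ≤ N
  small p c d y c' d' e ne = ≤-pred (≤∧≢⇒< (proj₂ (r p c d)) (λ e' → ne (inj p y c d c' d' (trans e' (sym e)))))

  module A (wx : app w x ≡ suc N) where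
    v = delA N x w
    lv : length v ≡ N
    lv = length-build N (fdA N x w)
    inv : insA x v ≡ w
    inv = list-ext (insA x v) w (trans (length-insA x v) (trans (cong suc lv) (sym lw))) pt
      where
      pt : ∀ i → i < length (insA x v) → insA x v ! i ≡ w ! i
      pt i il with (suc i) ≟ x | pos-split N (suc i) (subst (suc i ≤_) (trans (length-insA x v) (cong suc lv)) il)
      ... | yes e | _ = trans (subst (λ z → app (insA x v) z ≡ suc (length v)) (sym e) (insA-x x v a (subst (x ≤_) (sym lv) b)))
                             (trans (cong suc lv) (trans (sym wx) (cong (app w) (sym e))))
      ... | no ne | inj₁ e = trans (subst (λ z → app (insA x v) z ≡ app v x) (trans (cong suc lv) (sym e)) (insA-N x v (subst (x ≤_) (sym lv) b)))
                                (trans (dA-x N x w a b) (cong (app w) (sym e)))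
      ... | no ne | inj₂ le = trans (insA-o x v (suc i) (s≤s z≤n) (subst (suc i ≤_) (sym lv) le) ne) (dA-o N x w (suc i) (s≤s z≤n) le ne)
    perm : IsPerm N v
    perm = mkPerm N v lv rng inj'
      where
      val : ∀ p → 1 ≤ p → p ≤ N → (p ≡ x × app v p ≡ app w (suc N)) ⊎ (p ≢ x × app v p ≡ app w p)
      val p c d with p ≟ x
      ... | yes refl = inj₁ (refl , dA-x N p w a b)
      ... | no ne = inj₂ (ne , dA-o N x w p c d ne)
      rng : Rng N v
      rng p c d with val p c d
      ... | inj₁ (_ , e) rewrite e = proj₁ (r (suc N) (s≤s z≤n) ≤-refl) ,
              small (suc N) (s≤s z≤n) ≤-refl x a (le1 b) wx (λ e → <-irrefl (sym e) (s≤s b))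
      ... | inj₂ (ne , e) rewrite e = proj₁ (r p c (le1 d)) , small p c (le1 d) x a (le1 b) wx ne
      inj' : Inj1 N v
      inj' p q c d c' d' e with val p c d | val q c' d'
      ... | inj₁ (refl , _) | inj₁ (refl , _) = refl
      ... | inj₁ (_ , e1) | inj₂ (_ , e2) = ⊥-elim (<-irrefl (sym (inj (suc N) q (s≤s z≤n) ≤-refl c' (le1 d') (trans (sym e1) (trans e e2)))) (s≤s d'))
      ... | inj₂ (_ , e1) | inj₁ (_ , e2) = ⊥-elim (<-irrefl (sym (inj (suc N) p (s≤s z≤n) ≤-refl c (le1 d) (trans (sym e2) (trans (sym e) e1)))) (s≤s d))
      ... | inj₂ (_ , e1) | inj₂ (_ , e2) = inj p q c (le1 d) c' (le1 d') (trans (sym e1) (trans e e2))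

  module B (wN : app w (suc N) ≡ x) where
    v = delB N x w
    lv : length v ≡ N
    lv = length-build N (fdB N x w)
    inv : insB x v ≡ w
    inv = list-ext (insB x v) w (trans (length-insB x v) (trans (cong suc lv) (sym lw))) pt
      where
      pt : ∀ i → i < length (insB x v) → insB x v ! i ≡ w ! i
      pt i il with pos-split N (suc i) (subst (suc i ≤_) (trans (length-insB x v) (cong suc lv)) il)
      ... | inj₁ e = trans (subst (λ z → app (insB x v) z ≡ x) (trans (cong suc lv) (sym e)) (insB-N x v))
                          (trans (sym wN) (cong (app w) (sym e)))
      ... | inj₂ le with (app w (suc i)) ≟ (suc N)
      ...   | yes e = trans (trans (insB-hit x v (suc i) (s≤s z≤n) (subst (suc i ≤_) (sym lv) le) (dB-hit N x w (suc i) (s≤s z≤n) le e)) (cong suc lv)) (sym e)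
      ...   | no ne = trans (insB-o x v (suc i) (s≤s z≤n) (subst (suc i ≤_) (sym lv) le)
                               (λ e → <-irrefl (inj (suc i) (suc N) (s≤s z≤n) (le1 le) (s≤s z≤n) ≤-refl (trans (sym (dB-o N x w (suc i) (s≤s z≤n) le ne)) (trans e (sym wN)))) (s≤s le)))
                         (dB-o N x w (suc i) (s≤s z≤n) le ne)
    perm : IsPerm N v
    perm = mkPerm N v lv rng inj'
      where
      val : ∀ p → 1 ≤ p → p ≤ N → (app w p ≡ suc N × app v p ≡ x) ⊎ (app w p ≢ suc N × app v p ≡ app w p)
      val p c d with (app w p) ≟ (suc N)
      ... | yes e = inj₁ (e , dB-hit N x w p c d e)
      ... | no ne = inj₂ (ne , dB-o N x w p c d ne)
      rng : Rng N v
      rng p c d with val p c d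
      ... | inj₁ (_ , e) rewrite e = a , b
      ... | inj₂ (ne , e) rewrite e = proj₁ (r p c (le1 d)) , below (proj₂ (r p c (le1 d))) ne
        where
        below : ∀ {y z} → y ≤ suc z → y ≢ suc z → y ≤ z
        below p ne = ≤-pred (≤∧≢⇒< p ne)
      inj' : Inj1 N v
      inj' p q c d c' d' e with val p c d | val q c' d'
      ... | inj₁ (h1 , _) | inj₁ (h2 , _) = inj p q c (le1 d) c' (le1 d') (trans h1 (sym h2))
      ... | inj₁ (_ , e1) | inj₂ (_ , e2) = ⊥-elim (<-irrefl (inj q (suc N) c' (le1 d') (s≤s z≤n) ≤-refl (trans (sym e2) (trans (sym e) (trans e1 (sym wN))))) (s≤s d'))
      ... | inj₂ (_ , e1) | inj₁ (_ , e2) = ⊥-elim (<-irrefl (inj p (suc N) c (le1 d) (s≤s z≤n) ≤-refl (trans (sym e1) (trans e (trans e2 (sym wN))))) (s≤s d))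
      ... | inj₂ (_ , e1) | inj₂ (_ , e2) = inj p q c (le1 d) c' (le1 d') (trans (sym e1) (trans e e2))

-- The conditions of Good that deleting the maximum preserves.
CycGood : List ℕ → ℕ → List ℕ → Set
CycGood ρ N v = IsPerm N v × Cyc N v × ¬ OccSeq (orbit v) N ρ

Good⇒CycGood : ∀ {ρ N v} → Good ρ N v → CycGood ρ N v
Good⇒CycGood G = Good.perm G , Good.cyc G , Good.noρ G

delA-CycGood : ∀ ρ N x w → CycGood ρ (suc N) w → 1 ≤ x → x ≤ N → (wx : app w x ≡ suc N) →
  CycGood ρ N (delA N x w)
delA-CycGood ρ N x w (PW , CW , NW) a b wx = PV , CV , NV
  where
  open DelPerm N x w PW a b
  open A wx
  PV = perm
  PW' : IsPerm (suc N) (insA x v)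
  PW' = subst (IsPerm (suc N)) (sym inv) PW
  CW' : Cyc (suc N) (insA x v)
  CW' = subst (Cyc (suc N)) (sym inv) CW
  Ks = orbit-onto (suc N) w PW CW (suc N) (s≤s z≤n) ≤-refl
  K = proj₁ Ks
  Kn : K ≤ N
  Kn = ≤-pred (proj₁ (proj₂ Ks))
  oK : orbit (insA x v) K ≡ suc N
  oK = trans (cong (λ z → orbit z K) inv) (proj₂ (proj₂ Ks))
  h = orbit-skip-insA N x v K lv PW' CW' a b Kn oK
  CV = cyclic-skip N v (insA x v) K CW' Kn h
  NV : ¬ OccSeq (orbit v) N ρ
  NV o = NW (subst (λ z → OccSeq (orbit z) (suc N) ρ) inv (OccSeq-skip (orbit v) (orbit (insA x v)) K N ρ h o))

delB-CycGood : ∀ ρ N x w → CycGood ρ (suc N) w → 1 ≤ x → x ≤ N → (wN : app w (suc N) ≡ x) →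
  CycGood ρ N (delB N x w)
delB-CycGood ρ N x w (PW , CW , NW) a b wN = PV , CV , NV
  where
  open DelPerm N x w PW a b
  open B wN
  PV = perm
  PW' : IsPerm (suc N) (insB x v)
  PW' = subst (IsPerm (suc N)) (sym inv) PW
  CW' : Cyc (suc N) (insB x v)
  CW' = subst (Cyc (suc N)) (sym inv) CW
  Ks = orbit-onto (suc N) w PW CW (suc N) (s≤s z≤n) ≤-refl
  K = proj₁ Ks
  Kn : K ≤ N
  Kn = ≤-pred (proj₁ (proj₂ Ks))
  oK : orbit (insB x v) K ≡ suc N
  oK = trans (cong (λ z → orbit z K) inv) (proj₂ (proj₂ Ks))
  h = orbit-skip-insB N x v K PV PW' CW' a b Kn oK
  CV = cyclic-skip N v (insB x v) K CW' Kn h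
  NV : ¬ OccSeq (orbit v) N ρ
  NV o = NW (subst (λ z → OccSeq (orbit z) (suc N) ρ) inv (OccSeq-skip (orbit v) (orbit (insB x v)) K N ρ h o))

CycGood⇒Good : ∀ ρ N v → CycGood ρ N v → ¬ Occ4 v P4321 → ¬ Occ4 v P3412 → Good ρ N v
CycGood⇒Good ρ N v (P , C , Nρ) a b = record { perm = P ; cyc = C ; no4321 = a ; no3412 = b ; noρ = Nρ }

Result : List ℕ → (List ℕ → List ℕ) → ℕ → List ℕ → Set
Result ρ opC q w = (∃ λ v → Good ρ (suc (suc q)) v × w ≡ opA v) ⊎ (∃ λ v → Good ρ (suc (suc q)) v × w ≡ opB v) ⊎
                   (∃ λ v → Good ρ (suc q) v × w ≡ opC v)

module CompletenessAB (ρ : List ℕ) (q : ℕ) (w : List ℕ) (G : Good ρ (suc (suc (suc q))) w) (q1 : 1 ≤ q) where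
  open TopValues ρ q w G q1
  G0 = Good⇒CycGood G
  caseA : π T1 ≡ T → ∃ λ v → Good ρ T1 v × w ≡ opA v
  caseA e = v , CycGood⇒Good ρ T1 v G0v (λ o → no4321 (subst (λ z → Occ4 z P4321) eqw (Occ4Lift.Occ4-opA (suc q) v PV 4 3 2 1 o)))
                                  (λ o → no3412 (subst (λ z → Occ4 z P3412) eqw (Occ4Lift.Occ4-opA (suc q) v PV 3 4 1 2 o))) , sym eqw
    where
    v = delA T1 T1 w
    G0v = delA-CycGood ρ T1 T1 w G0 (s≤s z≤n) ≤-refl e
    PV = proj₁ G0v
    eqw : opA v ≡ w
    eqw = trans (cong (λ z → insA z v) (proj₁ PV)) (DelPerm.A.inv T1 T1 w perm (s≤s z≤n) ≤-refl e)
  caseB : π T ≡ T1 → ∃ λ v → Good ρ T1 v × w ≡ opB v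
  caseB e = v , CycGood⇒Good ρ T1 v G0v (λ o → no4321 (subst (λ z → Occ4 z P4321) eqw (Occ4Lift.Occ4-opB (suc q) v PV 4 3 2 1 o)))
                                  (λ o → no3412 (subst (λ z → Occ4 z P3412) eqw (Occ4Lift.Occ4-opB (suc q) v PV 3 4 1 2 o))) , sym eqw
    where
    v = delB T1 T1 w
    G0v = delB-CycGood ρ T1 T1 w G0 (s≤s z≤n) ≤-refl e
    PV = proj₁ G0v
    eqw : opB v ≡ w
    eqw = trans (cong (λ z → insB z v) (proj₁ PV)) (DelPerm.B.inv T1 T1 w perm (s≤s z≤n) ≤-refl e)

module Completeness213 (q : ℕ) (w : List ℕ) (q1 : 1 ≤ q) (G : Good ρ213 (suc (suc (suc q))) w) where
  open TopValues ρ213 q w G q1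
  open CompletenessAB ρ213 q w G q1
  open Shape213 q w G q1 using (top-shape)
  caseC : π T ≡ T2 → π T2 ≡ T1 → ∃ λ v → Good ρ213 T2 v × w ≡ opAC v
  caseC e1 e2 = v , CycGood⇒Good ρ213 T2 v G0v (λ o → no4321 (subst (λ z → Occ4 z P4321) eqw (Occ4Lift.Occ4-opAC q v PV 4 3 2 1 o)))
                                  (λ o → no3412 (subst (λ z → Occ4 z P3412) eqw (Occ4Lift.Occ4-opAC q v PV 3 4 1 2 o))) , sym eqw
    where
    T2≤T1 : T2 ≤ T1
    T2≤T1 = n≤1+n _
    u = delB T1 T2 w
    G0u = delB-CycGood ρ213 T1 T2 w G0 (s≤s z≤n) T2≤T1 e1
    PU = proj₁ G0u
    uT2 : app u T2 ≡ T1
    uT2 = trans (dB-o T1 T2 w T2 (s≤s z≤n) T2≤T1 (λ e → <-irrefl (trans (sym e2) e) (n<1+n _))) e2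
    v = delA T2 T2 u
    G0v = delA-CycGood ρ213 T2 T2 u G0u (s≤s z≤n) ≤-refl uT2
    PV = proj₁ G0v
    eqw : opAC v ≡ w
    eqw = trans (cong (λ z → insB z (insA z v)) (proj₁ PV))
            (trans (cong (insB T2) (DelPerm.A.inv T2 T2 u PU (s≤s z≤n) ≤-refl uT2))
                   (DelPerm.B.inv T1 T2 w perm (s≤s z≤n) T2≤T1 e1))
  complete : Result ρ213 opAC q w
  complete with top-shape
  ... | inj₁ e = inj₁ (caseA e)
  ... | inj₂ (inj₁ e) = inj₂ (inj₁ (caseB e))
  ... | inj₂ (inj₂ (e1 , e2)) = inj₂ (inj₂ (caseC e1 e2))

module Completeness312 (q : ℕ) (w : List ℕ) (q1 : 1 ≤ q) (G : Good ρ312 (suc (suc (suc q))) w) where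
  open TopValues ρ312 q w G q1
  open CompletenessAB ρ312 q w G q1
  open Shape312 q w G q1 using (top-shape)
  caseC : π T1 ≡ T2 → π T2 ≡ T → ∃ λ v → Good ρ312 T2 v × w ≡ opD v
  caseC e1 e2 = v , CycGood⇒Good ρ312 T2 v G0v (λ o → no4321 (subst (λ z → Occ4 z P4321) eqw (Occ4Lift.Occ4-opD q v PV 4 3 2 1 o)))
                                  (λ o → no3412 (subst (λ z → Occ4 z P3412) eqw (Occ4Lift.Occ4-opD q v PV 3 4 1 2 o))) , sym eqw
    where
    T2≤T1 : T2 ≤ T1
    T2≤T1 = n≤1+n _
    u = delA T1 T2 w
    G0u = delA-CycGood ρ312 T1 T2 w G0 (s≤s z≤n) T2≤T1 e2
    PU = proj₁ G0u
    uT1 : app u T1 ≡ T2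
    uT1 = trans (dA-o T1 T2 w T1 (s≤s z≤n) ≤-refl (λ e → <-irrefl (sym e) (n<1+n _))) e1
    v = delB T2 T2 u
    G0v = delB-CycGood ρ312 T2 T2 u G0u (s≤s z≤n) ≤-refl uT1
    PV = proj₁ G0v
    eqw : opD v ≡ w
    eqw = trans (cong (λ z → insA z (insB z v)) (proj₁ PV))
            (trans (cong (insA T2) (DelPerm.B.inv T2 T2 u PU (s≤s z≤n) ≤-refl uT1))
                   (DelPerm.A.inv T1 T2 w perm (s≤s z≤n) T2≤T1 e2))
  complete : Result ρ312 opD q w
  complete with top-shape
  ... | inj₁ e = inj₁ (caseA e)
  ... | inj₂ (inj₁ e) = inj₂ (inj₁ (caseB e))
  ... | inj₂ (inj₂ (e1 , e2)) = inj₂ (inj₂ (caseC e1 e2))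

top-not-fixed : ∀ ρ m v → 1 ≤ m → Good ρ (suc m) v → v ! m ≢ suc m
top-not-fixed ρ m v m1 G e = <-irrefl (cyc (pred k) k (<-trans pk kn) kn pe) pk
  where
  open GoodFacts ρ m v G m1
  pk : pred k < k
  pk with k | k1
  ... | suc _ | _ = ≤-refl
  ik : suc (pred k) ≡ k
  ik with k | k1
  ... | suc _ | _ = refl
  r = orbit-range n v perm n1
  pe : orbit v (pred k) ≡ orbit v k
  pe = trans (perm-inj n v perm (orbit v (pred k)) n (proj₁ (r (pred k))) (proj₂ (r (pred k))) (s≤s z≤n) ≤-refl
                (trans (cong (orbit v) ik) (trans ok' (sym e)))) (sym ok')

bump-injective : ∀ x N → x < N → ∀ y z → y ≤ x → z ≤ x → bump x N y ≡ bump x N z → y ≡ z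
bump-injective x N xN y z yx zx e with <-cmp y z
... | tri< p _ _ = ⊥-elim (<-irrefl e (bump-mono x N xN y z yx zx p))
... | tri≈ _ p _ = p
... | tri> _ _ p = ⊥-elim (<-irrefl (sym e) (bump-mono x N xN z y zx yx p))

bump-top : ∀ x y → y ≤ x → bump x (suc x) y ≡ suc x → y ≡ x
bump-top x y yx e with y ≟ x
... | yes p = p
... | no ne = ⊥-elim (<-irrefl (trans (sym (bump-other x (suc x) y ne)) e) (s≤s yx))

module Injectivity (m : ℕ) (v v' : List ℕ) (P : IsPerm (suc m) v) (P' : IsPerm (suc m) v') where
  module T = Tables m v (proj₁ P)
  module T' = Tables m v' (proj₁ P')
  n = suc m
  len : length v ≡ length v'
  len = trans (proj₁ P) (sym (proj₁ P'))
  il : ∀ {i} → i < length v → i < n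
  il {i} p = subst (i <_) (proj₁ P) p
  b : ∀ i → i < n → v ! i ≤ n
  b = perm-le n v P
  b' : ∀ i → i < n → v' ! i ≤ n
  b' = perm-le n v' P'
  ext : (∀ i → i < m → v ! i ≡ v' ! i) → v ! m ≡ v' ! m → v ≡ v'
  ext h hm = list-ext v v' len λ i p → case i p
    where
    case : ∀ i → i < length v → v ! i ≡ v' ! i
    case i p with <-cmp i m
    ... | tri< q _ _ = h i q
    ... | tri≈ _ refl _ = hm
    ... | tri> _ _ q = ⊥-elim (<-irrefl refl (<-≤-trans q (≤-pred (il p))))
  opA-injective : opA v ≡ opA v' → v ≡ v'
  opA-injective e = ext (λ i q → trans (sym (T.A-lt i q)) (trans (cong (_! i) e) (T'.A-lt i q)))
               (trans (sym T.A-sm) (trans (cong (_! suc m) e) T'.A-sm))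
  opB-injective : opB v ≡ opB v' → v ≡ v'
  opB-injective e = ext (λ i q → bump-injective n (suc n) ≤-refl _ _ (b i (m<n⇒m<1+n q)) (b' i (m<n⇒m<1+n q))
                  (trans (sym (T.B-le i (m<n⇒m<1+n q))) (trans (cong (_! i) e) (T'.B-le i (m<n⇒m<1+n q)))))
               (bump-injective n (suc n) ≤-refl _ _ (b m ≤-refl) (b' m ≤-refl) (trans (sym (T.B-le m ≤-refl)) (trans (cong (_! m) e) (T'.B-le m ≤-refl))))
  opAC-injective : opAC v ≡ opAC v' → v ≡ v'
  opAC-injective e = ext (λ i q → bump-injective n (suc (suc n)) (<-trans (n<1+n n) (n<1+n _)) _ _ (b i (m<n⇒m<1+n q)) (b' i (m<n⇒m<1+n q))
                  (trans (sym (T.AC-lt i q)) (trans (cong (_! i) e) (T'.AC-lt i q))))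
               (bump-injective n (suc (suc n)) (<-trans (n<1+n n) (n<1+n _)) _ _ (b m ≤-refl) (b' m ≤-refl) (trans (sym T.AC-sm) (trans (cong (_! suc m) e) T'.AC-sm)))
  opD-injective : opD v ≡ opD v' → v ≡ v'
  opD-injective e = ext (λ i q → bump-injective n (suc n) ≤-refl _ _ (b i (m<n⇒m<1+n q)) (b' i (m<n⇒m<1+n q))
                  (trans (sym (T.D-lt i q)) (trans (cong (_! i) e) (T'.D-lt i q))))
               (bump-injective n (suc n) ≤-refl _ _ (b m ≤-refl) (b' m ≤-refl) (trans (sym T.D-ssm) (trans (cong (_! suc (suc m)) e) T'.D-ssm)))

module Disjointness {ρ : List ℕ} (q : ℕ) (v v' : List ℕ) (q1 : 1 ≤ q) where

  opA≢opB : Good ρ (suc (suc q)) v → Good ρ (suc (suc q)) v' → opA v ≢ opB v'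
  opA≢opB G G' e = top-not-fixed ρ (suc q) v' (s≤s z≤n) G' (bump-top _ _ (perm-le _ v' (Good.perm G') (suc q) ≤-refl)
                     (trans (sym (T'.B-le (suc q) ≤-refl)) (trans (cong (_! suc q) (sym e)) T.A-m)))
    where
    module T = Tables (suc q) v (proj₁ (Good.perm G))
    module T' = Tables (suc q) v' (proj₁ (Good.perm G'))

  opA≢opAC : Good ρ (suc (suc q)) v → Good ρ (suc q) v' → opA v ≢ opAC v'
  opA≢opAC G G' e = top-not-fixed ρ q v' q1 G' (bump-top2 (perm-le _ v' (Good.perm G') q ≤-refl)
                     (trans (sym T'.AC-sm) (trans (cong (_! suc q) (sym e)) T.A-m)))
    where
    module T = Tables (suc q) v (proj₁ (Good.perm G))
    module T' = Tables q v' (proj₁ (Good.perm G'))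
    bump-top2 : ∀ {y} → y ≤ suc q → bump (suc q) (suc (suc (suc q))) y ≡ suc (suc (suc q)) → y ≡ suc q
    bump-top2 {y} yx e with y ≟ suc q
    ... | yes p = p
    ... | no ne = ⊥-elim (<-irrefl (trans (sym (bump-other (suc q) _ y ne)) e) (s≤s (≤-trans yx (n≤1+n _))))

  opB≢opAC : Good ρ (suc (suc q)) v → Good ρ (suc q) v' → opB v ≢ opAC v'
  opB≢opAC G G' e = <-irrefl (sym (trans (sym T.B-n) (trans (cong (_! suc (suc q)) e) T'.AC-ssm))) ≤-refl
    where
    module T = Tables (suc q) v (proj₁ (Good.perm G))
    module T' = Tables q v' (proj₁ (Good.perm G'))

  opA≢opD : Good ρ (suc (suc q)) v → Good ρ (suc q) v' → opA v ≢ opD v'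
  opA≢opD G G' e = <-irrefl (trans (sym T'.D-sm) (trans (cong (_! suc q) (sym e)) T.A-m)) (m<n⇒m<1+n (n<1+n _))
    where
    module T = Tables (suc q) v (proj₁ (Good.perm G))
    module T' = Tables q v' (proj₁ (Good.perm G'))

  opB≢opD : Good ρ (suc (suc q)) v → Good ρ (suc q) v' → opB v ≢ opD v'
  opB≢opD G G' e = top-not-fixed ρ q v' q1 G' (bump-top _ _ (perm-le _ v' (Good.perm G') q ≤-refl)
                     (trans (sym T'.D-ssm) (trans (cong (_! suc (suc q)) (sym e)) T.B-n)))
    where
    module T = Tables (suc q) v (proj₁ (Good.perm G))
    module T' = Tables q v' (proj₁ (Good.perm G'))

unique-map-on : ∀ {A B : Set} (f : A → B) xs → Unique xs →
  (∀ {x y} → x ∈ xs → y ∈ xs → f x ≡ f y → x ≡ y) → Unique (map f xs)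
unique-map-on f [] _ _ = []
unique-map-on f (x ∷ xs) (x∉xs ∷ u) inj =
  fx∉ xs x∉xs (λ y∈ → inj (here refl) (there y∈)) ∷ unique-map-on f xs u (λ p q → inj (there p) (there q))
  where
  fx∉ : ∀ ys → All (x ≢_) ys → (∀ {y} → y ∈ ys → f x ≡ f y → x ≡ y) → All (f x ≢_) (map f ys)
  fx∉ [] [] _ = []
  fx∉ (y ∷ ys) (x≢y ∷ ps) g = (λ e → x≢y (g (here refl) e)) ∷ fx∉ ys ps (λ y∈ → g (there y∈))

module Recurrence (ρ1 ρ2 ρ3 : ℕ) (opC : List ℕ → List ℕ)
  (soundA : ∀ m v → 1 ≤ m → Good (ρ1 ∷ ρ2 ∷ ρ3 ∷ []) (suc m) v → Good (ρ1 ∷ ρ2 ∷ ρ3 ∷ []) (suc (suc m)) (opA v))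
  (soundB : ∀ m v → 1 ≤ m → Good (ρ1 ∷ ρ2 ∷ ρ3 ∷ []) (suc m) v → Good (ρ1 ∷ ρ2 ∷ ρ3 ∷ []) (suc (suc m)) (opB v))
  (soundC : ∀ m v → 1 ≤ m → Good (ρ1 ∷ ρ2 ∷ ρ3 ∷ []) (suc m) v → Good (ρ1 ∷ ρ2 ∷ ρ3 ∷ []) (suc (suc (suc m))) (opC v))
  (complete : ∀ q w → 1 ≤ q → Good (ρ1 ∷ ρ2 ∷ ρ3 ∷ []) (suc (suc (suc q))) w → Result (ρ1 ∷ ρ2 ∷ ρ3 ∷ []) opC q w)
  (opC-injective : ∀ m v v' → IsPerm (suc m) v → IsPerm (suc m) v' → opC v ≡ opC v' → v ≡ v')
  (opA≢opC : ∀ q v v' → 1 ≤ q → Good (ρ1 ∷ ρ2 ∷ ρ3 ∷ []) (suc (suc q)) v → Good (ρ1 ∷ ρ2 ∷ ρ3 ∷ []) (suc q) v' → opA v ≢ opC v')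
  (opB≢opC : ∀ q v v' → 1 ≤ q → Good (ρ1 ∷ ρ2 ∷ ρ3 ∷ []) (suc (suc q)) v → Good (ρ1 ∷ ρ2 ∷ ρ3 ∷ []) (suc q) v' → opB v ≢ opC v')
  where

  ρ : List ℕ
  ρ = ρ1 ∷ ρ2 ∷ ρ3 ∷ []

  L : ℕ → List (List ℕ)
  L M = 𝒜 M σs ρ

  unique-L : ∀ M → Unique (L M)
  unique-L M = unique-boolFilter _ (perms M) (unique-perms M)

  ∈L⇒Good : ∀ M {w} → w ∈ L M → Good ρ M w
  ∈L⇒Good M {w} = 𝒜⇒Good M ρ1 ρ2 ρ3 w

  Good⇒∈L : ∀ {M w} → Good ρ M w → w ∈ L M
  Good⇒∈L {M} {w} = Good⇒𝒜 M ρ1 ρ2 ρ3 w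

  module _ (q : ℕ) (q1 : 1 ≤ q) where

    L₃ L₂ L₁ : List (List ℕ)
    L₃ = L (suc (suc (suc q)))
    L₂ = L (suc (suc q))
    L₁ = L (suc q)

    generated : List (List ℕ)
    generated = map opA L₂ ++ map opB L₂ ++ map opC L₁

    unique-generated : Unique generated
    unique-generated = Uniqueₚ.++⁺ uniqueA (Uniqueₚ.++⁺ uniqueB uniqueC B∩C) A∩BC
      where
      perm : ∀ M {v} → v ∈ L M → IsPerm M v
      perm M p = Good.perm (∈L⇒Good M p)
      uniqueA : Unique (map opA L₂)
      uniqueA = unique-map-on opA L₂ (unique-L (suc (suc q))) λ p p' → Injectivity.opA-injective (suc q) _ _ (perm (suc (suc q)) p) (perm (suc (suc q)) p')
      uniqueB : Unique (map opB L₂)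
      uniqueB = unique-map-on opB L₂ (unique-L (suc (suc q))) λ p p' → Injectivity.opB-injective (suc q) _ _ (perm (suc (suc q)) p) (perm (suc (suc q)) p')
      uniqueC : Unique (map opC L₁)
      uniqueC = unique-map-on opC L₁ (unique-L (suc q)) λ p p' → opC-injective q _ _ (perm (suc q) p) (perm (suc q) p')
      B∩C : Disjoint (map opB L₂) (map opC L₁)
      B∩C (p , p') with ∈-map⁻ opB p | ∈-map⁻ opC p'
      ... | v , v∈ , refl | v' , v'∈ , e = opB≢opC q v v' q1 (∈L⇒Good (suc (suc q)) v∈) (∈L⇒Good (suc q) v'∈) e
      A∩BC : Disjoint (map opA L₂) (map opB L₂ ++ map opC L₁)
      A∩BC (p , p') with ∈-map⁻ opA p | ∈-++⁻ (map opB L₂) p'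
      ... | v , v∈ , refl | inj₁ p'' with ∈-map⁻ opB p''
      ...   | v' , v'∈ , e = Disjointness.opA≢opB q v v' q1 (∈L⇒Good (suc (suc q)) v∈) (∈L⇒Good (suc (suc q)) v'∈) e
      A∩BC (p , p') | v , v∈ , refl | inj₂ p'' with ∈-map⁻ opC p''
      ...   | v' , v'∈ , e = opA≢opC q v v' q1 (∈L⇒Good (suc (suc q)) v∈) (∈L⇒Good (suc q) v'∈) e

    L₃⊆generated : L₃ ⊆ generated
    L₃⊆generated {w} p with complete q w q1 (∈L⇒Good (suc (suc (suc q))) p)
    ... | inj₁ (v , g , refl) = ∈-++⁺ˡ (∈-map⁺ opA (Good⇒∈L g))
    ... | inj₂ (inj₁ (v , g , refl)) = ∈-++⁺ʳ (map opA L₂) (∈-++⁺ˡ (∈-map⁺ opB (Good⇒∈L g)))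
    ... | inj₂ (inj₂ (v , g , refl)) = ∈-++⁺ʳ (map opA L₂) (∈-++⁺ʳ (map opB L₂) (∈-map⁺ opC (Good⇒∈L g)))

    generated⊆L₃ : generated ⊆ L₃
    generated⊆L₃ p with ∈-++⁻ (map opA L₂) p
    ... | inj₁ p' with ∈-map⁻ opA p'
    ...   | v , v∈ , refl = Good⇒∈L (soundA (suc q) v (s≤s z≤n) (∈L⇒Good (suc (suc q)) v∈))
    generated⊆L₃ p | inj₂ p' with ∈-++⁻ (map opB L₂) p'
    ...   | inj₁ p'' with ∈-map⁻ opB p''
    ...     | v , v∈ , refl = Good⇒∈L (soundB (suc q) v (s≤s z≤n) (∈L⇒Good (suc (suc q)) v∈))
    generated⊆L₃ p | inj₂ p' | inj₂ p'' with ∈-map⁻ opC p''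
    ...     | v , v∈ , refl = Good⇒∈L (soundC q v q1 (∈L⇒Good (suc q) v∈))

    length-L-step : length L₃ ≡ length L₂ + (length L₂ + length L₁)
    length-L-step = begin
      length L₃
        ≡⟨ unique-⊆-⊇-length L₃ generated (unique-L (suc (suc (suc q)))) unique-generated L₃⊆generated generated⊆L₃ ⟩
      length generated
        ≡⟨ length-++ (map opA L₂) ⟩
      length (map opA L₂) + length (map opB L₂ ++ map opC L₁)
        ≡⟨ cong₂ _+_ (length-map opA L₂) (trans (length-++ (map opB L₂)) (cong₂ _+_ (length-map opB L₂) (length-map opC L₁))) ⟩
      length L₂ + (length L₂ + length L₁) ∎
      where open ≡-Reasoning

  length-L≡pell : length (L 2) ≡ 1 → length (L 3) ≡ 2 → ∀ n → length (L (suc (suc n))) ≡ pell (suc n)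
  length-L≡pell L2 L3 zero = L2
  length-L≡pell L2 L3 (suc zero) = L3
  length-L≡pell L2 L3 (suc (suc n)) = begin
    length (L (4 + n))                                    ≡⟨ length-L-step (suc n) (s≤s z≤n) ⟩
    length (L (3 + n)) + (length (L (3 + n)) + length (L (2 + n)))
      ≡⟨ cong₂ (λ x y → x + (x + y)) (length-L≡pell L2 L3 (suc n)) (length-L≡pell L2 L3 n) ⟩
    pell (2 + n) + (pell (2 + n) + pell (1 + n))          ≡⟨ +-assoc (pell (2 + n)) (pell (2 + n)) (pell (1 + n)) ⟨
    pell (2 + n) + pell (2 + n) + pell (1 + n)            ≡⟨ cong (λ x → pell (2 + n) + x + pell (1 + n)) (+-identityʳ (pell (2 + n))) ⟨
    pell (3 + n)                                          ∎
    where open ≡-Reasoning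

module Recurrence213 = Recurrence 2 1 3 opAC sound-A213 sound-B213 sound-AC213 Completeness213.complete
  Injectivity.opAC-injective Disjointness.opA≢opAC Disjointness.opB≢opAC
module Recurrence312 = Recurrence 3 1 2 opD sound-A312 sound-B312 sound-D312 Completeness312.complete
  Injectivity.opD-injective Disjointness.opA≢opD Disjointness.opB≢opD

theorem3p8 : (n : ℕ) → 2 ≤ n →
    (a n ((3 ∷ 4 ∷ 1 ∷ 2 ∷ []) ∷ (4 ∷ 3 ∷ 2 ∷ 1 ∷ []) ∷ []) (2 ∷ 1 ∷ 3 ∷ []) ≡ pell (n ∸ 1))
    × (a n ((3 ∷ 4 ∷ 1 ∷ 2 ∷ []) ∷ (4 ∷ 3 ∷ 2 ∷ 1 ∷ []) ∷ []) (3 ∷ 1 ∷ 2 ∷ []) ≡ pell (n ∸ 1))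
theorem3p8 (suc zero) (s≤s ())
theorem3p8 (suc (suc n)) _ = Recurrence213.length-L≡pell refl refl n , Recurrence312.length-L≡pell refl refl n
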